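{- For a composition $\alpha\models n$, the fundamental quasisymmetric function expands as $$F_\alpha=\sum_\beta L^{ -1}_{\alpha,\beta}\,\mathfrak{S}^*_\beta,\qquad L^{ -1}_{\alpha,\beta}=\sum_{\mathcal{P}}(-1)^{\ell(\mathcal{P})}prod(\mathcal{P}),$$ where the first sum runs over all compositions $\beta$ reachable from $\alpha$ in the immaculate descent graph $\mathfrak{D}^n$ and the second over all directed paths $\mathcal{P}$ from $\alpha$ to $\beta$ in $\mathfrak{D}^n$.
   Context: $QSym$ is the algebra of quasisymmetric functions with monomial basis $M_\alpha$ and fundamental basis $F_\alpha=\sum_{\beta\preceq\alpha}M_\beta$ ($\preceq$ the refinement order on compositions). For a composition $\alpha=(\alpha_1,\dots,\alpha_k)$, an immaculate tableau of shape $\alpha$ is a filling of the left-justified diagram with rows of lengths $\alpha_1,\dots,\alpha_k$ (row 1 on top) by positive integers, weakly increasing left to right in rows and strictly increasing top to bottom in the first column; if $\beta_i$ boxes contain $i$, set $x^T=\prod_i x_i^{\beta_i}$; the dual immaculate function is $\mathfrak{S}^*_\alpha=\sum_T x^T$ over immaculate tableaux of shape $\alpha$. A standard immaculate tableau of shape $\alpha\models n$ uses $1,\dots,n$ once each; it has a descent at $i$ if $i+1$ is in a strictly lower row than $i$; its descent composition is the composition of $n$ whose partial-sum set is the descent set. $L_{\alpha,\beta}$ is the number of standard immaculate tableaux of shape $\alpha$ with descent composition $\beta$. The immaculate descent graph $\mathfrak{D}^n$ is the edge-weighted directed simple graph whose vertices are the compositions of $n$, with an edge $\alpha\to\beta$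 ($\beta\ne\alpha$) whenever some standard immaculate tableau of shape $\alpha$ has descent composition $\beta$, weighted by $L_{\alpha,\beta}$. For a directed path $\mathcal{P}$, $\ell(\mathcal{P})$ is its number of edges and $prod(\mathcal{P})$ the product of its weights; the empty path has $\ell=0$, $prod=1$; $\beta$ is reachable from $\alpha$ if a directed path from $\alpha$ to $\beta$ exists (including $\beta=\alpha$). -}

module Defs where

open import Data.Bool using (Bool; true; false; _∧_; not; if_then_else_)
open import Data.Nat using (ℕ; zero; suc; _+_; _∸_; _<_; _≤ᵇ_; _<ᵇ_; _≡ᵇ_; _≟_)
open import Data.Integer as ℤ using (ℤ; +_)
open import Data.List using (List; []; _∷_; [_]; map; concat; concatMap; filterᵇ; length;
  null; applyUpTo; upTo; replicate)
open import Data.Bool.ListAction using (all; any)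
open import Data.Nat.ListAction using (sum)
open import Data.List.Properties using (≡-dec)
open import Data.List.Relation.Unary.All using (All)
open import Data.Product using (_×_; _,_)
open import Relation.Nullary.Decidable using (⌊_⌋)
open import Relation.Binary.PropositionalEquality using (_≡_)

_==ₗ_ : List ℕ → List ℕ → Bool
xs ==ₗ ys = ⌊ ≡-dec _≟_ xs ys ⌋

_==ₗₗ_ : List (List ℕ) → List (List ℕ) → Bool
xs ==ₗₗ ys = ⌊ ≡-dec (≡-dec _≟_) xs ys ⌋

elemₗ : List ℕ → List (List ℕ) → Bool
elemₗ x = any (λ y → x ==ₗ y)

elem : ℕ → List ℕ → Bool
elem i = any (λ j → i ≡ᵇ j)

listsOf : {A : Set} → List A → ℕ → List (List A)
listsOf xs zero    = [ [] ]
listsOf xs (suc k) = concatMap (λ x → map (x ∷_) (listsOf xs k)) xs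

oneTo : ℕ → List ℕ
oneTo N = applyUpTo suc N

sumℤ : List ℤ → ℤ
sumℤ []       = + 0
sumℤ (x ∷ xs) = x ℤ.+ sumℤ xs

IsComp : ℕ → List ℕ → Set
IsComp n α = All (λ a → 0 < a) α × sum α ≡ n

-- the (finite) list of all compositions of n
-- (every composition of n has length ≤ n and parts in [1..n])
comps : ℕ → List (List ℕ)
comps n = filterᵇ (λ β → sum β ≡ᵇ n) (concatMap (listsOf (oneTo n)) (upTo (suc n)))

partialSums : List ℕ → List ℕ
partialSums []      = []
partialSums (a ∷ r) = a ∷ map (λ s → a + s) (partialSums r)

setOf : List ℕ → List ℕ
setOf α = filterᵇ (λ s → s <ᵇ sum α) (partialSums α)

refinesᵇ : List ℕ → List ℕ → Bool
refinesᵇ β α = (sum β ≡ᵇ sum α) ∧ all (λ s → elem s (partialSums β)) (partialSums α)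

-- Formal power series in x₁, x₂, ...: a series is given by its coefficient
-- function; the monomial x₁^e₁ ⋯ x_N^e_N is encoded by the list e = [e₁,…,e_N]
-- (trailing zeros do not change the monomial, and all series below respect this).

Series : Set
Series = List ℕ → ℤ

M : List ℕ → Series
M β e = if filterᵇ (λ x → not (x ≡ᵇ 0)) e ==ₗ β then + 1 else + 0

F : List ℕ → Series
F α e = sumℤ (map (λ β → M β e) (filterᵇ (λ β → refinesᵇ β α) (comps (sum α))))

-- Tableaux: a filling is a list of rows (row 1 first)

Tableau : Set
Tableau = List (List ℕ)

fillings : List ℕ → ℕ → List Tableau
fillings []      N = [ [] ]
fillings (a ∷ α) N = concatMap (λ r → map (r ∷_) (fillings α N)) (listsOf (oneTo N) a)

weakIncᵇ : List ℕ → Bool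
weakIncᵇ []           = true
weakIncᵇ (x ∷ [])     = true
weakIncᵇ (x ∷ y ∷ r)  = (x ≤ᵇ y) ∧ weakIncᵇ (y ∷ r)

strictIncᵇ : List ℕ → Bool
strictIncᵇ []          = true
strictIncᵇ (x ∷ [])    = true
strictIncᵇ (x ∷ y ∷ r) = (x <ᵇ y) ∧ strictIncᵇ (y ∷ r)

firstCol : Tableau → List ℕ
firstCol []             = []
firstCol ([] ∷ T)       = firstCol T
firstCol ((x ∷ _) ∷ T)  = x ∷ firstCol T

isImmaculateᵇ : Tableau → Bool
isImmaculateᵇ T = all weakIncᵇ T ∧ strictIncᵇ (firstCol T)

count : ℕ → List ℕ → ℕ
count i xs = length (filterᵇ (λ j → i ≡ᵇ j) xs)

content : ℕ → Tableau → List ℕ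
content N T = map (λ i → count i (concat T)) (oneTo N)

-- dual immaculate function 𝔖*_α = Σ_T x^T; its coefficient on x^e (e of length N)
-- is the number of immaculate tableaux of shape α with entries in [1..N] and content e
dualImm : List ℕ → Series
dualImm α e =
  + length (filterᵇ (λ T → isImmaculateᵇ T ∧ (content (length e) T ==ₗ e))
                    (fillings α (length e)))

standard : List ℕ → List Tableau
standard α = filterᵇ (λ T → isImmaculateᵇ T ∧ (content (sum α) T ==ₗ replicate (sum α) 1))
                     (fillings α (sum α))

-- index of the row containing i (0 = top row)
rowOf : ℕ → Tableau → ℕ
rowOf i []      = 0
rowOf i (r ∷ T) = if elem i r then 0 else suc (rowOf i T)

descentAtᵇ : Tableau → ℕ → Bool
descentAtᵇ T i = rowOf i T <ᵇ rowOf (suc i) T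

descentSet : ℕ → Tableau → List ℕ
descentSet n T = filterᵇ (descentAtᵇ T) (oneTo (n ∸ 1))

L : List ℕ → List ℕ → ℕ
L α β = length (filterᵇ (λ T → descentSet (sum α) T ==ₗ setOf β) (standard α))

edgeᵇ : List ℕ → List ℕ → Bool
edgeᵇ α β = not (α ==ₗ β) ∧ (0 <ᵇ L α β)

consecEdgesᵇ : List (List ℕ) → Bool
consecEdgesᵇ []              = true
consecEdgesᵇ (v ∷ [])        = true
consecEdgesᵇ (v ∷ w ∷ r)     = edgeᵇ v w ∧ consecEdgesᵇ (w ∷ r)

distinctᵇ : List (List ℕ) → Bool
distinctᵇ []      = true
distinctᵇ (v ∷ r) = not (elemₗ v r) ∧ distinctᵇ r

lastOr : List ℕ → List (List ℕ) → List ℕ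
lastOr d []      = d
lastOr d (v ∷ r) = lastOr v r

-- all directed paths (vertex sequences α = v₀ → v₁ → ⋯ → v_k = β without
-- repeated vertices) from α to β in 𝔇ⁿ; a path has at most #comps(n) vertices
paths : ℕ → List ℕ → List ℕ → List (List (List ℕ))
paths n α β =
  filterᵇ (λ P → consecEdgesᵇ P ∧ distinctᵇ P ∧ (lastOr α P ==ₗ β))
          (concatMap (λ k → map (α ∷_) (listsOf (comps n) k)) (upTo (length (comps n))))

ℓ : List (List ℕ) → ℕ
ℓ P = length P ∸ 1

prod : List (List ℕ) → ℕ
prod []          = 1
prod (v ∷ [])    = 1
prod (v ∷ w ∷ r) = L v w Data.Nat.* prod (w ∷ r)

sign : ℕ → ℤ
sign zero    = + 1
sign (suc k) = ℤ.- sign k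

Linv : ℕ → List ℕ → List ℕ → ℤ
Linv n α β = sumℤ (map (λ P → sign (ℓ P) ℤ.* (+ prod P)) (paths n α β))

reachable : ℕ → List ℕ → List (List ℕ)
reachable n α = filterᵇ (λ β → not (null (paths n α β))) (comps n)

module Submission where

-- Standardizing immaculate tableaux gives 𝔖*_β = Σ_γ L_{β,γ} F_γ.  An immaculate tableau of
-- shape β and content γ forces γ ≤ β lexicographically, with equality only for the
-- superstandard tableau, so L is unitriangular: L_{β,β} = 1 and every edge β → γ of the descent
-- graph goes lexicographically down.  Writing L = I + L₀ with L₀ nilpotent, L⁻¹ = Σ_k (−L₀)^k,
-- and the (α, β) entry of (−L₀)^k is the signed weighted sum over walks with k edges from α to
-- β; these walks are the paths of the descent graph, and unreachable β contribute nothing.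

open import Defs

open import Algebra.Properties.CommutativeSemigroup as CommutativeSemigroupProperties using ()
open import Data.Bool using (Bool; true; false; T?; if_then_else_; _∧_; _∨_; not)
open import Data.Bool.ListAction using (all)
open import Data.Bool.Properties using (∧-identityʳ; ∨-identityʳ)
open import Data.Empty using (⊥; ⊥-elim)
open import Data.Integer as ℤ using (ℤ; +_; -_; _*_) renaming (_+_ to _+ℤ_)
import Data.Integer.Properties as ℤP
open import Data.Integer.Tactic.RingSolver using (solve-∀)
open import Data.List using (List; []; _∷_; [_]; map; concat; concatMap; filterᵇ; length; _++_;
  applyUpTo; upTo; replicate; reverse; null)
import Data.List.Properties as LP
open import Data.List.Properties using (≡-dec)
open import Data.List.Membership.Propositional using (_∈_; _∉_; find; lose)
import Data.List.Membership.Propositional.Properties as MP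
open import Data.List.Relation.Unary.All as All using (All; []; _∷_)
import Data.List.Relation.Unary.All.Properties as AllP
open import Data.List.Relation.Unary.AllPairs using ([]; _∷_)
open import Data.List.Relation.Unary.Any using (here; there)
open import Data.List.Relation.Unary.Unique.Propositional using (Unique)
import Data.List.Relation.Unary.Unique.Propositional.Properties as Unique
open import Data.Nat as ℕ using (ℕ; zero; suc; pred; _+_; _∸_; _<_; _≤_; z≤n; s≤s; _≟_; _<ᵇ_; _≤ᵇ_; _≡ᵇ_)
import Data.Nat.Properties as ℕP
open import Data.Nat.ListAction using (sum)
open import Data.Product using (_×_; _,_; proj₁; proj₂; Σ-syntax)
open import Data.Sum using (_⊎_; inj₁; inj₂)
open import Data.Unit using (tt)
open import Function using (_⟨_⟩_)
open import Relation.Binary.PropositionalEquality hiding ([_])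
open import Relation.Nullary using (yes; no)

open CommutativeSemigroupProperties ℕP.+-commutativeSemigroup using () renaming (interchange to +-interchange)
open CommutativeSemigroupProperties ℤP.+-commutativeSemigroup using () renaming (interchange to +ℤ-interchange)

-- Booleans and finite sums

false≢true : false ≢ true
false≢true ()

T⇒≡true : ∀ {b} → Data.Bool.T b → b ≡ true
T⇒≡true {true} _ = refl

≡true⇒T : ∀ {b} → b ≡ true → Data.Bool.T b
≡true⇒T refl = tt

∧-elim : ∀ {a b} → (a ∧ b) ≡ true → a ≡ true × b ≡ true
∧-elim {true} {true} refl = refl , refl

∧-intro : ∀ {a b} → a ≡ true → b ≡ true → (a ∧ b) ≡ true
∧-intro refl refl = refl

<ᵇ-irrefl : ∀ m → (m <ᵇ m) ≡ false
<ᵇ-irrefl zero = refl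
<ᵇ-irrefl (suc m) = <ᵇ-irrefl m

<ᵇ⇒< : ∀ {m n} → (m <ᵇ n) ≡ true → m < n
<ᵇ⇒< {m} {n} h = ℕP.<ᵇ⇒< m n (≡true⇒T h)

<⇒<ᵇ : ∀ {m n} → m < n → (m <ᵇ n) ≡ true
<⇒<ᵇ m<n = T⇒≡true (ℕP.<⇒<ᵇ m<n)

≤ᵇ⇒≤ : ∀ {m n} → (m ≤ᵇ n) ≡ true → m ≤ n
≤ᵇ⇒≤ {m} {n} h = ℕP.≤ᵇ⇒≤ m n (≡true⇒T h)

≤⇒≤ᵇ : ∀ {m n} → m ≤ n → (m ≤ᵇ n) ≡ true
≤⇒≤ᵇ m≤n = T⇒≡true (ℕP.≤⇒≤ᵇ m≤n)

∨-elim : ∀ {a b} → (a ∨ b) ≡ true → a ≡ true ⊎ b ≡ true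
∨-elim {true} _ = inj₁ refl
∨-elim {false} h = inj₂ h

∨-introˡ : ∀ {a} b → a ≡ true → (a ∨ b) ≡ true
∨-introˡ b refl = refl

∨-introʳ : ∀ a {b} → b ≡ true → (a ∨ b) ≡ true
∨-introʳ true _ = refl
∨-introʳ false h = h

≡ᵇ⇒≡ : ∀ {m n} → (m ≡ᵇ n) ≡ true → m ≡ n
≡ᵇ⇒≡ {m} {n} e = ℕP.≡ᵇ⇒≡ m n (≡true⇒T e)

≡ᵇ-refl : ∀ m → (m ≡ᵇ m) ≡ true
≡ᵇ-refl m = T⇒≡true (ℕP.≡⇒≡ᵇ m m refl)

==ₗ-refl : ∀ xs → (xs ==ₗ xs) ≡ true
==ₗ-refl xs with ≡-dec _≟_ xs xs
... | yes _ = refl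
... | no ¬p = ⊥-elim (¬p refl)

==ₗ⇒≡ : ∀ {xs ys} → (xs ==ₗ ys) ≡ true → xs ≡ ys
==ₗ⇒≡ {xs} {ys} h with ≡-dec _≟_ xs ys
... | yes p = p
==ₗ⇒≡ () | no _

≡⇒==ₗ : ∀ {xs ys} → xs ≡ ys → (xs ==ₗ ys) ≡ true
≡⇒==ₗ {xs} refl = ==ₗ-refl xs

==ₗ-comm : ∀ xs ys → (xs ==ₗ ys) ≡ (ys ==ₗ xs)
==ₗ-comm xs ys with ≡-dec _≟_ xs ys | ≡-dec _≟_ ys xs
... | yes _ | yes _ = refl
... | no _  | no _  = refl
... | yes p | no q  = ⊥-elim (q (sym p))
... | no p  | yes q = ⊥-elim (p (sym q))

∉-head : ∀ {A : Set} {x : A} {xs} → All (x ≢_) xs → x ∉ xs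
∉-head x≢xs x∈xs = All.lookup x≢xs x∈xs refl

∑ : {A : Set} → List A → (A → ℤ) → ℤ
∑ xs f = sumℤ (map f xs)

ind : Bool → ℤ
ind true = + 1
ind false = + 0

ind-* : ∀ b x → ind b * x ≡ (if b then x else + 0)
ind-* true x = ℤP.*-identityˡ x
ind-* false x = refl

*-ind : ∀ b x → x * ind b ≡ (if b then x else + 0)
*-ind b x = trans (ℤP.*-comm x (ind b)) (ind-* b x)

∑-++ : {A : Set} (xs ys : List A) (f : A → ℤ) → ∑ (xs ++ ys) f ≡ ∑ xs f +ℤ ∑ ys f
∑-++ [] ys f = sym (ℤP.+-identityˡ _)
∑-++ (x ∷ xs) ys f rewrite ∑-++ xs ys f = sym (ℤP.+-assoc (f x) _ _)

∑-map : {A B : Set} (h : A → B) (xs : List A) (f : B → ℤ) → ∑ (map h xs) f ≡ ∑ xs (λ x → f (h x))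
∑-map h [] f = refl
∑-map h (x ∷ xs) f rewrite ∑-map h xs f = refl

∑-concatMap : {A B : Set} (g : A → List B) (xs : List A) (f : B → ℤ) →
  ∑ (concatMap g xs) f ≡ ∑ xs (λ x → ∑ (g x) f)
∑-concatMap g [] f = refl
∑-concatMap g (x ∷ xs) f rewrite ∑-++ (g x) (concatMap g xs) f | ∑-concatMap g xs f = refl

∑-filter : {A : Set} (p : A → Bool) (xs : List A) (f : A → ℤ) →
  ∑ (filterᵇ p xs) f ≡ ∑ xs (λ x → if p x then f x else + 0)
∑-filter p [] f = refl
∑-filter p (x ∷ xs) f with p x
... | true = cong (f x +ℤ_) (∑-filter p xs f)
... | false = trans (∑-filter p xs f) (sym (ℤP.+-identityˡ _))

∑-cong : {A : Set} (xs : List A) {f g : A → ℤ} → (∀ x → x ∈ xs → f x ≡ g x) → ∑ xs f ≡ ∑ xs g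
∑-cong [] h = refl
∑-cong (x ∷ xs) h = cong₂ _+ℤ_ (h x (here refl)) (∑-cong xs (λ y m → h y (there m)))

∑-cong′ : {A : Set} (xs : List A) {f g : A → ℤ} → (∀ x → f x ≡ g x) → ∑ xs f ≡ ∑ xs g
∑-cong′ xs h = ∑-cong xs (λ x _ → h x)

∑-+ : {A : Set} (xs : List A) (f g : A → ℤ) → ∑ xs (λ x → f x +ℤ g x) ≡ ∑ xs f +ℤ ∑ xs g
∑-+ [] f g = refl
∑-+ (x ∷ xs) f g rewrite ∑-+ xs f g = +ℤ-interchange (f x) (g x) (∑ xs f) (∑ xs g)

∑-*ˡ : {A : Set} (xs : List A) (c : ℤ) (f : A → ℤ) → ∑ xs (λ x → c * f x) ≡ c * ∑ xs f
∑-*ˡ [] c f = sym (ℤP.*-zeroʳ c)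
∑-*ˡ (x ∷ xs) c f rewrite ∑-*ˡ xs c f = sym (ℤP.*-distribˡ-+ c (f x) (∑ xs f))

∑-*ʳ : {A : Set} (xs : List A) (c : ℤ) (f : A → ℤ) → ∑ xs (λ x → f x * c) ≡ ∑ xs f * c
∑-*ʳ xs c f = trans (∑-cong′ xs (λ x → ℤP.*-comm (f x) c)) (trans (∑-*ˡ xs c f) (ℤP.*-comm c _))

∑-zero : {A : Set} (xs : List A) (f : A → ℤ) → (∀ x → x ∈ xs → f x ≡ + 0) → ∑ xs f ≡ + 0
∑-zero [] f h = refl
∑-zero (x ∷ xs) f h rewrite h x (here refl) = trans (ℤP.+-identityˡ _) (∑-zero xs f (λ y m → h y (there m)))

∑-neg : {A : Set} (xs : List A) (f : A → ℤ) → ∑ xs (λ x → - f x) ≡ - ∑ xs f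
∑-neg [] f = refl
∑-neg (x ∷ xs) f rewrite ∑-neg xs f = sym (ℤP.neg-distrib-+ (f x) (∑ xs f))

∑-swap : {A B : Set} (xs : List A) (ys : List B) (f : A → B → ℤ) →
  ∑ xs (λ x → ∑ ys (f x)) ≡ ∑ ys (λ y → ∑ xs (λ x → f x y))
∑-swap [] ys f = sym (∑-zero ys _ (λ _ _ → refl))
∑-swap (x ∷ xs) ys f rewrite ∑-swap xs ys f = sym (∑-+ ys (f x) (λ y → ∑ xs (λ x → f x y)))

∑-pos : {A : Set} (xs : List A) (g : A → ℕ) → ∑ xs (λ x → + g x) ≡ + sum (map g xs)
∑-pos [] g = refl
∑-pos (x ∷ xs) g rewrite ∑-pos xs g = sym (ℤP.pos-+ (g x) (sum (map g xs)))

length-filterᵇ : {A : Set} (p : A → Bool) (xs : List A) → + length (filterᵇ p xs) ≡ ∑ xs (λ x → ind (p x))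
length-filterᵇ p [] = refl
length-filterᵇ p (x ∷ xs) with p x
... | true = cong (+ 1 +ℤ_) (length-filterᵇ p xs)
... | false = trans (length-filterᵇ p xs) (sym (ℤP.+-identityˡ _))

∑-select : (xs : List (List ℕ)) (a : List ℕ) (f : List ℕ → ℤ) → Unique xs → a ∈ xs →
  ∑ xs (λ x → if a ==ₗ x then f x else + 0) ≡ f a
∑-select (x ∷ xs) a f (x∉ ∷ u) (here refl) rewrite ==ₗ-refl a =
  trans (cong (f a +ℤ_) (∑-zero xs _ absent)) (ℤP.+-identityʳ _)
  where
  absent : ∀ y → y ∈ xs → (if a ==ₗ y then f y else + 0) ≡ + 0
  absent y y∈ with a ==ₗ y in e
  ... | false = refl
  ... | true = ⊥-elim (∉-head x∉ (subst (_∈ xs) (sym (==ₗ⇒≡ e)) y∈))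
∑-select (x ∷ xs) a f (x∉ ∷ u) (there a∈) with a ==ₗ x in e
... | true = ⊥-elim (∉-head x∉ (subst (_∈ xs) (==ₗ⇒≡ e) a∈))
... | false = trans (ℤP.+-identityˡ _) (∑-select xs a f u a∈)

-- Lists

∈-filterᵇ⁻ : {A : Set} (p : A → Bool) {x : A} {xs : List A} → x ∈ filterᵇ p xs → x ∈ xs × p x ≡ true
∈-filterᵇ⁻ p m = let x∈ , px = MP.∈-filter⁻ (λ x → T? (p x)) m in x∈ , T⇒≡true px

∈-filterᵇ⁺ : {A : Set} (p : A → Bool) {x : A} {xs : List A} → x ∈ xs → p x ≡ true → x ∈ filterᵇ p xs
∈-filterᵇ⁺ p m px = MP.∈-filter⁺ (λ x → T? (p x)) m (≡true⇒T px)

filterᵇ-cong : {A : Set} (xs : List A) (p q : A → Bool) → (∀ x → x ∈ xs → p x ≡ q x) → filterᵇ p xs ≡ filterᵇ q xs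
filterᵇ-cong [] p q h = refl
filterᵇ-cong (x ∷ xs) p q h with p x in e1 | q x in e2
... | true | true = cong (x ∷_) (filterᵇ-cong xs p q (λ y m → h y (there m)))
... | false | false = filterᵇ-cong xs p q (λ y m → h y (there m))
... | true | false = ⊥-elim (false≢true (trans (sym e2) (trans (sym (h x (here refl))) e1)))
... | false | true = ⊥-elim (false≢true (trans (sym e1) (trans (h x (here refl)) e2)))

∈-concatMap⁻ : {A B : Set} (g : A → List B) {y : B} (xs : List A) → y ∈ concatMap g xs → Σ[ x ∈ A ] x ∈ xs × y ∈ g x
∈-concatMap⁻ g xs m = find (MP.∈-concatMap⁻ g {xs} m)

∈-concatMap⁺ : {A B : Set} (g : A → List B) {x : A} {y : B} (xs : List A) → x ∈ xs → y ∈ g x → y ∈ concatMap g xs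
∈-concatMap⁺ g xs x∈ y∈ = MP.∈-concatMap⁺ g {xs} (lose x∈ y∈)

Unique-concatMap : {A B : Set} (g : A → List B) {xs : List A} →
  (∀ {x y b} → b ∈ g x → b ∈ g y → x ≡ y) → (∀ x → Unique (g x)) → Unique xs → Unique (concatMap g xs)
Unique-concatMap g disjoint ug [] = []
Unique-concatMap g {x ∷ xs} disjoint ug (x∉ ∷ u) = Unique.++⁺ (ug x) (Unique-concatMap g disjoint ug u)
  (λ (b∈gx , b∈rest) → let z , z∈ , b∈gz = ∈-concatMap⁻ g xs b∈rest in
     ∉-head x∉ (subst (_∈ xs) (disjoint b∈gz b∈gx) z∈))

Unique-map-on : {A B : Set} (f : A → B) {xs : List A} →
  (∀ {x y} → x ∈ xs → y ∈ xs → f x ≡ f y → x ≡ y) → Unique xs → Unique (map f xs)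
Unique-map-on f inj [] = []
Unique-map-on f {x ∷ xs} inj (x∉ ∷ u) =
  All-≢ (λ {y} fx≡y y∈ → let z , z∈ , e = MP.∈-map⁻ f y∈ in
           ∉-head x∉ (subst (_∈ xs) (sym (inj (here refl) (there z∈) (trans fx≡y e))) z∈))
  ∷ Unique-map-on f (λ a∈ b∈ → inj (there a∈) (there b∈)) u
  where
  All-≢ : ∀ {C : Set} {fx : C} {ys} → (∀ {y} → fx ≡ y → y ∈ ys → ⊥) → All (fx ≢_) ys
  All-≢ {ys = []} h = []
  All-≢ {ys = y ∷ ys} h = (λ e → h e (here refl)) ∷ All-≢ (λ e m → h e (there m))

Unique-⊆⇒length≤ : {A : Set} {zs : List A} (ws : List A) → Unique zs → (∀ {z} → z ∈ zs → z ∈ ws) → length zs ≤ length ws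
Unique-⊆⇒length≤ ws [] h = z≤n
Unique-⊆⇒length≤ {zs = z ∷ zs} ws (z∉ ∷ u) h =
  let z∈ws = h (here refl) in
  subst (suc (length zs) ≤_) (sym (length-del ws z∈ws))
    (s≤s (Unique-⊆⇒length≤ (del ws z∈ws) u
      (λ {w} w∈ → del-keep ws z∈ws (h (there w∈)) (λ e → ∉-head z∉ (subst (_∈ zs) e w∈)))))
  where
  del : ∀ {C : Set} {z : C} (ws : List C) → z ∈ ws → List C
  del (w ∷ ws) (here _) = ws
  del (w ∷ ws) (there m) = w ∷ del ws m
  length-del : ∀ {C : Set} {z : C} (ws : List C) (m : z ∈ ws) → length ws ≡ suc (length (del ws m))
  length-del (w ∷ ws) (here _) = refl
  length-del (w ∷ ws) (there m) = cong suc (length-del ws m)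
  del-keep : ∀ {C : Set} {z w : C} (ws : List C) (m : z ∈ ws) → w ∈ ws → w ≢ z → w ∈ del ws m
  del-keep (v ∷ ws) (here refl) (here refl) ne = ⊥-elim (ne refl)
  del-keep (v ∷ ws) (here refl) (there mw) ne = mw
  del-keep (v ∷ ws) (there m) (here refl) ne = here refl
  del-keep (v ∷ ws) (there m) (there mw) ne = there (del-keep ws m mw ne)

length-filterᵇ-≤-injection : {A B : Set} (xs : List A) (ys : List B) (p : A → Bool) (q : B → Bool) (f : A → B) (g : B → A) →
  Unique xs →
  (∀ x → x ∈ xs → p x ≡ true → f x ∈ ys × q (f x) ≡ true × g (f x) ≡ x) →
  length (filterᵇ p xs) ≤ length (filterᵇ q ys)
length-filterᵇ-≤-injection xs ys p q f g ux h =
  subst (_≤ length (filterᵇ q ys)) (LP.length-map f (filterᵇ p xs))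
   (Unique-⊆⇒length≤ (filterᵇ q ys)
     (Unique-map-on f (λ a∈ b∈ e →
        let a∈′ , pa = ∈-filterᵇ⁻ p a∈ ; b∈′ , pb = ∈-filterᵇ⁻ p b∈ in
        trans (sym (proj₂ (proj₂ (h _ a∈′ pa)))) (trans (cong g e) (proj₂ (proj₂ (h _ b∈′ pb)))))
       (Unique.filter⁺ (λ x → T? (p x)) ux))
     (λ z∈ → let x , x∈ , e = MP.∈-map⁻ f z∈ ; x∈′ , px = ∈-filterᵇ⁻ p x∈ ; fx∈ , qfx , _ = h x x∈′ px in
        subst (_∈ filterᵇ q ys) (sym e) (∈-filterᵇ⁺ q fx∈ qfx)))

length-filterᵇ-bijection : {A B : Set} (xs : List A) (ys : List B) (p : A → Bool) (q : B → Bool) (f : A → B) (g : B → A) →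
  Unique xs → Unique ys →
  (∀ x → x ∈ xs → p x ≡ true → f x ∈ ys × q (f x) ≡ true × g (f x) ≡ x) →
  (∀ y → y ∈ ys → q y ≡ true → g y ∈ xs × p (g y) ≡ true × f (g y) ≡ y) →
  length (filterᵇ p xs) ≡ length (filterᵇ q ys)
length-filterᵇ-bijection xs ys p q f g ux uy fwd bwd =
  ℕP.≤-antisym (length-filterᵇ-≤-injection xs ys p q f g ux fwd) (length-filterᵇ-≤-injection ys xs q p g f uy bwd)

∈-upTo⁻ : ∀ {N x} → x ∈ upTo N → x < N
∈-upTo⁻ m with MP.∈-applyUpTo⁻ (λ k → k) m
... | _ , i<N , refl = i<N

∈-upTo⁺ : ∀ {N x} → x < N → x ∈ upTo N
∈-upTo⁺ = MP.∈-applyUpTo⁺ (λ k → k)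

∈-oneTo⁻ : ∀ {N x} → x ∈ oneTo N → 1 ≤ x × x ≤ N
∈-oneTo⁻ m with MP.∈-applyUpTo⁻ suc m
... | _ , i<N , refl = s≤s z≤n , i<N

∈-oneTo⁺ : ∀ {N x} → 1 ≤ x → x ≤ N → x ∈ oneTo N
∈-oneTo⁺ {x = suc x} _ x≤N = MP.∈-applyUpTo⁺ suc x≤N

Unique-oneTo : ∀ N → Unique (oneTo N)
Unique-oneTo N = Unique.applyUpTo⁺₁ suc N (λ i<j _ e → ℕP.<-irrefl (ℕP.suc-injective e) i<j)

∈-listsOf⁻ : {A : Set} (xs : List A) (k : ℕ) {r : List A} → r ∈ listsOf xs k → All (_∈ xs) r × length r ≡ k
∈-listsOf⁻ xs zero (here refl) = [] , refl
∈-listsOf⁻ xs (suc k) m with ∈-concatMap⁻ (λ x → map (x ∷_) (listsOf xs k)) xs m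
... | x , x∈ , m′ with MP.∈-map⁻ (x ∷_) m′
... | r , r∈ , refl = let rs∈ , len = ∈-listsOf⁻ xs k r∈ in (x∈ ∷ rs∈) , cong suc len

∈-listsOf⁺ : {A : Set} (xs : List A) {r : List A} → All (_∈ xs) r → r ∈ listsOf xs (length r)
∈-listsOf⁺ xs [] = here refl
∈-listsOf⁺ xs (_∷_ {x} {r} x∈ rs∈) = ∈-concatMap⁺ (λ x → map (x ∷_) (listsOf xs (length r))) xs x∈ (MP.∈-map⁺ (x ∷_) (∈-listsOf⁺ xs rs∈))

∑-listsOf-suc : {A : Set} (xs : List A) (k : ℕ) (f : List A → ℤ) →
  ∑ (listsOf xs (suc k)) f ≡ ∑ xs (λ c → ∑ (listsOf xs k) (λ r → f (c ∷ r)))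
∑-listsOf-suc xs k f = trans (∑-concatMap (λ x → map (x ∷_) (listsOf xs k)) xs f)
  (∑-cong′ xs (λ c → ∑-map (c ∷_) (listsOf xs k) f))

Unique-listsOf : {A : Set} {xs : List A} → Unique xs → ∀ k → Unique (listsOf xs k)
Unique-listsOf u zero = [] ∷ []
Unique-listsOf {xs = xs} u (suc k) = Unique-concatMap (λ x → map (x ∷_) (listsOf xs k))
  (λ {x} {y} → cons-head x y) (λ x → Unique.map⁺ (λ e → proj₂ (LP.∷-injective e)) (Unique-listsOf u k)) u
  where
  cons-head : ∀ x y {b} → b ∈ map (x ∷_) (listsOf xs k) → b ∈ map (y ∷_) (listsOf xs k) → x ≡ y
  cons-head x y b∈x b∈y with MP.∈-map⁻ (x ∷_) b∈x | MP.∈-map⁻ (y ∷_) b∈y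
  ... | _ , _ , refl | _ , _ , refl = refl

length-∷ʳ : {A : Set} (xs : List A) (x : A) → length (xs ++ [ x ]) ≡ suc (length xs)
length-∷ʳ xs x = trans (LP.length-++ xs) (ℕP.+-comm (length xs) 1)

replicate-∷ʳ : {A : Set} (n : ℕ) (x : A) → replicate (suc n) x ≡ replicate n x ++ [ x ]
replicate-∷ʳ zero x = refl
replicate-∷ʳ (suc n) x = cong (x ∷_) (replicate-∷ʳ n x)

-- Compositions and fillings

Unique-comps : ∀ n → Unique (comps n)
Unique-comps n = Unique.filter⁺ (λ β → T? (sum β ≡ᵇ n)) (Unique-concatMap (listsOf (oneTo n))
  (λ {x} {y} b∈x b∈y → trans (sym (proj₂ (∈-listsOf⁻ _ x b∈x))) (proj₂ (∈-listsOf⁻ _ y b∈y)))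
  (Unique-listsOf (Unique-oneTo n)) (Unique.upTo⁺ (suc n)))

∈-comps⁻ : ∀ n {β} → β ∈ comps n → All (0 <_) β × sum β ≡ n
∈-comps⁻ n m =
  let m′ , e = ∈-filterᵇ⁻ (λ β → sum β ≡ᵇ n) m
      k , _ , m″ = ∈-concatMap⁻ (listsOf (oneTo n)) (upTo (suc n)) m′
  in All.map (λ x∈ → proj₁ (∈-oneTo⁻ x∈)) (proj₁ (∈-listsOf⁻ _ k m″)) , ≡ᵇ⇒≡ e

∈-comps⁺ : ∀ n {β} → All (0 <_) β → sum β ≡ n → β ∈ comps n
∈-comps⁺ n {β} pos refl = ∈-filterᵇ⁺ (λ β → sum β ≡ᵇ n)
  (∈-concatMap⁺ (listsOf (oneTo n)) (upTo (suc n)) (∈-upTo⁺ (s≤s (length≤sum pos)))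
     (∈-listsOf⁺ (oneTo n) (parts∈ β pos)))
  (≡ᵇ-refl (sum β))
  where
  length≤sum : ∀ {γ} → All (0 <_) γ → length γ ≤ sum γ
  length≤sum [] = z≤n
  length≤sum (p ∷ ps) = ℕP.+-mono-≤ p (length≤sum ps)
  parts∈ : ∀ γ → All (0 <_) γ → All (_∈ oneTo (sum γ)) γ
  parts∈ [] [] = []
  parts∈ (x ∷ γ) (p ∷ ps) = ∈-oneTo⁺ p (ℕP.m≤m+n x (sum γ))
    ∷ All.map (λ {y} y∈ → let a , b = ∈-oneTo⁻ y∈ in ∈-oneTo⁺ a (ℕP.≤-trans b (ℕP.m≤n+m (sum γ) x))) (parts∈ γ ps)

∈-fillings⁻ : ∀ α N {T} → T ∈ fillings α N → map length T ≡ α × All (All (_∈ oneTo N)) T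
∈-fillings⁻ [] N (here refl) = refl , []
∈-fillings⁻ (a ∷ α) N m =
  let r , r∈ , m′ = ∈-concatMap⁻ (λ r → map (r ∷_) (fillings α N)) (listsOf (oneTo N) a) m
      T′ , T′∈ , e = MP.∈-map⁻ (r ∷_) m′
      entries , len = ∈-listsOf⁻ (oneTo N) a r∈
      shape′ , entries′ = ∈-fillings⁻ α N T′∈
  in subst (λ T → map length T ≡ a ∷ α × All (All (_∈ oneTo N)) T) (sym e) (cong₂ _∷_ len shape′ , (entries ∷ entries′))

∈-fillings⁺ : ∀ N T → All (All (_∈ oneTo N)) T → T ∈ fillings (map length T) N
∈-fillings⁺ N [] [] = here refl
∈-fillings⁺ N (r ∷ T) (a ∷ as) = ∈-concatMap⁺ (λ r → map (r ∷_) (fillings (map length T) N)) (listsOf (oneTo N) (length r))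
  (∈-listsOf⁺ (oneTo N) a) (MP.∈-map⁺ (r ∷_) (∈-fillings⁺ N T as))

Unique-fillings : ∀ α N → Unique (fillings α N)
Unique-fillings [] N = [] ∷ []
Unique-fillings (a ∷ α) N = Unique-concatMap (λ r → map (r ∷_) (fillings α N))
  (λ {x} {y} → row-head x y) (λ r → Unique.map⁺ (λ e → proj₂ (LP.∷-injective e)) (Unique-fillings α N))
  (Unique-listsOf (Unique-oneTo N) a)
  where
  row-head : ∀ x y {b} → b ∈ map (x ∷_) (fillings α N) → b ∈ map (y ∷_) (fillings α N) → x ≡ y
  row-head x y b∈x b∈y with MP.∈-map⁻ (x ∷_) b∈x | MP.∈-map⁻ (y ∷_) b∈y
  ... | _ , _ , refl | _ , _ , refl = refl

elem-sound : ∀ x r → elem x r ≡ true → x ∈ r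
elem-sound x (y ∷ r) h with x ≡ᵇ y in e
... | true = here (≡ᵇ⇒≡ e)
... | false = there (elem-sound x r h)

elem-complete : ∀ x r → x ∈ r → elem x r ≡ true
elem-complete x (y ∷ r) (here refl) rewrite ≡ᵇ-refl x = refl
elem-complete x (y ∷ r) (there m) with x ≡ᵇ y
... | true = refl
... | false = elem-complete x r m

elem-false⇒∉ : ∀ x r → elem x r ≡ false → x ∉ r
elem-false⇒∉ x r h m = false≢true (trans (sym h) (elem-complete x r m))

∉⇒elem-false : ∀ x r → x ∉ r → elem x r ≡ false
∉⇒elem-false x r h with elem x r in e
... | true = ⊥-elim (h (elem-sound x r e))
... | false = refl

elem-++ : ∀ x r s → elem x (r ++ s) ≡ (elem x r ∨ elem x s)
elem-++ x [] s = refl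
elem-++ x (y ∷ r) s with x ≡ᵇ y
... | true = refl
... | false = elem-++ x r s

-- Inverting a unitriangular matrix by path sums

∑-upTo-telescope : (columnAbove : ℕ → ℤ) (m : ℕ) → ∑ (upTo m) (λ k → columnAbove k +ℤ - columnAbove (suc k)) ≡ columnAbove 0 +ℤ - columnAbove m
∑-upTo-telescope columnAbove zero = sym (ℤP.+-inverseʳ (columnAbove 0))
∑-upTo-telescope columnAbove (suc m) = begin
  ∑ (upTo (suc m)) Δ                ≡⟨ cong (λ ks → ∑ ks Δ) (sym (LP.upTo-∷ʳ m)) ⟩
  ∑ (upTo m ++ [ m ]) Δ             ≡⟨ ∑-++ (upTo m) [ m ] Δ ⟩
  ∑ (upTo m) Δ +ℤ (Δ m +ℤ + 0)       ≡⟨ cong₂ _+ℤ_ (∑-upTo-telescope columnAbove m) (ℤP.+-identityʳ (Δ m)) ⟩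
  (columnAbove 0 +ℤ - columnAbove m) +ℤ (columnAbove m +ℤ - columnAbove (suc m)) ≡⟨ cancel (columnAbove 0) (columnAbove m) (columnAbove (suc m)) ⟩
  columnAbove 0 +ℤ - columnAbove (suc m)                ∎
  where
  open ≡-Reasoning
  Δ : ℕ → ℤ
  Δ k = columnAbove k +ℤ - columnAbove (suc k)
  cancel : ∀ a b c → (a +ℤ - b) +ℤ (b +ℤ - c) ≡ a +ℤ - c
  cancel = solve-∀

length-filterᵇ-< : {A : Set} (p q : A → Bool) (xs : List A) {c : A} → (∀ x → p x ≡ true → q x ≡ true) →
  c ∈ xs → q c ≡ true → p c ≡ false → length (filterᵇ p xs) < length (filterᵇ q xs)
length-filterᵇ-< p q (x ∷ xs) p⇒q (here refl) qc pc rewrite qc | pc = s≤s (length-filterᵇ-≤ xs)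
  where
  length-filterᵇ-≤ : ∀ ys → length (filterᵇ p ys) ≤ length (filterᵇ q ys)
  length-filterᵇ-≤ [] = z≤n
  length-filterᵇ-≤ (y ∷ ys) with p y in ep | q y in eq
  ... | true | true = s≤s (length-filterᵇ-≤ ys)
  ... | true | false = ⊥-elim (false≢true (trans (sym eq) (p⇒q y ep)))
  ... | false | true = ℕP.m≤n⇒m≤1+n (length-filterᵇ-≤ ys)
  ... | false | false = length-filterᵇ-≤ ys
length-filterᵇ-< p q (x ∷ xs) p⇒q (there c∈) qc pc with p x in ep | q x in eq
... | true | true = s≤s (length-filterᵇ-< p q xs p⇒q c∈ qc pc)
... | true | false = ⊥-elim (false≢true (trans (sym eq) (p⇒q x ep)))
... | false | true = ℕP.m≤n⇒m≤1+n (length-filterᵇ-< p q xs p⇒q c∈ qc pc)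
... | false | false = length-filterᵇ-< p q xs p⇒q c∈ qc pc

module UnitriangularInverse (n : ℕ)
    (_≺_ : List ℕ → List ℕ → Bool)
    (≺-trans : ∀ {a b c} → (a ≺ b) ≡ true → (b ≺ c) ≡ true → (a ≺ c) ≡ true)
    (≺-irrefl : ∀ a → (a ≺ a) ≡ false)
    (L-diagonal : ∀ {a} → a ∈ comps n → L a a ≡ 1)
    (edge⇒≺ : ∀ {a b} → a ∈ comps n → b ∈ comps n → edgeᵇ a b ≡ true → (b ≺ a) ≡ true) where

  C : List (List ℕ)
  C = comps n

  offDiag : List ℕ → List ℕ → ℤ
  offDiag a c = if a ==ₗ c then + 0 else + L a c

  -- walkSum k a g is the (a, g) entry of (−L₀)ᵏ, L₀ = L − I the strictly triangular part.
  walkSum : ℕ → List ℕ → List ℕ → ℤ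
  walkSum zero a g = ind (a ==ₗ g)
  walkSum (suc k) a g = ∑ C (λ c → - offDiag a c * walkSum k c g)

  edge-of-weight : ∀ {a c m} → (a ==ₗ c) ≡ false → L a c ≡ suc m → edgeᵇ a c ≡ true
  edge-of-weight a≠c Lac rewrite a≠c | Lac = refl

  edges-descend : ∀ a r → a ∈ C → All (_∈ C) r → consecEdgesᵇ (a ∷ r) ≡ true → All (λ x → (x ≺ a) ≡ true) r
  edges-descend a [] a∈ r∈ h = []
  edges-descend a (c ∷ r) a∈ (c∈ ∷ r∈) h with edgeᵇ a c in e
  ... | true = c≺a ∷ All.map (λ x≺c → ≺-trans x≺c c≺a) (edges-descend c r c∈ r∈ h)
    where c≺a = edge⇒≺ a∈ c∈ e

  below⇒∉ : ∀ a r → All (λ x → (x ≺ a) ≡ true) r → elemₗ a r ≡ false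
  below⇒∉ a [] _ = refl
  below⇒∉ a (x ∷ r) (x≺a ∷ r≺a) with a ==ₗ x in a=x
  ... | true = ⊥-elim (false≢true (trans (sym (≺-irrefl a)) (subst (λ y → (y ≺ a) ≡ true) (sym (==ₗ⇒≡ a=x)) x≺a)))
  ... | false = below⇒∉ a r r≺a

  consecEdges⇒distinct : ∀ a r → a ∈ C → All (_∈ C) r → consecEdgesᵇ (a ∷ r) ≡ true → distinctᵇ (a ∷ r) ≡ true
  consecEdges⇒distinct a [] a∈ r∈ h = refl
  consecEdges⇒distinct a (c ∷ r) a∈ (c∈ ∷ r∈) h with edgeᵇ a c in e
  ... | true rewrite below⇒∉ a (c ∷ r) (edges-descend a (c ∷ r) a∈ (c∈ ∷ r∈) (cong (_∧ consecEdgesᵇ (c ∷ r)) e ⟨ trans ⟩ h))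
      = consecEdges⇒distinct c r c∈ r∈ h

  module _ (γ : List ℕ) where
    pathTerm : List ℕ → List (List ℕ) → ℤ
    pathTerm a r = if consecEdgesᵇ (a ∷ r) ∧ distinctᵇ (a ∷ r) ∧ (lastOr a r ==ₗ γ)
                   then sign (ℓ (a ∷ r)) * + prod (a ∷ r) else + 0

    pathTerm-cons : ∀ a c r → a ∈ C → c ∈ C → All (_∈ C) r → pathTerm a (c ∷ r) ≡ - offDiag a c * pathTerm c r
    pathTerm-cons a c r a∈ c∈ r∈ with edgeᵇ a c in e
    ... | false = sym (cong (λ z → - z * pathTerm c r) no-weight)
      where
      no-weight : offDiag a c ≡ + 0
      no-weight with a ==ₗ c in a=c
      ... | true = refl
      ... | false with L a c in Lac
      ...   | zero = refl
      ...   | suc _ = ⊥-elim (false≢true (sym e))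
    ... | true with consecEdgesᵇ (c ∷ r) in e′
    ...   | false = sym (ℤP.*-zeroʳ (- offDiag a c))
    ...   | true rewrite consecEdges⇒distinct a (c ∷ r) a∈ (c∈ ∷ r∈) (cong₂ _∧_ e e′)
                     | consecEdges⇒distinct c r c∈ r∈ e′ with lastOr c r ==ₗ γ
    ...     | false = sym (ℤP.*-zeroʳ (- offDiag a c))
    ...     | true with a ==ₗ c
    ...       | false = trans (cong (- sign (length r) *_) (ℤP.pos-* (L a c) (prod (c ∷ r))))
                             (rearrange (sign (length r)) (+ L a c) (+ prod (c ∷ r)))
      where
      rearrange : ∀ (s l p : ℤ) → (- s) * (l * p) ≡ - l * (s * p)
      rearrange = solve-∀

    ∑-pathTerms : ∀ k a → a ∈ C → ∑ (listsOf C k) (pathTerm a) ≡ walkSum k a γ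
    ∑-pathTerms zero a a∈ with a ==ₗ γ
    ... | true = refl
    ... | false = refl
    ∑-pathTerms (suc k) a a∈ =
      trans (∑-listsOf-suc C k (pathTerm a))
        (∑-cong C (λ c c∈ →
          trans (∑-cong (listsOf C k) (λ r r∈ → pathTerm-cons a c r a∈ c∈ (proj₁ (∈-listsOf⁻ C k r∈))))
            (trans (∑-*ˡ (listsOf C k) (- offDiag a c) (pathTerm c))
              (cong (- offDiag a c *_) (∑-pathTerms k c c∈)))))

    Linv≡∑walkSum : ∀ {α} → α ∈ C → Linv n α γ ≡ ∑ (upTo (length C)) (λ k → walkSum k α γ)
    Linv≡∑walkSum {α} α∈ =
      trans (∑-filter _ (concatMap (λ k → map (α ∷_) (listsOf C k)) (upTo (length C))) _)
       (trans (∑-concatMap (λ k → map (α ∷_) (listsOf C k)) (upTo (length C)) _)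
         (∑-cong′ (upTo (length C)) (λ k → trans (∑-map (α ∷_) (listsOf C k) _) (∑-pathTerms k α α∈))))

  walkSum-suc : ∀ k {a g} → a ∈ C → g ∈ C → walkSum (suc k) a g ≡ ∑ C (λ c → walkSum k a c * - offDiag c g)
  walkSum-suc zero {a} {g} a∈ g∈ = begin
    ∑ C (λ c → - offDiag a c * ind (c ==ₗ g))                 ≡⟨ ∑-cong′ C (λ c → *-ind (c ==ₗ g) _) ⟩
    ∑ C (λ c → if c ==ₗ g then - offDiag a c else + 0)       ≡⟨ ∑-cong′ C (λ c → cong (λ b → if b then _ else + 0) (==ₗ-comm c g)) ⟩
    ∑ C (λ c → if g ==ₗ c then - offDiag a c else + 0)       ≡⟨ ∑-select C g _ (Unique-comps n) g∈ ⟩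
    - offDiag a g                                             ≡⟨ sym (∑-select C a _ (Unique-comps n) a∈) ⟩
    ∑ C (λ c → if a ==ₗ c then - offDiag c g else + 0)       ≡⟨ sym (∑-cong′ C (λ c → ind-* (a ==ₗ c) _)) ⟩
    ∑ C (λ c → ind (a ==ₗ c) * - offDiag c g)                 ∎
    where open ≡-Reasoning
  walkSum-suc (suc k) {a} {g} a∈ g∈ = begin
    ∑ C (λ c → - offDiag a c * walkSum (suc k) c g)
      ≡⟨ ∑-cong C (λ c c∈ → trans (cong (- offDiag a c *_) (walkSum-suc k c∈ g∈))
                                  (sym (∑-*ˡ C (- offDiag a c) (λ d → walkSum k c d * - offDiag d g)))) ⟩
    ∑ C (λ c → ∑ C (λ d → - offDiag a c * (walkSum k c d * - offDiag d g)))
      ≡⟨ ∑-swap C C _ ⟩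
    ∑ C (λ d → ∑ C (λ c → - offDiag a c * (walkSum k c d * - offDiag d g)))
      ≡⟨ ∑-cong′ C (λ d → trans (∑-cong′ C (λ c → sym (ℤP.*-assoc (- offDiag a c) _ _)))
                                (∑-*ʳ C (- offDiag d g) (λ c → - offDiag a c * walkSum k c d))) ⟩
    ∑ C (λ d → walkSum (suc k) a d * - offDiag d g) ∎
    where open ≡-Reasoning

  L≡offDiag+I : ∀ β {γ} → γ ∈ C → + L β γ ≡ offDiag β γ +ℤ ind (β ==ₗ γ)
  L≡offDiag+I β {γ} γ∈ with β ==ₗ γ in e
  ... | true rewrite ==ₗ⇒≡ e | L-diagonal γ∈ = refl
  ... | false = sym (ℤP.+-identityʳ _)

  walkSum-*-L : ∀ k {α γ} → α ∈ C → γ ∈ C →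
    ∑ C (λ β → walkSum k α β * + L β γ) ≡ walkSum k α γ +ℤ - walkSum (suc k) α γ
  walkSum-*-L k {α} {γ} α∈ γ∈ = begin
    ∑ C (λ β → W β * + L β γ)
      ≡⟨ ∑-cong′ C (λ β → trans (cong (W β *_) (L≡offDiag+I β γ∈)) (ℤP.*-distribˡ-+ (W β) _ _)) ⟩
    ∑ C (λ β → W β * offDiag β γ +ℤ W β * ind (β ==ₗ γ))
      ≡⟨ ∑-+ C _ _ ⟩
    ∑ C (λ β → W β * offDiag β γ) +ℤ ∑ C (λ β → W β * ind (β ==ₗ γ))
      ≡⟨ cong₂ _+ℤ_ negated-next diagonal ⟩
    - walkSum (suc k) α γ +ℤ W γ
      ≡⟨ ℤP.+-comm _ (W γ) ⟩
    W γ +ℤ - walkSum (suc k) α γ ∎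
    where
    open ≡-Reasoning
    W : List ℕ → ℤ
    W = walkSum k α
    diagonal : ∑ C (λ β → W β * ind (β ==ₗ γ)) ≡ W γ
    diagonal = trans (∑-cong′ C (λ β → trans (*-ind (β ==ₗ γ) (W β)) (cong (λ b → if b then W β else + 0) (==ₗ-comm β γ))))
                     (∑-select C γ W (Unique-comps n) γ∈)
    negated-next : ∑ C (λ β → W β * offDiag β γ) ≡ - walkSum (suc k) α γ
    negated-next = sym (begin
      - walkSum (suc k) α γ                    ≡⟨ cong -_ (walkSum-suc k α∈ γ∈) ⟩
      - ∑ C (λ c → W c * - offDiag c γ)        ≡⟨ sym (∑-neg C _) ⟩
      ∑ C (λ c → - (W c * - offDiag c γ))      ≡⟨ ∑-cong′ C (λ c → trans (cong -_ (sym (ℤP.neg-distribʳ-* (W c) _)))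
                                                                           (ℤP.neg-involutive _)) ⟩
      ∑ C (λ c → W c * offDiag c γ)            ∎)

  rank : List ℕ → ℕ
  rank a = length (filterᵇ (_≺ a) C)

  rank-< : ∀ {a c} → c ∈ C → (c ≺ a) ≡ true → rank c < rank a
  rank-< {a} {c} c∈ c≺a = length-filterᵇ-< (_≺ c) (_≺ a) C (λ x x≺c → ≺-trans x≺c c≺a) c∈ c≺a (≺-irrefl c)

  rank<length : ∀ {a} → a ∈ C → rank a < length C
  rank<length {a} a∈ = subst (rank a <_) (cong length (LP.filter-all (λ _ → T? true) (All.universal _ C)))
    (length-filterᵇ-< (_≺ a) (λ _ → true) C (λ _ _ → refl) a∈ refl (≺-irrefl a))

  walkSum-vanishes : ∀ k {a} γ → a ∈ C → rank a < k → walkSum k a γ ≡ + 0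
  walkSum-vanishes (suc k) {a} γ a∈ rank<k = ∑-zero C _ step-vanishes
    where
    step-vanishes : ∀ c → c ∈ C → - offDiag a c * walkSum k c γ ≡ + 0
    step-vanishes c c∈ with a ==ₗ c in a=c
    ... | true = refl
    ... | false with L a c in Lac
    ...   | zero = refl
    ...   | suc m = trans (cong (- (+ suc m) *_)
                      (walkSum-vanishes k γ c∈ (ℕP.<-≤-trans (rank-< c∈ (edge⇒≺ a∈ c∈ (edge-of-weight a=c Lac))) (ℕP.≤-pred rank<k))))
                      (ℤP.*-zeroʳ (- (+ suc m)))

  Linv-*-L : ∀ {α γ} → α ∈ C → γ ∈ C → ∑ C (λ β → Linv n α β * + L β γ) ≡ ind (α ==ₗ γ)
  Linv-*-L {α} {γ} α∈ γ∈ = begin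
    ∑ C (λ β → Linv n α β * + L β γ)
      ≡⟨ ∑-cong C (λ β β∈ → trans (cong (_* + L β γ) (Linv≡∑walkSum β α∈)) (sym (∑-*ʳ (upTo K) (+ L β γ) (λ k → walkSum k α β)))) ⟩
    ∑ C (λ β → ∑ (upTo K) (λ k → walkSum k α β * + L β γ))
      ≡⟨ sym (∑-swap (upTo K) C _) ⟩
    ∑ (upTo K) (λ k → ∑ C (λ β → walkSum k α β * + L β γ))
      ≡⟨ ∑-cong′ (upTo K) (λ k → walkSum-*-L k α∈ γ∈) ⟩
    ∑ (upTo K) (λ k → walkSum k α γ +ℤ - walkSum (suc k) α γ)
      ≡⟨ ∑-upTo-telescope (λ k → walkSum k α γ) K ⟩
    walkSum 0 α γ +ℤ - walkSum K α γ
      ≡⟨ cong (λ z → walkSum 0 α γ +ℤ - z) (walkSum-vanishes K γ α∈ (rank<length α∈)) ⟩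
    walkSum 0 α γ +ℤ - + 0
      ≡⟨ ℤP.+-identityʳ _ ⟩
    ind (α ==ₗ γ) ∎
    where
    open ≡-Reasoning
    K = length C


-- Adding and removing a box at the end of a row

dropLast : List ℕ → List ℕ
dropLast [] = []
dropLast (x ∷ []) = []
dropLast (x ∷ y ∷ r) = x ∷ dropLast (y ∷ r)

dropFromRow : ℕ → Tableau → Tableau
dropFromRow j [] = []
dropFromRow zero (r ∷ T) = dropLast r ∷ T
dropFromRow (suc j) (r ∷ T) = r ∷ dropFromRow j T

appendToRow : ℕ → ℕ → Tableau → Tableau
appendToRow j X [] = []
appendToRow zero X (r ∷ T) = (r ++ [ X ]) ∷ T
appendToRow (suc j) X (r ∷ T) = r ∷ appendToRow j X T

decAt : ℕ → List ℕ → List ℕ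
decAt j [] = []
decAt zero (a ∷ β) = (a ∸ 1) ∷ β
decAt (suc j) (a ∷ β) = a ∷ decAt j β

allZero : List ℕ → Bool
allZero = all (λ a → a ≡ᵇ 0)

removableAt : List ℕ → ℕ → Bool
removableAt [] j = false
removableAt (a ∷ β) zero = (1 ≤ᵇ a) ∧ ((2 ≤ᵇ a) ∨ allZero β)
removableAt (a ∷ β) (suc j) = removableAt β j

length-dropLast : ∀ r → length (dropLast r) ≡ length r ∸ 1
length-dropLast [] = refl
length-dropLast (x ∷ []) = refl
length-dropLast (x ∷ y ∷ r) = cong suc (length-dropLast (y ∷ r))

shape-dropFromRow : ∀ j T → map length (dropFromRow j T) ≡ decAt j (map length T)
shape-dropFromRow j [] = refl
shape-dropFromRow zero (r ∷ T) = cong (_∷ map length T) (length-dropLast r)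
shape-dropFromRow (suc j) (r ∷ T) = cong (length r ∷_) (shape-dropFromRow j T)

shape-appendToRow : ∀ j X T β → removableAt β j ≡ true → map length T ≡ decAt j β → map length (appendToRow j X T) ≡ β
shape-appendToRow j X [] [] c e = refl
shape-appendToRow j X [] (a ∷ β) c e with j
shape-appendToRow j X [] (a ∷ β) c () | zero
shape-appendToRow j X [] (a ∷ β) c () | suc _
shape-appendToRow zero X (r ∷ T) (a ∷ β) c e with LP.∷-injective e
... | e1 , e2 = cong₂ _∷_ (trans (length-∷ʳ r X) (trans (cong suc e1) (suc-pred a c))) e2
  where
  suc-pred : ∀ a → ((1 ≤ᵇ a) ∧ ((2 ≤ᵇ a) ∨ allZero β)) ≡ true → suc (a ∸ 1) ≡ a
  suc-pred (suc a) _ = refl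
  suc-pred zero ()
shape-appendToRow (suc j) X (r ∷ T) (a ∷ β) c e with LP.∷-injective e
... | e1 , e2 = cong₂ _∷_ e1 (shape-appendToRow j X T β c e2)
shape-appendToRow j X (r ∷ T) [] c ()

dropFromRow-appendToRow : ∀ j X T → dropFromRow j (appendToRow j X T) ≡ T
dropFromRow-appendToRow j X [] = refl
dropFromRow-appendToRow zero X (r ∷ T) = cong (_∷ T) (dropLast-∷ʳ r)
  where
  dropLast-∷ʳ : ∀ r → dropLast (r ++ [ X ]) ≡ r
  dropLast-∷ʳ [] = refl
  dropLast-∷ʳ (x ∷ []) = refl
  dropLast-∷ʳ (x ∷ y ∷ r) = cong (x ∷_) (dropLast-∷ʳ (y ∷ r))
dropFromRow-appendToRow (suc j) X (r ∷ T) = cong (r ∷_) (dropFromRow-appendToRow j X T)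

dropLast-snoc-max : ∀ X r → weakIncᵇ r ≡ true → All (_≤ X) r → X ∈ r → dropLast r ++ [ X ] ≡ r
dropLast-snoc-max X (x ∷ []) w b (here refl) = refl
dropLast-snoc-max X (x ∷ y ∷ r) w (bx ∷ by ∷ br) m = cong (x ∷_) (dropLast-snoc-max X (y ∷ r) w2 (by ∷ br) mt)
  where
  w1 : x ≤ y
  w1 = ℕP.≤ᵇ⇒≤ x y (≡true⇒T (proj₁ (∧-elim {x ≤ᵇ y} w)))
  w2 : weakIncᵇ (y ∷ r) ≡ true
  w2 = proj₂ (∧-elim {x ≤ᵇ y} w)
  mt' : X ∈ x ∷ y ∷ r → X ∈ y ∷ r
  mt' (here e) = here (ℕP.≤-antisym (subst (_≤ y) (sym e) w1) by)
  mt' (there m') = m'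
  mt : X ∈ y ∷ r
  mt = mt' m

Bounded : ℕ → Tableau → Set
Bounded X T = All (All (_≤ X)) T

appendToRow-dropFromRow : ∀ X T → all weakIncᵇ T ≡ true → Bounded X T → X ∈ concat T →
  appendToRow (rowOf X T) X (dropFromRow (rowOf X T) T) ≡ T
appendToRow-dropFromRow X (r ∷ T) w (br ∷ bT) m with elem X r in e
... | true = cong (_∷ T) (dropLast-snoc-max X r (proj₁ (∧-elim w)) br (elem-sound X r e))
... | false with MP.∈-++⁻ r m
...   | inj₁ mr = ⊥-elim (elem-false⇒∉ X r e mr)
...   | inj₂ mT = cong (r ∷_) (appendToRow-dropFromRow X T (proj₂ (∧-elim {weakIncᵇ r} w)) bT mT)

rowOf<length : ∀ X T → X ∈ concat T → rowOf X T < length T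
rowOf<length X (r ∷ T) m with elem X r in e
... | true = s≤s z≤n
... | false with MP.∈-++⁻ r m
...   | inj₁ mr = ⊥-elim (elem-false⇒∉ X r e mr)
...   | inj₂ mT = s≤s (rowOf<length X T mT)

rowsBefore : ℕ → (List ℕ → Bool) → Tableau → Bool
rowsBefore zero p T = true
rowsBefore (suc j) p [] = true
rowsBefore (suc j) p (r ∷ T) = p r ∧ rowsBefore j p T

absentAbove : ℕ → ℕ → Tableau → Bool
absentAbove X i T = rowsBefore i (λ r → not (elem X r)) T

absentAbove-rowOf : ∀ X T → absentAbove X (rowOf X T) T ≡ true
absentAbove-rowOf X [] = refl
absentAbove-rowOf X (r ∷ T) with elem X r in e
... | true = refl
... | false = trans (cong (λ b → not b ∧ absentAbove X (rowOf X T) T) e) (absentAbove-rowOf X T)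

absentAbove⇒≤rowOf : ∀ X i T → absentAbove X i T ≡ true → X ∈ concat T → i ≤ rowOf X T
absentAbove⇒≤rowOf X zero T h m = z≤n
absentAbove⇒≤rowOf X (suc i) (r ∷ T) h m with elem X r in e
... | true = ⊥-elim (false≢true h)
... | false with MP.∈-++⁻ r m
...   | inj₁ mr = ⊥-elim (elem-false⇒∉ X r e mr)
...   | inj₂ mT = s≤s (absentAbove⇒≤rowOf X i T h mT)

≤rowOf⇒absentAbove : ∀ X i T → i ≤ rowOf X T → absentAbove X i T ≡ true
≤rowOf⇒absentAbove X zero T le = refl
≤rowOf⇒absentAbove X (suc i) [] le = refl
≤rowOf⇒absentAbove X (suc i) (r ∷ T) le with elem X r in e
... | true = case le
  where case : suc i ≤ 0 → _
        case ()
... | false = ≤rowOf⇒absentAbove X i T (ℕP.≤-pred le)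

rowsBefore-dropFromRow : ∀ j p T → rowsBefore j p (dropFromRow j T) ≡ rowsBefore j p T
rowsBefore-dropFromRow zero p T = refl
rowsBefore-dropFromRow (suc j) p [] = refl
rowsBefore-dropFromRow (suc j) p (r ∷ T) = cong (p r ∧_) (rowsBefore-dropFromRow j p T)

rowsBefore-appendToRow : ∀ i j X p T → i ≤ j → rowsBefore i p (appendToRow j X T) ≡ rowsBefore i p T
rowsBefore-appendToRow zero j X p T le = refl
rowsBefore-appendToRow (suc i) j X p [] le = refl
rowsBefore-appendToRow (suc i) (suc j) X p (r ∷ T) (s≤s le) = cong (p r ∧_) (rowsBefore-appendToRow i j X p T le)

rowsBefore-mono : ∀ i j p T → i ≤ j → rowsBefore j p T ≡ true → rowsBefore i p T ≡ true
rowsBefore-mono zero j p T le h = refl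
rowsBefore-mono (suc i) (suc j) p [] le h = refl
rowsBefore-mono (suc i) (suc j) p (r ∷ T) (s≤s le) h = ∧-intro (proj₁ (∧-elim h)) (rowsBefore-mono i j p T le (proj₂ (∧-elim h)))

rowOf-appendToRow-other : ∀ y j X T → (y ≡ᵇ X) ≡ false → rowOf y (appendToRow j X T) ≡ rowOf y T
rowOf-appendToRow-other y j X [] ne = refl
rowOf-appendToRow-other y zero X (r ∷ T) ne rewrite elem-++ y r [ X ] | ne with elem y r
... | true = refl
... | false = refl
rowOf-appendToRow-other y (suc j) X (r ∷ T) ne = cong (λ z → if elem y r then 0 else suc z) (rowOf-appendToRow-other y j X T ne)

rowOf-appendToRow-self : ∀ j X T → j < length T → absentAbove X j T ≡ true → rowOf X (appendToRow j X T) ≡ j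
rowOf-appendToRow-self zero X (r ∷ T) lt h rewrite elem-++ X r [ X ] | ≡ᵇ-refl X with elem X r
... | true = refl
... | false = refl
rowOf-appendToRow-self (suc j) X (r ∷ T) (s≤s lt) h with elem X r in e
... | true = ⊥-elim (false≢true h)
... | false = cong suc (rowOf-appendToRow-self j X T lt h)

columnAbove : ℕ → Tableau → Bool
columnAbove b T = strictIncᵇ (b ∷ firstCol T)

≤-<ᵇ-trans : ∀ b c x → b ≤ c → (c <ᵇ x) ≡ true → (b <ᵇ x) ≡ true
≤-<ᵇ-trans b c x le h = T⇒≡true (ℕP.<⇒<ᵇ (ℕP.≤-<-trans le (ℕP.<ᵇ⇒< c x (≡true⇒T h))))

columnAbove-mono : ∀ b c T → b ≤ c → columnAbove c T ≡ true → columnAbove b T ≡ true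
columnAbove-mono b c T le h with firstCol T
... | [] = refl
... | x ∷ fc = ∧-intro (≤-<ᵇ-trans b c x le (proj₁ (∧-elim h))) (proj₂ (∧-elim {c <ᵇ x} h))

columnAbove-dropFromRow : ∀ j b T → columnAbove b T ≡ true → columnAbove b (dropFromRow j T) ≡ true
columnAbove-dropFromRow j b [] h = h
columnAbove-dropFromRow zero b ([] ∷ T) h = h
columnAbove-dropFromRow zero b ((x ∷ []) ∷ T) h = columnAbove-mono b x T (ℕP.<⇒≤ (ℕP.<ᵇ⇒< b x (≡true⇒T (proj₁ (∧-elim h))))) (proj₂ (∧-elim {b <ᵇ x} h))
columnAbove-dropFromRow zero b ((x ∷ y ∷ r) ∷ T) h = h
columnAbove-dropFromRow (suc j) b ([] ∷ T) h = columnAbove-dropFromRow j b T h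
columnAbove-dropFromRow (suc j) b ((x ∷ r) ∷ T) h = ∧-intro (proj₁ (∧-elim h)) (columnAbove-dropFromRow j x T (proj₂ (∧-elim {b <ᵇ x} h)))

allRowsEmpty : Tableau → Bool
allRowsEmpty T = all (λ r → Data.List.null r) T

emptyRowHasEmptyTail : ℕ → Tableau → Bool
emptyRowHasEmptyTail j [] = true
emptyRowHasEmptyTail zero ([] ∷ T) = allRowsEmpty T
emptyRowHasEmptyTail zero ((x ∷ r) ∷ T) = true
emptyRowHasEmptyTail (suc j) (r ∷ T) = emptyRowHasEmptyTail j T

allRowsEmpty⇒firstCol≡[] : ∀ T → allRowsEmpty T ≡ true → firstCol T ≡ []
allRowsEmpty⇒firstCol≡[] [] h = refl
allRowsEmpty⇒firstCol≡[] ([] ∷ T) h = allRowsEmpty⇒firstCol≡[] T h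

allBelow : ℕ → List ℕ → Bool
allBelow X r = all (λ x → x <ᵇ X) r

columnAbove-appendToRow : ∀ j b X T → (b <ᵇ X) ≡ true → rowsBefore j (allBelow X) T ≡ true → emptyRowHasEmptyTail j T ≡ true → columnAbove b T ≡ true → columnAbove b (appendToRow j X T) ≡ true
columnAbove-appendToRow j b X [] bX bf ec h = h
columnAbove-appendToRow zero b X ([] ∷ T) bX bf ec h rewrite allRowsEmpty⇒firstCol≡[] T ec = ∧-intro bX refl
columnAbove-appendToRow zero b X ((x ∷ r) ∷ T) bX bf ec h = h
columnAbove-appendToRow (suc j) b X ([] ∷ T) bX bf ec h = columnAbove-appendToRow j b X T bX (proj₂ (∧-elim {true} bf)) ec h
columnAbove-appendToRow (suc j) b X ((x ∷ r) ∷ T) bX bf ec h =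
  ∧-intro (proj₁ (∧-elim h)) (columnAbove-appendToRow j x X T (proj₁ (∧-elim (proj₁ (∧-elim bf)))) (proj₂ (∧-elim {allBelow X (x ∷ r)} bf)) ec (proj₂ (∧-elim {b <ᵇ x} h)))

columnAbove-bound⇒allRowsEmpty : ∀ X T → columnAbove X T ≡ true → Bounded X T → allRowsEmpty T ≡ true
columnAbove-bound⇒allRowsEmpty X [] h b = refl
columnAbove-bound⇒allRowsEmpty X ([] ∷ T) h (_ ∷ b) = columnAbove-bound⇒allRowsEmpty X T h b
columnAbove-bound⇒allRowsEmpty X ((x ∷ r) ∷ T) h ((bx ∷ _) ∷ b) = ⊥-elim (ℕP.<-irrefl refl (ℕP.<-≤-trans (ℕP.<ᵇ⇒< X x (≡true⇒T (proj₁ (∧-elim h)))) bx))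

removableAt-rowOf : ∀ b X T → columnAbove b T ≡ true → Bounded X T → X ∈ concat T → removableAt (map length T) (rowOf X T) ≡ true
removableAt-rowOf b X (r ∷ T) h (br ∷ bT) m with elem X r in e
removableAt-rowOf b X ([] ∷ T) h (br ∷ bT) m | true = ⊥-elim (false≢true e)
removableAt-rowOf b X ((x ∷ []) ∷ T) h (br ∷ bT) m | true = shape-allZero (columnAbove-bound⇒allRowsEmpty X T (subst (λ z → columnAbove z T ≡ true) xX (proj₂ (∧-elim {b <ᵇ x} h))) bT)
  where
  xX : x ≡ X
  xX with elem-sound X (x ∷ []) e
  ... | here p = sym p
  shape-allZero : allRowsEmpty T ≡ true → allZero (map length T) ≡ true
  shape-allZero = go T
    where
    go : ∀ T → allRowsEmpty T ≡ true → allZero (map length T) ≡ true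
    go [] _ = refl
    go ([] ∷ T) h = go T h
removableAt-rowOf b X ((x ∷ y ∷ r) ∷ T) h (br ∷ bT) m | true = refl
removableAt-rowOf b X (r ∷ T) h (br ∷ bT) m | false with MP.∈-++⁻ r m
... | inj₁ mr = ⊥-elim (elem-false⇒∉ X r e mr)
removableAt-rowOf b X ([] ∷ T) h (br ∷ bT) m | false | inj₂ mT = removableAt-rowOf b X T h bT mT
removableAt-rowOf b X ((x ∷ r) ∷ T) h (br ∷ bT) m | false | inj₂ mT = removableAt-rowOf x X T (proj₂ (∧-elim {b <ᵇ x} h)) bT mT

removableAt⇒emptyRowHasEmptyTail : ∀ j T β → removableAt β j ≡ true → map length T ≡ decAt j β → emptyRowHasEmptyTail j T ≡ true
removableAt⇒emptyRowHasEmptyTail j [] β c e = refl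
removableAt⇒emptyRowHasEmptyTail zero ((x ∷ r) ∷ T) (a ∷ β) c e = refl
removableAt⇒emptyRowHasEmptyTail zero ([] ∷ T) (a ∷ β) c e with LP.∷-injective e
... | e1 , e2 = go T β e2 (single-box⇒tail-empty a (proj₁ (∧-elim c)) (proj₂ (∧-elim {1 ≤ᵇ a} c)) (sym e1))
  where
  single-box⇒tail-empty : ∀ a → (1 ≤ᵇ a) ≡ true → ((2 ≤ᵇ a) ∨ allZero β) ≡ true → a ∸ 1 ≡ 0 → allZero β ≡ true
  single-box⇒tail-empty (suc zero) _ h _ = h
  single-box⇒tail-empty (suc (suc a)) _ _ ()
  go : ∀ T β → map length T ≡ β → allZero β ≡ true → allRowsEmpty T ≡ true
  go [] [] _ _ = refl
  go ([] ∷ T) (zero ∷ β) e h = go T β (proj₂ (LP.∷-injective e)) h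
  go ((x ∷ r) ∷ T) (zero ∷ β) () h
  go (r ∷ T) (suc a ∷ β) e ()
removableAt⇒emptyRowHasEmptyTail (suc j) (r ∷ T) (a ∷ β) c e = removableAt⇒emptyRowHasEmptyTail j T β c (proj₂ (LP.∷-injective e))
removableAt⇒emptyRowHasEmptyTail zero (r ∷ T) [] () e
removableAt⇒emptyRowHasEmptyTail (suc j) (r ∷ T) [] () e

weakInc-dropLast : ∀ r → weakIncᵇ r ≡ true → weakIncᵇ (dropLast r) ≡ true
weakInc-dropLast [] h = refl
weakInc-dropLast (x ∷ []) h = refl
weakInc-dropLast (x ∷ y ∷ []) h = refl
weakInc-dropLast (x ∷ y ∷ z ∷ r) h = ∧-intro (proj₁ (∧-elim h)) (weakInc-dropLast (y ∷ z ∷ r) (proj₂ (∧-elim {x ≤ᵇ y} h)))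

weakInc-snoc : ∀ X r → weakIncᵇ r ≡ true → All (_≤ X) r → weakIncᵇ (r ++ [ X ]) ≡ true
weakInc-snoc X [] h b = refl
weakInc-snoc X (x ∷ []) h (bx ∷ []) = ∧-intro (T⇒≡true (ℕP.≤⇒≤ᵇ bx)) refl
weakInc-snoc X (x ∷ y ∷ r) h (bx ∷ b) = ∧-intro (proj₁ (∧-elim h)) (weakInc-snoc X (y ∷ r) (proj₂ (∧-elim {x ≤ᵇ y} h)) b)

AllEntries : (ℕ → Set) → Tableau → Set
AllEntries Q T = All (All Q) T

All-dropLast : ∀ {Q : ℕ → Set} r → All Q r → All Q (dropLast r)
All-dropLast [] a = a
All-dropLast (x ∷ []) a = []
All-dropLast (x ∷ y ∷ r) (p ∷ a) = p ∷ All-dropLast (y ∷ r) a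

AllEntries-dropFromRow : ∀ {Q : ℕ → Set} j T → AllEntries Q T → AllEntries Q (dropFromRow j T)
AllEntries-dropFromRow j [] a = a
AllEntries-dropFromRow zero (r ∷ T) (p ∷ a) = All-dropLast r p ∷ a
AllEntries-dropFromRow (suc j) (r ∷ T) (p ∷ a) = p ∷ AllEntries-dropFromRow j T a

AllEntries-appendToRow : ∀ {Q : ℕ → Set} j X T → AllEntries Q T → Q X → AllEntries Q (appendToRow j X T)
AllEntries-appendToRow j X [] a q = a
AllEntries-appendToRow zero X (r ∷ T) (p ∷ a) q = AllP.∷ʳ⁺ p q ∷ a
AllEntries-appendToRow (suc j) X (r ∷ T) (p ∷ a) q = p ∷ AllEntries-appendToRow j X T a q

rowsWeakInc-dropFromRow : ∀ j T → all weakIncᵇ T ≡ true → all weakIncᵇ (dropFromRow j T) ≡ true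
rowsWeakInc-dropFromRow j [] h = h
rowsWeakInc-dropFromRow zero (r ∷ T) h = ∧-intro (weakInc-dropLast r (proj₁ (∧-elim h))) (proj₂ (∧-elim {weakIncᵇ r} h))
rowsWeakInc-dropFromRow (suc j) (r ∷ T) h = ∧-intro (proj₁ (∧-elim h)) (rowsWeakInc-dropFromRow j T (proj₂ (∧-elim {weakIncᵇ r} h)))

rowsWeakInc-appendToRow : ∀ j X T → all weakIncᵇ T ≡ true → Bounded X T → all weakIncᵇ (appendToRow j X T) ≡ true
rowsWeakInc-appendToRow j X [] h b = h
rowsWeakInc-appendToRow zero X (r ∷ T) h (br ∷ b) = ∧-intro (weakInc-snoc X r (proj₁ (∧-elim h)) br) (proj₂ (∧-elim {weakIncᵇ r} h))
rowsWeakInc-appendToRow (suc j) X (r ∷ T) h (br ∷ b) = ∧-intro (proj₁ (∧-elim h)) (rowsWeakInc-appendToRow j X T (proj₂ (∧-elim {weakIncᵇ r} h)) b)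

Positive : Tableau → Set
Positive T = AllEntries (1 ≤_) T

firstCol-positive : ∀ T → Positive T → All (1 ≤_) (firstCol T)
firstCol-positive [] [] = []
firstCol-positive ([] ∷ T) (_ ∷ a) = firstCol-positive T a
firstCol-positive ((x ∷ r) ∷ T) ((p ∷ _) ∷ a) = p ∷ firstCol-positive T a

strictInc-firstCol≡columnAbove0 : ∀ T → Positive T → strictIncᵇ (firstCol T) ≡ columnAbove 0 T
strictInc-firstCol≡columnAbove0 T pT with firstCol T | firstCol-positive T pT
... | [] | _ = refl
... | suc x ∷ fc | _ = refl
... | zero ∷ fc | (() ∷ _)

immaculate-dropFromRow : ∀ j T → Positive T → isImmaculateᵇ T ≡ true → isImmaculateᵇ (dropFromRow j T) ≡ true
immaculate-dropFromRow j T pT h =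
  ∧-intro (rowsWeakInc-dropFromRow j T (proj₁ (∧-elim h)))
    (trans (strictInc-firstCol≡columnAbove0 (dropFromRow j T) (AllEntries-dropFromRow j T pT)) (columnAbove-dropFromRow j 0 T (trans (sym (strictInc-firstCol≡columnAbove0 T pT)) (proj₂ (∧-elim {all weakIncᵇ T} h)))))

immaculate-appendToRow : ∀ j X T → Positive T → 1 ≤ X → isImmaculateᵇ T ≡ true → Bounded X T → rowsBefore j (allBelow X) T ≡ true → emptyRowHasEmptyTail j T ≡ true →
  isImmaculateᵇ (appendToRow j X T) ≡ true
immaculate-appendToRow j X T pT pX h bT bf ec =
  ∧-intro (rowsWeakInc-appendToRow j X T (proj₁ (∧-elim h)) bT)
    (trans (strictInc-firstCol≡columnAbove0 (appendToRow j X T) (AllEntries-appendToRow j X T pT pX))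
      (columnAbove-appendToRow j 0 X T (T⇒≡true (ℕP.<⇒<ᵇ pX)) bf ec (trans (sym (strictInc-firstCol≡columnAbove0 T pT)) (proj₂ (∧-elim {all weakIncᵇ T} h)))))

allBelow-row : ∀ X r → All (_≤ X) r → elem X r ≡ false → allBelow X r ≡ true
allBelow-row X [] _ _ = refl
allBelow-row X (x ∷ r) (bx ∷ b) e with X ≡ᵇ x in e1
... | true = ⊥-elim (false≢true (sym e))
... | false = ∧-intro (T⇒≡true (ℕP.<⇒<ᵇ (ℕP.≤∧≢⇒< bx (λ xX → false≢true (trans (sym e1) (trans (cong (X ≡ᵇ_) xX) (≡ᵇ-refl X))))))) (allBelow-row X r b e)

absentAbove⇒allBelow : ∀ X j T → Bounded X T → absentAbove X j T ≡ true → rowsBefore j (allBelow X) T ≡ true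
absentAbove⇒allBelow X zero T b h = refl
absentAbove⇒allBelow X (suc j) [] b h = refl
absentAbove⇒allBelow X (suc j) (r ∷ T) (br ∷ b) h with elem X r in e
... | true = ⊥-elim (false≢true h)
... | false = ∧-intro (allBelow-row X r br e) (absentAbove⇒allBelow X j T b h)

bounded⇒allBelow : ∀ B X j T → Bounded B T → B < X → rowsBefore j (allBelow X) T ≡ true
bounded⇒allBelow B X zero T b lt = refl
bounded⇒allBelow B X (suc j) [] b lt = refl
bounded⇒allBelow B X (suc j) (r ∷ T) (br ∷ b) lt = ∧-intro (go r br) (bounded⇒allBelow B X j T b lt)
  where
  go : ∀ r → All (_≤ B) r → allBelow X r ≡ true
  go [] _ = refl
  go (x ∷ r) (p ∷ ps) = ∧-intro (T⇒≡true (ℕP.<⇒<ᵇ (ℕP.≤-<-trans p lt))) (go r ps)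

count-++ : ∀ i xs ys → count i (xs ++ ys) ≡ count i xs + count i ys
count-++ i [] ys = refl
count-++ i (x ∷ xs) ys with i ≡ᵇ x
... | true = cong suc (count-++ i xs ys)
... | false = count-++ i xs ys

indicator : ℕ → ℕ → ℕ
indicator i X = if i ≡ᵇ X then 1 else 0

count-append : ∀ i j X T → j < length T → count i (concat (appendToRow j X T)) ≡ count i (concat T) + indicator i X
count-append i zero X (r ∷ T) lt =
  trans (count-++ i (r ++ [ X ]) (concat T))
   (trans (cong (_+ count i (concat T)) (trans (count-++ i r [ X ]) (cong (λ z → count i r + z) (count-singleton i X))))
    (trans (ℕP.+-assoc (count i r) (indicator i X) (count i (concat T)))
     (trans (cong (λ z → count i r + z) (ℕP.+-comm (indicator i X) _))
      (trans (sym (ℕP.+-assoc (count i r) (count i (concat T)) (indicator i X)))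
       (cong (_+ indicator i X) (sym (count-++ i r (concat T))))))))
  where
  count-singleton : ∀ i X → count i [ X ] ≡ indicator i X
  count-singleton i X with i ≡ᵇ X
  ... | true = refl
  ... | false = refl
count-append i (suc j) X (r ∷ T) (s≤s lt) =
  trans (count-++ i r (concat (appendToRow j X T)))
   (trans (cong (λ z → count i r + z) (count-append i j X T lt))
    (trans (sym (ℕP.+-assoc (count i r) _ _)) (cong (_+ indicator i X) (sym (count-++ i r (concat T))))))

countIn : Tableau → ℕ → ℕ
countIn T i = count i (concat T)

content-snoc : ∀ N T → content (suc N) T ≡ map (countIn T) (oneTo N) ++ [ countIn T (suc N) ]
content-snoc N T = trans (cong (map (countIn T)) (sym (LP.applyUpTo-∷ʳ suc N))) (LP.map-++ (countIn T) (oneTo N) [ suc N ])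

indicator-< : ∀ i X → i < X → indicator i X ≡ 0
indicator-< i X lt with i ≡ᵇ X in e
... | true = ⊥-elim (ℕP.<-irrefl (≡ᵇ⇒≡ e) lt)
... | false = refl

map-cong-∈ : ∀ {A B : Set} (f g : A → B) xs → (∀ x → x ∈ xs → f x ≡ g x) → map f xs ≡ map g xs
map-cong-∈ f g [] h = refl
map-cong-∈ f g (x ∷ xs) h = cong₂ _∷_ (h x (here refl)) (map-cong-∈ f g xs (λ y m → h y (there m)))

content-append : ∀ N j T → j < length T →
  content (suc N) (appendToRow j (suc N) T) ≡ map (countIn T) (oneTo N) ++ [ suc (countIn T (suc N)) ]
content-append N j T lt =
  trans (content-snoc N (appendToRow j (suc N) T))
   (cong₂ _++_ (map-cong-∈ _ _ (oneTo N) (λ i m → trans (count-append i j (suc N) T lt)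
                   (trans (cong (λ z → countIn T i + z) (indicator-< i (suc N) (s≤s (proj₂ (∈-oneTo⁻ m))))) (ℕP.+-identityʳ _))))
               (cong [_] (trans (count-append (suc N) j (suc N) T lt) (trans (cong (λ z → countIn T (suc N) + z) (cong (λ b → if b then 1 else 0) (≡ᵇ-refl (suc N)))) (ℕP.+-comm _ 1)))))

count≡0⇒∉ : ∀ i xs → count i xs ≡ 0 → i ∉ xs
count≡0⇒∉ i (x ∷ xs) h (here refl) rewrite ≡ᵇ-refl i = case h
  where case : suc _ ≡ 0 → ⊥
        case ()
count≡0⇒∉ i (x ∷ xs) h (there m) with i ≡ᵇ x
... | true = case h
  where case : suc _ ≡ 0 → ⊥
        case ()
... | false = count≡0⇒∉ i xs h m

∉⇒count≡0 : ∀ i xs → i ∉ xs → count i xs ≡ 0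
∉⇒count≡0 i [] h = refl
∉⇒count≡0 i (x ∷ xs) h with i ≡ᵇ x in e
... | true = ⊥-elim (h (here (≡ᵇ⇒≡ e)))
... | false = ∉⇒count≡0 i xs (λ m → h (there m))

∈-concat : ∀ {x} (T : Tableau) {r} → r ∈ T → x ∈ r → x ∈ concat T
∈-concat (r ∷ T) (here refl) m = MP.∈-++⁺ˡ m
∈-concat (r' ∷ T) (there mr) m = MP.∈-++⁺ʳ r' (∈-concat T mr m)

AllEntries-∈⁺ : ∀ {Q : ℕ → Set} T → (∀ x → x ∈ concat T → Q x) → AllEntries Q T
AllEntries-∈⁺ [] h = []
AllEntries-∈⁺ (r ∷ T) h = go r (λ x m → h x (MP.∈-++⁺ˡ m)) ∷ AllEntries-∈⁺ T (λ x m → h x (MP.∈-++⁺ʳ r m))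
  where
  go : ∀ r → (∀ x → x ∈ r → _) → All _ r
  go [] h = []
  go (x ∷ r) h = h x (here refl) ∷ go r (λ y m → h y (there m))

AllEntries-∈⁻ : ∀ {Q : ℕ → Set} T → AllEntries Q T → ∀ x → x ∈ concat T → Q x
AllEntries-∈⁻ (r ∷ T) (a ∷ as) x m with MP.∈-++⁻ r m
... | inj₁ mr = go r a mr
  where
  go : ∀ {x} r → All _ r → x ∈ r → _
  go (y ∷ r) (p ∷ _) (here refl) = p
  go (y ∷ r) (_ ∷ ps) (there m) = go r ps m
... | inj₂ mT = AllEntries-∈⁻ T as x mT

AllEntries-oneTo⁻ : ∀ N T → AllEntries (_∈ oneTo N) T → Positive T × Bounded N T
AllEntries-oneTo⁻ N T a = AllEntries-∈⁺ T (λ x m → proj₁ (∈-oneTo⁻ (AllEntries-∈⁻ T a x m))) , AllEntries-∈⁺ T (λ x m → proj₂ (∈-oneTo⁻ (AllEntries-∈⁻ T a x m)))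

AllEntries-oneTo⁺ : ∀ N T → Positive T → Bounded N T → AllEntries (_∈ oneTo N) T
AllEntries-oneTo⁺ N T p b = AllEntries-∈⁺ T (λ x m → ∈-oneTo⁺ (AllEntries-∈⁻ T p x m) (AllEntries-∈⁻ T b x m))

Bounded-pred : ∀ N T → Bounded (suc N) T → countIn T (suc N) ≡ 0 → Bounded N T
Bounded-pred N T b c = AllEntries-∈⁺ T (λ x m → ℕP.≤-pred (ℕP.≤∧≢⇒< (AllEntries-∈⁻ T b x m) (λ e → count≡0⇒∉ (suc N) (concat T) c (subst (_∈ concat T) e m))))

Bounded⇒count-suc≡0 : ∀ N T → Bounded N T → countIn T (suc N) ≡ 0
Bounded⇒count-suc≡0 N T b = ∉⇒count≡0 (suc N) (concat T) (λ m → ℕP.<-irrefl refl (AllEntries-∈⁻ T b (suc N) m))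

-- Removing the largest entry

dependentPairs : List ℕ → (ℕ → Bool) → (ℕ → List Tableau) → List (ℕ × Tableau)
dependentPairs J c F = concatMap (λ j → if c j then map (j ,_) (F j) else []) J

Unique-dependentPairs : ∀ J c F → Unique J → (∀ j → Unique (F j)) → Unique (dependentPairs J c F)
Unique-dependentPairs J c F uJ uF = Unique-concatMap (λ j → if c j then map (j ,_) (F j) else [])
  (λ {x} {y} {b} m1 m2 → trans (tag x b m1) (sym (tag y b m2))) (λ j → uj j) uJ
  where
  tag : ∀ x b → b ∈ (if c x then map (x ,_) (F x) else []) → x ≡ proj₁ b
  tag x b m with c x
  tag x b m | true with MP.∈-map⁻ (x ,_) m
  ... | T , _ , refl = refl
  tag x b () | false
  uj : ∀ j → Unique (if c j then map (j ,_) (F j) else [])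
  uj j with c j
  ... | true = Unique.map⁺ (λ e → cong proj₂ e) (uF j)
  ... | false = []

∈-dependentPairs⁺ : ∀ J c F {j T} → j ∈ J → c j ≡ true → T ∈ F j → (j , T) ∈ dependentPairs J c F
∈-dependentPairs⁺ J c F {j} mj cj mT = ∈-concatMap⁺ (λ j → if c j then map (j ,_) (F j) else []) J mj (pair∈block cj)
  where
  pair∈block : c j ≡ true → (j , _) ∈ (if c j then map (j ,_) (F j) else [])
  pair∈block e rewrite e = MP.∈-map⁺ (j ,_) mT

∈-dependentPairs⁻ : ∀ J c F {y} → y ∈ dependentPairs J c F → proj₁ y ∈ J × c (proj₁ y) ≡ true × proj₂ y ∈ F (proj₁ y)
∈-dependentPairs⁻ J c F {y} m with ∈-concatMap⁻ (λ j → if c j then map (j ,_) (F j) else []) J m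
... | j , mj , m2 with c j in e
...   | true with MP.∈-map⁻ (j ,_) m2
...     | T , mT , refl = mj , e , mT
∈-dependentPairs⁻ J c F {y} m | j , mj , () | false

length-filterᵇ-dependentPairs : ∀ J c F (q : ℕ × Tableau → Bool) →
  + length (filterᵇ q (dependentPairs J c F)) ≡ ∑ J (λ j → if c j then + length (filterᵇ (λ T → q (j , T)) (F j)) else + 0)
length-filterᵇ-dependentPairs J c F q =
  trans (length-filterᵇ q (dependentPairs J c F))
   (trans (∑-concatMap (λ j → if c j then map (j ,_) (F j) else []) J _)
    (∑-cong′ J (λ j → count-block j)))
  where
  count-block : ∀ j → ∑ (if c j then map (j ,_) (F j) else []) (λ x → ind (q x)) ≡ (if c j then + length (filterᵇ (λ T → q (j , T)) (F j)) else + 0)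
  count-block j with c j
  ... | true = trans (∑-map (j ,_) (F j) _) (sym (length-filterᵇ _ (F j)))
  ... | false = refl

length-filterᵇ-∧ : ∀ {A : Set} (b : Bool) (p : A → Bool) xs → length (filterᵇ (λ x → b ∧ p x) xs) ≡ (if b then length (filterᵇ p xs) else 0)
length-filterᵇ-∧ true p xs = refl
length-filterᵇ-∧ false p [] = refl
length-filterᵇ-∧ false p (x ∷ xs) = length-filterᵇ-∧ false p xs

fillings-shape : ∀ β N {T} → T ∈ fillings β N → map length T ≡ β
fillings-shape β N m = proj₁ (∈-fillings⁻ β N m)

length-shape : ∀ {T : Tableau} {β} → map length T ≡ β → length T ≡ length β
length-shape {T} refl = sym (LP.length-map length T)

length-decAt : ∀ j β → length (decAt j β) ≡ length β
length-decAt j [] = refl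
length-decAt zero (a ∷ β) = refl
length-decAt (suc j) (a ∷ β) = cong suc (length-decAt j β)

∈-fillings : ∀ β N T → map length T ≡ β → AllEntries (_∈ oneTo N) T → T ∈ fillings β N
∈-fillings β N T e a = subst (λ s → T ∈ fillings s N) e (∈-fillings⁺ N T a)

immaculate⇒columnAbove0 : ∀ T → Positive T → isImmaculateᵇ T ≡ true → columnAbove 0 T ≡ true
immaculate⇒columnAbove0 T pT h = trans (sym (strictInc-firstCol≡columnAbove0 T pT)) (proj₂ (∧-elim {all weakIncᵇ T} h))

∉⇒absentAbove : ∀ X i T → X ∉ concat T → absentAbove X i T ≡ true
∉⇒absentAbove X zero T h = refl
∉⇒absentAbove X (suc i) [] h = refl
∉⇒absentAbove X (suc i) (r ∷ T) h = ∧-intro (cong not (∉⇒elem-false X r (λ m → h (MP.∈-++⁺ˡ m)))) (∉⇒absentAbove X i T (λ m → h (MP.∈-++⁺ʳ r m)))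

count≡suc⇒∈ : ∀ i xs {k} → count i xs ≡ suc k → i ∈ xs
count≡suc⇒∈ i (x ∷ xs) h with i ≡ᵇ x in e
... | true = here (≡ᵇ⇒≡ e)
... | false = there (count≡suc⇒∈ i xs h)

-- The index i records that the largest letter N occurs in no row above row i.  Removing the
-- last entry of the highest row j containing N leaves a tableau whose remaining N's avoid the
-- rows above j, so these constrained counts satisfy a closed recursion.
isImmaculateOfContentᵇ : ℕ → List ℕ → ℕ → Tableau → Bool
isImmaculateOfContentᵇ N e i T = (isImmaculateᵇ T ∧ (content N T ==ₗ e)) ∧ absentAbove N i T

#immaculate : ℕ → List ℕ → List ℕ → ℕ → ℕ
#immaculate N β e i = length (filterᵇ (isImmaculateOfContentᵇ N e i) (fillings β N))

+-if : ∀ (b : Bool) x → + (if b then x else 0) ≡ (if b then + x else + 0)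
+-if true x = refl
+-if false x = refl

∧-elim₃ : ∀ {a b c} → ((a ∧ b) ∧ c) ≡ true → a ≡ true × b ≡ true × c ≡ true
∧-elim₃ {true} {true} {true} refl = refl , refl , refl

∧-intro₃ : ∀ {a b c} → a ≡ true → b ≡ true → c ≡ true → ((a ∧ b) ∧ c) ≡ true
∧-intro₃ refl refl refl = refl

module RemoveLargestImmaculate (N' : ℕ) (β e' : List ℕ) (m i : ℕ) where
  N : ℕ
  N = suc N'
  e : List ℕ
  e = e' ++ [ suc m ]
  e⁻ : List ℕ
  e⁻ = e' ++ [ m ]
  Js : List ℕ
  Js = upTo (length β)
  Fs : ℕ → List Tableau
  Fs j = fillings (decAt j β) N
  ys : List (ℕ × Tableau)
  ys = dependentPairs Js (removableAt β) Fs
  p : Tableau → Bool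
  p = isImmaculateOfContentᵇ N e i
  q : ℕ × Tableau → Bool
  q (j , T') = (i ≤ᵇ j) ∧ isImmaculateOfContentᵇ N e⁻ j T'
  f : Tableau → ℕ × Tableau
  f T = (rowOf N T , dropFromRow (rowOf N T) T)
  g : ℕ × Tableau → Tableau
  g (j , T') = appendToRow j N T'

  fwd : ∀ T → T ∈ fillings β N → p T ≡ true → f T ∈ ys × q (f T) ≡ true × g (f T) ≡ T
  fwd T mT pT = mem , ∧-intro (≤⇒≤ᵇ (absentAbove⇒≤rowOf N i T na inT)) (∧-intro₃ imm' cont' na') , gf
    where
    shape = fillings-shape β N mT
    a = proj₂ (∈-fillings⁻ β N mT)
    pos = proj₁ (AllEntries-oneTo⁻ N T a)
    bnd = proj₂ (AllEntries-oneTo⁻ N T a)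
    parts = ∧-elim₃ pT
    im = proj₁ parts
    ct = ==ₗ⇒≡ (proj₁ (proj₂ parts))
    na = proj₂ (proj₂ parts)
    j = rowOf N T
    T' = dropFromRow j T
    ctT : map (countIn T) (oneTo N') ++ [ countIn T N ] ≡ e' ++ [ suc m ]
    ctT = trans (sym (content-snoc N' T)) ct
    inT : N ∈ concat T
    inT = count≡suc⇒∈ N (concat T) (proj₂ (LP.∷ʳ-injective _ _ ctT))
    gf : appendToRow j N T' ≡ T
    gf = appendToRow-dropFromRow N T (proj₁ (∧-elim im)) bnd inT
    jlt : j < length T'
    jlt = subst (j <_) (trans (length-shape shape) (trans (sym (length-decAt j β)) (sym (length-shape (trans (shape-dropFromRow j T) (cong (decAt j) shape)))))) (rowOf<length N T inT)
    ctA : map (countIn T') (oneTo N') ++ [ suc (countIn T' N) ] ≡ e' ++ [ suc m ]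
    ctA = trans (sym (content-append N' j T' jlt)) (trans (cong (content N) gf) ct)
    cont' : (content N T' ==ₗ e⁻) ≡ true
    cont' = ≡⇒==ₗ (trans (content-snoc N' T') (cong₂ _++_ (proj₁ (LP.∷ʳ-injective _ _ ctA)) (cong [_] (ℕP.suc-injective (proj₂ (LP.∷ʳ-injective _ _ ctA))))))
    imm' = immaculate-dropFromRow j T pos im
    na' : absentAbove N j T' ≡ true
    na' = trans (rowsBefore-dropFromRow j _ T) (absentAbove-rowOf N T)
    cr : removableAt β j ≡ true
    cr = subst (λ s → removableAt s j ≡ true) shape (removableAt-rowOf 0 N T (immaculate⇒columnAbove0 T pos im) bnd inT)
    mem : f T ∈ ys
    mem = ∈-dependentPairs⁺ Js (removableAt β) Fs (∈-upTo⁺ (subst (j <_) (length-shape shape) (rowOf<length N T inT))) cr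
            (∈-fillings (decAt j β) N T' (trans (shape-dropFromRow j T) (cong (decAt j) shape)) (AllEntries-dropFromRow j T a))

  bwd : ∀ y → y ∈ ys → q y ≡ true → g y ∈ fillings β N × p (g y) ≡ true × f (g y) ≡ y
  bwd (j , T') my qy = memT , ∧-intro₃ imT (≡⇒==ₗ ctT) naT , fg
    where
    mparts = ∈-dependentPairs⁻ Js (removableAt β) Fs my
    mj = proj₁ mparts
    cr = proj₁ (proj₂ mparts)
    mT' = proj₂ (proj₂ mparts)
    sh' = fillings-shape (decAt j β) N mT'
    a' = proj₂ (∈-fillings⁻ (decAt j β) N mT')
    pos' = proj₁ (AllEntries-oneTo⁻ N T' a')
    bnd' = proj₂ (AllEntries-oneTo⁻ N T' a')
    ij = ≤ᵇ⇒≤ {i} {j} (proj₁ (∧-elim qy))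
    parts = ∧-elim₃ (proj₂ (∧-elim {i ≤ᵇ j} qy))
    im' = proj₁ parts
    ct' = ==ₗ⇒≡ (proj₁ (proj₂ parts))
    na' = proj₂ (proj₂ parts)
    T = appendToRow j N T'
    jlt : j < length T'
    jlt = subst (j <_) (trans (sym (length-decAt j β)) (sym (length-shape sh'))) (∈-upTo⁻ mj)
    memT : T ∈ fillings β N
    memT = ∈-fillings β N T (shape-appendToRow j N T' β cr sh') (AllEntries-appendToRow j N T' a' (∈-oneTo⁺ (s≤s z≤n) ℕP.≤-refl))
    ctS : map (countIn T') (oneTo N') ++ [ countIn T' N ] ≡ e' ++ [ m ]
    ctS = trans (sym (content-snoc N' T')) ct'
    ctT : content N T ≡ e
    ctT = trans (content-append N' j T' jlt) (cong₂ _++_ (proj₁ (LP.∷ʳ-injective _ _ ctS)) (cong [_] (cong suc (proj₂ (LP.∷ʳ-injective _ _ ctS)))))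
    imT = immaculate-appendToRow j N T' pos' (s≤s z≤n) im' bnd' (absentAbove⇒allBelow N j T' bnd' na') (removableAt⇒emptyRowHasEmptyTail j T' β cr sh')
    naT : absentAbove N i T ≡ true
    naT = trans (rowsBefore-appendToRow i j N _ T' ij) (rowsBefore-mono i j _ T' ij na')
    fg : f T ≡ (j , T')
    fg rewrite rowOf-appendToRow-self j N T' jlt na' = cong (j ,_) (dropFromRow-appendToRow j N T')

  uys : Unique ys
  uys = Unique-dependentPairs Js (removableAt β) Fs (Unique.upTo⁺ (length β)) (λ j → Unique-fillings (decAt j β) N)

  #immaculate-removeLargest : + #immaculate N β e i ≡ ∑ Js (λ j → if removableAt β j then (if i ≤ᵇ j then + #immaculate N (decAt j β) e⁻ j else + 0) else + 0)
  #immaculate-removeLargest = trans (cong +_ (length-filterᵇ-bijection (fillings β N) ys p q f g (Unique-fillings β N) uys fwd bwd))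
        (trans (length-filterᵇ-dependentPairs Js (removableAt β) Fs q)
          (∑-cong′ Js (λ j → count-row j)))
    where
    count-row : ∀ j → (if removableAt β j then + length (filterᵇ (λ T → q (j , T)) (Fs j)) else + 0) ≡
                (if removableAt β j then (if i ≤ᵇ j then + #immaculate N (decAt j β) e⁻ j else + 0) else + 0)
    count-row j with removableAt β j
    ... | false = refl
    ... | true = trans (cong +_ (length-filterᵇ-∧ (i ≤ᵇ j) (isImmaculateOfContentᵇ N e⁻ j) (Fs j))) (+-if (i ≤ᵇ j) _)

-- The flag lp switches the row constraint on the entry n on or off; it is on exactly when the
-- last exponent of the content is positive, i.e. when n standardizes an occurrence of its largest letter.
isStandardWithDescentsInᵇ : ℕ → List ℕ → Bool → ℕ → Tableau → Bool
isStandardWithDescentsInᵇ n S lp i U = ((isImmaculateᵇ U ∧ (content n U ==ₗ replicate n 1)) ∧ all (λ d → elem d S) (descentSet n U))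
                 ∧ (if lp then absentAbove n i U else true)

#standard : ℕ → List ℕ → Bool → List ℕ → ℕ → ℕ
#standard n S lp β i = length (filterᵇ (isStandardWithDescentsInᵇ n S lp i) (fillings β n))

all-++ : ∀ (Q : ℕ → Bool) xs ys → all Q (xs ++ ys) ≡ (all Q xs ∧ all Q ys)
all-++ Q [] ys = refl
all-++ Q (x ∷ xs) ys rewrite all-++ Q xs ys with Q x
... | true = refl
... | false = refl

all-cong : ∀ (P Q : ℕ → Bool) xs → (∀ x → x ∈ xs → P x ≡ Q x) → all P xs ≡ all Q xs
all-cong P Q [] h = refl
all-cong P Q (x ∷ xs) h = cong₂ _∧_ (h x (here refl)) (all-cong P Q xs (λ y m → h y (there m)))

descentAt-appendToRow : ∀ n' j U' d → d < n' → descentAtᵇ (appendToRow j (suc n') U') d ≡ descentAtᵇ U' d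
descentAt-appendToRow n' j U' d lt =
  cong₂ _<ᵇ_ (rowOf-appendToRow-other d j (suc n') U' (ne d (ℕP.<-trans lt (ℕP.n<1+n n'))))
             (rowOf-appendToRow-other (suc d) j (suc n') U' (ne (suc d) (s≤s lt)))
  where
  ne : ∀ x → x < suc n' → (x ≡ᵇ suc n') ≡ false
  ne x lt with x ≡ᵇ suc n' in e
  ... | true = ⊥-elim (ℕP.<-irrefl (≡ᵇ⇒≡ e) lt)
  ... | false = refl

all-descentSet-appendToRow : ∀ n' j U' (Q : ℕ → Bool) →
  all Q (descentSet (suc n') (appendToRow j (suc n') U')) ≡
    (all Q (descentSet n' U') ∧ (if (1 ≤ᵇ n') ∧ descentAtᵇ (appendToRow j (suc n') U') n' then Q n' else true))
all-descentSet-appendToRow zero j U' Q = refl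
all-descentSet-appendToRow (suc k) j U' Q =
  trans (cong (all Q) (trans (cong (filterᵇ (descentAtᵇ U)) (sym (LP.applyUpTo-∷ʳ suc k))) (LP.filter-++ (λ x → T? (descentAtᵇ U x)) (oneTo k) [ suc k ])))
   (trans (all-++ Q (filterᵇ (descentAtᵇ U) (oneTo k)) _)
     (cong₂ _∧_ (cong (all Q) (filterᵇ-cong (oneTo k) _ _ (λ d m → descentAt-appendToRow (suc k) j U' d (s≤s (proj₂ (∈-oneTo⁻ m))))))
                last-descent))
  where
  U = appendToRow j (suc (suc k)) U'
  last-descent : all Q (filterᵇ (descentAtᵇ U) [ suc k ]) ≡ (if descentAtᵇ U (suc k) then Q (suc k) else true)
  last-descent with descentAtᵇ U (suc k)
  ... | true with Q (suc k)
  ...   | true = refl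
  ...   | false = refl
  last-descent | false = refl

map≡replicate⇒∈ : ∀ (f : ℕ → ℕ) xs c {x} → map f xs ≡ replicate (length xs) c → x ∈ xs → f x ≡ c
map≡replicate⇒∈ f (y ∷ xs) c e (here refl) = proj₁ (LP.∷-injective e)
map≡replicate⇒∈ f (y ∷ xs) c e (there m) = map≡replicate⇒∈ f xs c (proj₂ (LP.∷-injective e)) m

∈-descentSet⇒< : ∀ n U {d} → d ∈ descentSet n U → d < n
∈-descentSet⇒< (suc n') U m = s≤s (ℕP.≤-trans (proj₂ (∈-oneTo⁻ (proj₁ (∈-filterᵇ⁻ _ m)))) ℕP.≤-refl)
∈-descentSet⇒< zero U ()

no-descent-of-guard : ∀ (a b c : Bool) → (if a ∧ b then c else true) ≡ true → a ≡ true → c ≡ false → b ≡ false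
no-descent-of-guard true true c h _ e = ⊥-elim (false≢true (trans (sym e) h))
no-descent-of-guard true false _ _ _ _ = refl

module RemoveLargestStandard (n' : ℕ) (S S′ : List ℕ) (lp′ : Bool) (β : List ℕ) (i : ℕ)
  (same-below : ∀ d → d < n' → elem d S ≡ elem d S′)
  (at-top : if lp′ then (1 ≤ n' × elem n' S ≡ false) else (1 ≤ n' → elem n' S ≡ true)) where
  n : ℕ
  n = suc n'
  Js : List ℕ
  Js = upTo (length β)
  Fs : ℕ → List Tableau
  Fs j = fillings (decAt j β) n'
  ys : List (ℕ × Tableau)
  ys = dependentPairs Js (removableAt β) Fs
  p : Tableau → Bool
  p = isStandardWithDescentsInᵇ n S true i
  q : ℕ × Tableau → Bool
  q (j , U') = (i ≤ᵇ j) ∧ isStandardWithDescentsInᵇ n' S′ lp′ j U'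
  f : Tableau → ℕ × Tableau
  f U = (rowOf n U , dropFromRow (rowOf n U) U)
  g : ℕ × Tableau → Tableau
  g (j , U') = appendToRow j n U'

  descS : ∀ U' → all (λ d → elem d S) (descentSet n' U') ≡ all (λ d → elem d S′) (descentSet n' U')
  descS U' = all-cong _ _ (descentSet n' U') (λ d m → same-below d (∈-descentSet⇒< n' U' m))

  cnt-rep : ∀ U' → content n' U' ≡ replicate n' 1 → ∀ x → 1 ≤ x → x ≤ n' → countIn U' x ≡ 1
  cnt-rep U' e x a b = map≡replicate⇒∈ (countIn U') (oneTo n') 1 (trans e (cong (λ z → replicate z 1) (sym (LP.length-applyUpTo suc n')))) (∈-oneTo⁺ a b)

  fwd : ∀ U → U ∈ fillings β n → p U ≡ true → f U ∈ ys × q (f U) ≡ true × g (f U) ≡ U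
  fwd U mU pU = mem , ∧-intro (≤⇒≤ᵇ (absentAbove⇒≤rowOf n i U na inU)) (∧-intro (∧-intro₃ imm' (≡⇒==ₗ cont') desc'') lc) , gf
    where
    shape = fillings-shape β n mU
    a = proj₂ (∈-fillings⁻ β n mU)
    pos = proj₁ (AllEntries-oneTo⁻ n U a)
    bnd = proj₂ (AllEntries-oneTo⁻ n U a)
    parts = ∧-elim₃ (proj₁ (∧-elim pU))
    im = proj₁ parts
    ct = ==ₗ⇒≡ (proj₁ (proj₂ parts))
    ds = proj₂ (proj₂ parts)
    na = proj₂ (∧-elim {(isImmaculateᵇ U ∧ (content n U ==ₗ replicate n 1)) ∧ all (λ d → elem d S) (descentSet n U)} pU)
    j = rowOf n U
    U' = dropFromRow j U
    ctU : map (countIn U) (oneTo n') ++ [ countIn U n ] ≡ replicate n' 1 ++ [ 1 ]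
    ctU = trans (sym (content-snoc n' U)) (trans ct (replicate-∷ʳ n' 1))
    inU : n ∈ concat U
    inU = count≡suc⇒∈ n (concat U) (proj₂ (LP.∷ʳ-injective _ _ ctU))
    gf : appendToRow j n U' ≡ U
    gf = appendToRow-dropFromRow n U (proj₁ (∧-elim im)) bnd inU
    shU' : map length U' ≡ decAt j β
    shU' = trans (shape-dropFromRow j U) (cong (decAt j) shape)
    jlt : j < length U'
    jlt = subst (j <_) (trans (length-shape shape) (trans (sym (length-decAt j β)) (sym (length-shape shU')))) (rowOf<length n U inU)
    ctA : map (countIn U') (oneTo n') ++ [ suc (countIn U' n) ] ≡ replicate n' 1 ++ [ 1 ]
    ctA = trans (sym (content-append n' j U' jlt)) (trans (cong (content n) gf) (trans ct (replicate-∷ʳ n' 1)))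
    cont' : content n' U' ≡ replicate n' 1
    cont' = proj₁ (LP.∷ʳ-injective _ _ ctA)
    c0 : countIn U' n ≡ 0
    c0 = ℕP.suc-injective (proj₂ (LP.∷ʳ-injective _ _ ctA))
    posU' = AllEntries-dropFromRow j U pos
    bndU' : Bounded n' U'
    bndU' = Bounded-pred n' U' (AllEntries-dropFromRow j U bnd) c0
    imm' = immaculate-dropFromRow j U pos im
    UA = appendToRow j n U'
    ds' : all (λ d → elem d S) (descentSet n UA) ≡ true
    ds' = subst (λ V → all (λ d → elem d S) (descentSet n V) ≡ true) (sym gf) ds
    dsplit : (all (λ d → elem d S) (descentSet n' U') ∧ (if (1 ≤ᵇ n') ∧ descentAtᵇ UA n' then elem n' S else true)) ≡ true
    dsplit = trans (sym (all-descentSet-appendToRow n' j U' (λ d → elem d S))) ds'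
    desc'' : all (λ d → elem d S′) (descentSet n' U') ≡ true
    desc'' = trans (sym (descS U')) (proj₁ (∧-elim dsplit))
    lc : (if lp′ then absentAbove n' j U' else true) ≡ true
    lc = lcf lp′ at-top
     where
     lcf : (b : Bool) → (if b then (1 ≤ n' × elem n' S ≡ false) else (1 ≤ n' → elem n' S ≡ true)) → (if b then absentAbove n' j U' else true) ≡ true
     lcf false _ = refl
     lcf true (pn' , el) = ≤rowOf⇒absentAbove n' j U' (ℕP.≮⇒≥ notlt)
      where
      g2 : (if (1 ≤ᵇ n') ∧ descentAtᵇ UA n' then elem n' S else true) ≡ true
      g2 = proj₂ (∧-elim {all (λ d → elem d S) (descentSet n' U')} dsplit)
      nd : descentAtᵇ UA n' ≡ false
      nd = no-descent-of-guard (1 ≤ᵇ n') (descentAtᵇ UA n') (elem n' S) g2 (≤⇒≤ᵇ pn') el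
      ne' : (n' ≡ᵇ n) ≡ false
      ne' with n' ≡ᵇ n in e3
      ... | true = ⊥-elim (ℕP.<-irrefl (≡ᵇ⇒≡ e3) (ℕP.n<1+n n'))
      ... | false = refl
      notlt : rowOf n' U' < j → ⊥
      notlt lt = false≢true (trans (sym nd) (trans (cong₂ _<ᵇ_ (rowOf-appendToRow-other n' j n U' ne') (cong (rowOf n) gf)) (T⇒≡true (ℕP.<⇒<ᵇ lt))))
    cr : removableAt β j ≡ true
    cr = subst (λ s → removableAt s j ≡ true) shape (removableAt-rowOf 0 n U (immaculate⇒columnAbove0 U pos im) bnd inU)
    mem : f U ∈ ys
    mem = ∈-dependentPairs⁺ Js (removableAt β) Fs (∈-upTo⁺ (subst (j <_) (length-shape shape) (rowOf<length n U inU))) cr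
            (∈-fillings (decAt j β) n' U' shU' (AllEntries-oneTo⁺ n' U' posU' bndU'))

  bwd : ∀ y → y ∈ ys → q y ≡ true → g y ∈ fillings β n × p (g y) ≡ true × f (g y) ≡ y
  bwd (j , U') my qy = memU , ∧-intro (∧-intro₃ imU (≡⇒==ₗ ctU) descU) naU , fg
    where
    mparts = ∈-dependentPairs⁻ Js (removableAt β) Fs my
    mj = proj₁ mparts
    cr = proj₁ (proj₂ mparts)
    mU' = proj₂ (proj₂ mparts)
    sh' = fillings-shape (decAt j β) n' mU'
    a' = proj₂ (∈-fillings⁻ (decAt j β) n' mU')
    pos' = proj₁ (AllEntries-oneTo⁻ n' U' a')
    bnd' = proj₂ (AllEntries-oneTo⁻ n' U' a')
    ij = ≤ᵇ⇒≤ {i} {j} (proj₁ (∧-elim qy))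
    hq = proj₂ (∧-elim {i ≤ᵇ j} qy)
    parts = ∧-elim₃ (proj₁ (∧-elim hq))
    im' = proj₁ parts
    ct' = ==ₗ⇒≡ (proj₁ (proj₂ parts))
    ds′ = proj₂ (proj₂ parts)
    lc′ = proj₂ (∧-elim {(isImmaculateᵇ U' ∧ (content n' U' ==ₗ replicate n' 1)) ∧ all (λ d → elem d S′) (descentSet n' U')} hq)
    U = appendToRow j n U'
    jlt : j < length U'
    jlt = subst (j <_) (trans (sym (length-decAt j β)) (sym (length-shape sh'))) (∈-upTo⁻ mj)
    bndn : Bounded n U'
    bndn = AllEntries-∈⁺ U' (λ x m → ℕP.m≤n⇒m≤1+n (AllEntries-∈⁻ U' bnd' x m))
    memU : U ∈ fillings β n
    memU = ∈-fillings β n U (shape-appendToRow j n U' β cr sh') (AllEntries-oneTo⁺ n U (AllEntries-appendToRow j n U' pos' (s≤s z≤n)) (AllEntries-appendToRow j n U' bndn ℕP.≤-refl))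
    c0 : countIn U' n ≡ 0
    c0 = Bounded⇒count-suc≡0 n' U' bnd'
    ctU : content n U ≡ replicate n 1
    ctU = trans (content-append n' j U' jlt) (trans (cong₂ _++_ ct' (cong (λ z → [ suc z ]) c0)) (sym (replicate-∷ʳ n' 1)))
    imU = immaculate-appendToRow j n U' pos' (s≤s z≤n) im' bndn (bounded⇒allBelow n' n j U' bnd' ℕP.≤-refl) (removableAt⇒emptyRowHasEmptyTail j U' β cr sh')
    naj : absentAbove n j U' ≡ true
    naj = ∉⇒absentAbove n j U' (count≡0⇒∉ n (concat U') c0)
    rown : rowOf n U ≡ j
    rown = rowOf-appendToRow-self j n U' jlt naj
    ne' : (n' ≡ᵇ n) ≡ false
    ne' with n' ≡ᵇ n in e3
    ... | true = ⊥-elim (ℕP.<-irrefl (≡ᵇ⇒≡ e3) (ℕP.n<1+n n'))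
    ... | false = refl
    guard : (b : Bool) → (if b then (1 ≤ n' × elem n' S ≡ false) else (1 ≤ n' → elem n' S ≡ true)) →
            (if b then absentAbove n' j U' else true) ≡ true →
            (if (1 ≤ᵇ n') ∧ descentAtᵇ U n' then elem n' S else true) ≡ true
    guard false h _ with 1 ≤ᵇ n' in e1
    ... | false = refl
    ... | true with descentAtᵇ U n'
    ...   | true = h (≤ᵇ⇒≤ {1} {n'} e1)
    ...   | false = refl
    guard true (pn' , el) nb = subst (λ b → (if (1 ≤ᵇ n') ∧ b then elem n' S else true) ≡ true) (sym nd) (guard-off (1 ≤ᵇ n'))
      where
      guard-off : ∀ a → (if a ∧ false then elem n' S else true) ≡ true
      guard-off true = refl
      guard-off false = refl
      inn : n' ∈ concat U'
      inn = count≡suc⇒∈ n' (concat U') (cnt-rep U' ct' n' pn' ℕP.≤-refl)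
      le : j ≤ rowOf n' U'
      le = absentAbove⇒≤rowOf n' j U' nb inn
      nd : descentAtᵇ U n' ≡ false
      nd = trans (cong₂ _<ᵇ_ (rowOf-appendToRow-other n' j n U' ne') rown) (≤⇒<ᵇ-false (rowOf n' U') j le)
        where
        ≤⇒<ᵇ-false : ∀ a b → b ≤ a → (a <ᵇ b) ≡ false
        ≤⇒<ᵇ-false a b le with a <ᵇ b in e
        ... | true = ⊥-elim (ℕP.<-irrefl refl (ℕP.<-≤-trans (ℕP.<ᵇ⇒< a b (≡true⇒T e)) le))
        ... | false = refl
    descU : all (λ d → elem d S) (descentSet n U) ≡ true
    descU = trans (all-descentSet-appendToRow n' j U' (λ d → elem d S)) (∧-intro (trans (descS U') ds′) (guard lp′ at-top lc′))
    naU : absentAbove n i U ≡ true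
    naU = ≤rowOf⇒absentAbove n i U (subst (i ≤_) (sym rown) ij)
    fg : f U ≡ (j , U')
    fg rewrite rown = cong (j ,_) (dropFromRow-appendToRow j n U')

  uys : Unique ys
  uys = Unique-dependentPairs Js (removableAt β) Fs (Unique.upTo⁺ (length β)) (λ j → Unique-fillings (decAt j β) n')

  #standard-removeLargest : + #standard n S true β i ≡ ∑ Js (λ j → if removableAt β j then (if i ≤ᵇ j then + #standard n' S′ lp′ (decAt j β) j else + 0) else + 0)
  #standard-removeLargest = trans (cong +_ (length-filterᵇ-bijection (fillings β n) ys p q f g (Unique-fillings β n) uys fwd bwd))
        (trans (length-filterᵇ-dependentPairs Js (removableAt β) Fs q)
          (∑-cong′ Js (λ j → count-row j)))
    where
    count-row : ∀ j → (if removableAt β j then + length (filterᵇ (λ T → q (j , T)) (Fs j)) else + 0) ≡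
                (if removableAt β j then (if i ≤ᵇ j then + #standard n' S′ lp′ (decAt j β) j else + 0) else + 0)
    count-row j with removableAt β j
    ... | false = refl
    ... | true = trans (cong +_ (length-filterᵇ-∧ (i ≤ᵇ j) (isStandardWithDescentsInᵇ n' S′ lp′ j) (Fs j))) (+-if (i ≤ᵇ j) _)

-- Standardization

nonzeroParts : List ℕ → List ℕ
nonzeroParts e = filterᵇ (λ x → not (x ≡ᵇ 0)) e

exponentSet : List ℕ → List ℕ
exponentSet e = partialSums (nonzeroParts e)

lastIsPositive : List ℕ → Bool
lastIsPositive [] = false
lastIsPositive (x ∷ []) = not (x ≡ᵇ 0)
lastIsPositive (x ∷ y ∷ r) = lastIsPositive (y ∷ r)

immCount : List ℕ → List ℕ → ℕ → ℕ
immCount β e i = #immaculate (length e) β e i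

stdCount : List ℕ → List ℕ → ℕ → ℕ
stdCount β e i = #standard (sum e) (exponentSet e) (lastIsPositive e) β i

lastIsPositive-∷ʳ : ∀ xs x → lastIsPositive (xs ++ [ x ]) ≡ not (x ≡ᵇ 0)
lastIsPositive-∷ʳ [] x = refl
lastIsPositive-∷ʳ (y ∷ []) x = refl
lastIsPositive-∷ʳ (y ∷ z ∷ xs) x = lastIsPositive-∷ʳ (z ∷ xs) x

sum-∷ʳ : ∀ xs x → sum (xs ++ [ x ]) ≡ sum xs + x
sum-∷ʳ [] x = ℕP.+-identityʳ x
sum-∷ʳ (y ∷ xs) x = trans (cong (_+_ y) (sum-∷ʳ xs x)) (sym (ℕP.+-assoc y (sum xs) x))

nonzeroParts-∷ʳ0 : ∀ xs → nonzeroParts (xs ++ [ 0 ]) ≡ nonzeroParts xs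
nonzeroParts-∷ʳ0 xs = trans (LP.filter-++ (λ x → T? (not (x ≡ᵇ 0))) xs [ 0 ]) (LP.++-identityʳ (nonzeroParts xs))

nonzeroParts-∷ʳsuc : ∀ xs m → nonzeroParts (xs ++ [ suc m ]) ≡ nonzeroParts xs ++ [ suc m ]
nonzeroParts-∷ʳsuc xs m = LP.filter-++ (λ x → T? (not (x ≡ᵇ 0))) xs [ suc m ]

sum-nonzeroParts : ∀ xs → sum (nonzeroParts xs) ≡ sum xs
sum-nonzeroParts [] = refl
sum-nonzeroParts (zero ∷ xs) = sum-nonzeroParts xs
sum-nonzeroParts (suc x ∷ xs) = cong (λ z → suc x + z) (sum-nonzeroParts xs)

partialSums-∷ʳ : ∀ xs x → partialSums (xs ++ [ x ]) ≡ partialSums xs ++ [ sum xs + x ]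
partialSums-∷ʳ [] x = refl
partialSums-∷ʳ (y ∷ xs) x = cong (y ∷_) (trans (cong (map (_+_ y)) (partialSums-∷ʳ xs x))
  (trans (LP.map-++ (_+_ y) (partialSums xs) _) (cong (λ z → map (_+_ y) (partialSums xs) ++ [ z ]) (sym (ℕP.+-assoc y (sum xs) x)))))

partialSums-≤sum : ∀ xs {d} → d ∈ partialSums xs → d ≤ sum xs
partialSums-≤sum (y ∷ xs) (here refl) = ℕP.m≤m+n y (sum xs)
partialSums-≤sum (y ∷ xs) (there m) with MP.∈-map⁻ (_+_ y) m
... | d' , md , refl = ℕP.+-monoʳ-≤ y (partialSums-≤sum xs md)

sum∈partialSums : ∀ xs → xs ≢ [] → sum xs ∈ partialSums xs
sum∈partialSums [] h = ⊥-elim (h refl)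
sum∈partialSums (y ∷ []) h = here (ℕP.+-identityʳ y)
sum∈partialSums (y ∷ z ∷ xs) h = there (MP.∈-map⁺ (_+_ y) (sum∈partialSums (z ∷ xs) (λ ())))

elem-∷ʳ : ∀ d xs z → elem d (xs ++ [ z ]) ≡ (elem d xs ∨ (d ≡ᵇ z))
elem-∷ʳ d xs z = trans (elem-++ d xs [ z ]) (cong (elem d xs ∨_) (∨-identityʳ (d ≡ᵇ z)))

<⇒≡ᵇ-false : ∀ a b → a < b → (a ≡ᵇ b) ≡ false
<⇒≡ᵇ-false a b lt with a ≡ᵇ b in e
... | true = ⊥-elim (ℕP.<-irrefl (≡ᵇ⇒≡ e) lt)
... | false = refl

#immaculate-snoc0 : ∀ N' β e' i → #immaculate (suc N') β (e' ++ [ 0 ]) i ≡ #immaculate N' β e' 0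
#immaculate-snoc0 N' β e' i = length-filterᵇ-bijection (fillings β (suc N')) (fillings β N') p q (λ T → T) (λ T → T)
   (Unique-fillings β (suc N')) (Unique-fillings β N') fwd bwd
  where
  p = isImmaculateOfContentᵇ (suc N') (e' ++ [ 0 ]) i
  q = isImmaculateOfContentᵇ N' e' 0
  fwd : ∀ T → T ∈ fillings β (suc N') → p T ≡ true → T ∈ fillings β N' × q T ≡ true × T ≡ T
  fwd T mT pT = ∈-fillings β N' T (fillings-shape β (suc N') mT) (AllEntries-oneTo⁺ N' T pos (Bounded-pred N' T bnd c0)) ,
                  ∧-intro₃ im (≡⇒==ₗ (proj₁ (LP.∷ʳ-injective _ _ cs))) refl , refl
    where
    a = proj₂ (∈-fillings⁻ β (suc N') mT)
    pos = proj₁ (AllEntries-oneTo⁻ (suc N') T a)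
    bnd = proj₂ (AllEntries-oneTo⁻ (suc N') T a)
    parts = ∧-elim₃ pT
    im = proj₁ parts
    cs : map (countIn T) (oneTo N') ++ [ countIn T (suc N') ] ≡ e' ++ [ 0 ]
    cs = trans (sym (content-snoc N' T)) (==ₗ⇒≡ (proj₁ (proj₂ parts)))
    c0 = proj₂ (LP.∷ʳ-injective _ _ cs)
  bwd : ∀ T → T ∈ fillings β N' → q T ≡ true → T ∈ fillings β (suc N') × p T ≡ true × T ≡ T
  bwd T mT qT = ∈-fillings β (suc N') T (fillings-shape β N' mT) (AllEntries-oneTo⁺ (suc N') T pos (AllEntries-∈⁺ T (λ x m → ℕP.m≤n⇒m≤1+n (AllEntries-∈⁻ T bnd x m)))) ,
                  ∧-intro₃ im (≡⇒==ₗ ct) (∉⇒absentAbove (suc N') i T (count≡0⇒∉ (suc N') (concat T) c0)) , refl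
    where
    a = proj₂ (∈-fillings⁻ β N' mT)
    pos = proj₁ (AllEntries-oneTo⁻ N' T a)
    bnd = proj₂ (AllEntries-oneTo⁻ N' T a)
    parts = ∧-elim₃ qT
    im = proj₁ parts
    c0 = Bounded⇒count-suc≡0 N' T bnd
    ct : content (suc N') T ≡ e' ++ [ 0 ]
    ct = trans (content-snoc N' T) (cong₂ _++_ (==ₗ⇒≡ (proj₁ (proj₂ parts))) (cong [_] c0))

#standard-lastIsPositive-irrelevant : ∀ n S lp β i → #standard n S false β i ≡ #standard n S lp β 0
#standard-lastIsPositive-irrelevant n S false β i = refl
#standard-lastIsPositive-irrelevant n S true β i = refl

exponentSet-snoc-suc : ∀ xs m → exponentSet (xs ++ [ suc m ]) ≡ exponentSet xs ++ [ sum xs + suc m ]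
exponentSet-snoc-suc xs m = trans (cong partialSums (nonzeroParts-∷ʳsuc xs m)) (trans (partialSums-∷ʳ (nonzeroParts xs) (suc m)) (cong (λ z → exponentSet xs ++ [ z + suc m ]) (sum-nonzeroParts xs)))

exponentSet-snoc0 : ∀ xs → exponentSet (xs ++ [ 0 ]) ≡ exponentSet xs
exponentSet-snoc0 xs = cong partialSums (nonzeroParts-∷ʳ0 xs)

elem-exponentSet-> : ∀ xs d → sum xs < d → elem d (exponentSet xs) ≡ false
elem-exponentSet-> xs d lt = ∉⇒elem-false d (exponentSet xs) (λ m → ℕP.<-irrefl refl (ℕP.<-≤-trans lt (subst (d ≤_) (sum-nonzeroParts xs) (partialSums-≤sum (nonzeroParts xs) m))))

elem-exponentSet-top : ∀ xs → 1 ≤ sum xs → elem (sum xs) (exponentSet xs) ≡ true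
elem-exponentSet-top xs h = elem-complete (sum xs) (exponentSet xs) (subst (_∈ exponentSet xs) (sum-nonzeroParts xs) (sum∈partialSums (nonzeroParts xs) ne))
  where
  ne : nonzeroParts xs ≢ []
  ne e = ℕP.<-irrefl refl (ℕP.<-≤-trans h (ℕP.≤-reflexive (trans (sym (sum-nonzeroParts xs)) (cong sum e))))

immCount-snoc-suc : ∀ e' k β i → + #immaculate (length (e' ++ [ suc k ])) β (e' ++ [ suc k ]) i ≡
   ∑ (upTo (length β)) (λ j → if removableAt β j then (if i ≤ᵇ j then + #immaculate (length (e' ++ [ k ])) (decAt j β) (e' ++ [ k ]) j else + 0) else + 0)
immCount-snoc-suc e' k β i rewrite length-∷ʳ e' (suc k) | length-∷ʳ e' k =
  RemoveLargestImmaculate.#immaculate-removeLargest (length e') β e' k i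

exponentSet-snoc-below : ∀ e' k d → d < sum e' + k → elem d (exponentSet (e' ++ [ suc k ])) ≡ elem d (exponentSet (e' ++ [ k ]))
exponentSet-snoc-below e' zero d lt rewrite exponentSet-snoc-suc e' 0 | exponentSet-snoc0 e' | elem-∷ʳ d (exponentSet e') (sum e' + 1)
  | <⇒≡ᵇ-false d (sum e' + 1) (ℕP.<-trans lt (ℕP.+-monoʳ-< (sum e') (s≤s z≤n))) = ∨-identityʳ _
exponentSet-snoc-below e' (suc k) d lt rewrite exponentSet-snoc-suc e' (suc k) | exponentSet-snoc-suc e' k | elem-∷ʳ d (exponentSet e') (sum e' + suc (suc k))
  | elem-∷ʳ d (exponentSet e') (sum e' + suc k)
  | <⇒≡ᵇ-false d (sum e' + suc (suc k)) (ℕP.<-trans lt (ℕP.+-monoʳ-< (sum e') (ℕP.n<1+n (suc k))))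
  | <⇒≡ᵇ-false d (sum e' + suc k) lt = refl

exponentSet-snoc-last : ∀ e' k → if not (k ≡ᵇ 0) then (1 ≤ sum e' + k × elem (sum e' + k) (exponentSet (e' ++ [ suc k ])) ≡ false)
                                     else (1 ≤ sum e' + k → elem (sum e' + k) (exponentSet (e' ++ [ suc k ])) ≡ true)
exponentSet-snoc-last e' zero h rewrite exponentSet-snoc-suc e' 0 | elem-∷ʳ (sum e' + 0) (exponentSet e') (sum e' + 1) | ℕP.+-identityʳ (sum e') | elem-exponentSet-top e' h = refl
exponentSet-snoc-last e' (suc k) = subst (1 ≤_) (sym (ℕP.+-suc (sum e') k)) (s≤s z≤n) , top-absent
  where
  top-absent : elem (sum e' + suc k) (exponentSet (e' ++ [ suc (suc k) ])) ≡ false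
  top-absent rewrite exponentSet-snoc-suc e' (suc k) | elem-∷ʳ (sum e' + suc k) (exponentSet e') (sum e' + suc (suc k))
     | elem-exponentSet-> e' (sum e' + suc k) (ℕP.m<m+n (sum e') (s≤s z≤n))
     | <⇒≡ᵇ-false (sum e' + suc k) (sum e' + suc (suc k)) (ℕP.+-monoʳ-< (sum e') (ℕP.n<1+n (suc k))) = refl

stdCount-snoc-suc : ∀ e' k β i → + #standard (sum (e' ++ [ suc k ])) (exponentSet (e' ++ [ suc k ])) (lastIsPositive (e' ++ [ suc k ])) β i ≡
     ∑ (upTo (length β)) (λ j → if removableAt β j then (if i ≤ᵇ j then + #standard (sum (e' ++ [ k ])) (exponentSet (e' ++ [ k ])) (lastIsPositive (e' ++ [ k ])) (decAt j β) j else + 0) else + 0)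
stdCount-snoc-suc e' k β i rewrite sum-∷ʳ e' (suc k) | sum-∷ʳ e' k | lastIsPositive-∷ʳ e' (suc k) | ℕP.+-suc (sum e') k | lastIsPositive-∷ʳ e' k =
  RemoveLargestStandard.#standard-removeLargest (sum e' + k) (exponentSet (e' ++ [ suc k ])) (exponentSet (e' ++ [ k ])) (not (k ≡ᵇ 0)) β i (exponentSet-snoc-below e' k) (exponentSet-snoc-last e' k)

immCount≡stdCount-snoc : ∀ e' → (∀ β i → immCount β e' i ≡ stdCount β e' i) → ∀ m β i → immCount β (e' ++ [ m ]) i ≡ stdCount β (e' ++ [ m ]) i
immCount≡stdCount-snoc e' h zero β i = trans G0 (trans (h β 0) (sym H0))
  where
  G0 : #immaculate (length (e' ++ [ 0 ])) β (e' ++ [ 0 ]) i ≡ #immaculate (length e') β e' 0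
  G0 rewrite length-∷ʳ e' 0 = #immaculate-snoc0 (length e') β e' i
  H0 : #standard (sum (e' ++ [ 0 ])) (exponentSet (e' ++ [ 0 ])) (lastIsPositive (e' ++ [ 0 ])) β i ≡ #standard (sum e') (exponentSet e') (lastIsPositive e') β 0
  H0 rewrite sum-∷ʳ e' 0 | ℕP.+-identityʳ (sum e') | exponentSet-snoc0 e' | lastIsPositive-∷ʳ e' 0 = #standard-lastIsPositive-irrelevant (sum e') (exponentSet e') (lastIsPositive e') β i
immCount≡stdCount-snoc e' h (suc k) β i = ℤP.+-injective (trans (immCount-snoc-suc e' k β i) (trans (∑-cong′ (upTo (length β)) by-induction) (sym (stdCount-snoc-suc e' k β i))))
  where
  by-induction : ∀ j → (if removableAt β j then (if i ≤ᵇ j then + immCount (decAt j β) (e' ++ [ k ]) j else + 0) else + 0) ≡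
              (if removableAt β j then (if i ≤ᵇ j then + stdCount (decAt j β) (e' ++ [ k ]) j else + 0) else + 0)
  by-induction j rewrite immCount≡stdCount-snoc e' h k (decAt j β) j = refl

immCount≡stdCount-[] : ∀ β i → immCount β [] i ≡ stdCount β [] i
immCount≡stdCount-[] β i = cong length (filterᵇ-cong (fillings β 0) _ _ same-predicate)
  where
  abs : ∀ T → T ∈ fillings β 0 → 0 ∉ concat T
  abs T mT m = ℕP.<-irrefl refl (ℕP.≤-trans (AllEntries-∈⁻ T (proj₁ (AllEntries-oneTo⁻ 0 T a)) 0 m) (AllEntries-∈⁻ T (proj₂ (AllEntries-oneTo⁻ 0 T a)) 0 m))
    where a = proj₂ (∈-fillings⁻ β 0 mT)
  same-predicate : ∀ T → T ∈ fillings β 0 → isImmaculateOfContentᵇ 0 [] i T ≡ isStandardWithDescentsInᵇ 0 [] false i T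
  same-predicate T mT rewrite ∉⇒absentAbove 0 i T (abs T mT) with isImmaculateᵇ T
  ... | true = refl
  ... | false = refl

immCount≡stdCount-reverse : ∀ r β i → immCount β (reverse r) i ≡ stdCount β (reverse r) i
immCount≡stdCount-reverse [] β i = immCount≡stdCount-[] β i
immCount≡stdCount-reverse (x ∷ r) β i = subst (λ e → immCount β e i ≡ stdCount β e i) (sym (LP.unfold-reverse x r)) (immCount≡stdCount-snoc (reverse r) (immCount≡stdCount-reverse r) x β i)

-- Immaculate tableaux of content e and standard immaculate tableaux whose descents lie in
-- the partial-sum set of e satisfy the same recursion in e.
immCount≡stdCount : ∀ e β i → immCount β e i ≡ stdCount β e i
immCount≡stdCount e β i = subst (λ e → immCount β e i ≡ stdCount β e i) (LP.reverse-involutive e) (immCount≡stdCount-reverse (reverse e) β i)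

-- The dual immaculate expansion

nonzeroParts-positive : ∀ e → All (0 <_) (nonzeroParts e)
nonzeroParts-positive [] = []
nonzeroParts-positive (zero ∷ e) = nonzeroParts-positive e
nonzeroParts-positive (suc x ∷ e) = s≤s z≤n ∷ nonzeroParts-positive e

F-coefficient : ∀ γ e → F γ e ≡ ind (refinesᵇ (nonzeroParts e) γ)
F-coefficient γ e =
  trans (∑-filter (λ β → refinesᵇ β γ) (comps (sum γ)) (λ β → M β e))
   (trans (∑-cong′ (comps (sum γ)) swap) fin)
  where
  swap : ∀ β → (if refinesᵇ β γ then M β e else + 0) ≡ (if nonzeroParts e ==ₗ β then ind (refinesᵇ β γ) else + 0)
  swap β with refinesᵇ β γ | nonzeroParts e ==ₗ β
  ... | true | true = refl
  ... | true | false = refl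
  ... | false | true = refl
  ... | false | false = refl
  fin : ∑ (comps (sum γ)) (λ β → if nonzeroParts e ==ₗ β then ind (refinesᵇ β γ) else + 0) ≡ ind (refinesᵇ (nonzeroParts e) γ)
  fin with refinesᵇ (nonzeroParts e) γ in r
  ... | true = trans (∑-select (comps (sum γ)) (nonzeroParts e) (λ β → ind (refinesᵇ β γ)) (Unique-comps (sum γ))
                 (∈-comps⁺ (sum γ) (nonzeroParts-positive e) (≡ᵇ⇒≡ (proj₁ (∧-elim r))))) (cong ind r)
  ... | false = ∑-zero (comps (sum γ)) _ (λ β _ → z β)
    where
    z : ∀ β → (if nonzeroParts e ==ₗ β then ind (refinesᵇ β γ) else + 0) ≡ + 0
    z β with nonzeroParts e ==ₗ β in e1
    ... | false = refl
    ... | true rewrite sym (==ₗ⇒≡ e1) | r = refl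

<ᵇ-shift : ∀ a y s → (a + y <ᵇ a + s) ≡ (y <ᵇ s)
<ᵇ-shift zero y s = refl
<ᵇ-shift (suc a) y s = <ᵇ-shift a y s

filter-map-shift : ∀ a s Y → filterᵇ (λ x → x <ᵇ a + s) (map (_+_ a) Y) ≡ map (_+_ a) (filterᵇ (λ x → x <ᵇ s) Y)
filter-map-shift a s [] = refl
filter-map-shift a s (y ∷ Y) rewrite <ᵇ-shift a y s with y <ᵇ s
... | true = cong (a + y ∷_) (filter-map-shift a s Y)
... | false = filter-map-shift a s Y

filter-<-head : ∀ a s X → 0 < s → filterᵇ (λ x → x <ᵇ a + s) (a ∷ X) ≡ a ∷ filterᵇ (λ x → x <ᵇ a + s) X
filter-<-head a s X sp rewrite <⇒<ᵇ (ℕP.m<m+n a sp) = refl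

partialSums≡setOf∷ʳsum : ∀ γ → All (0 <_) γ → γ ≢ [] → partialSums γ ≡ setOf γ ++ [ sum γ ]
partialSums≡setOf∷ʳsum [] _ ne = ⊥-elim (ne refl)
partialSums≡setOf∷ʳsum (a ∷ []) _ _ rewrite ℕP.+-identityʳ a | <ᵇ-irrefl a = refl
partialSums≡setOf∷ʳsum (a ∷ b ∷ r) (pa ∷ pb ∷ pr) _ =
  sym (trans (cong (_++ [ a + (b + sum r) ]) (filter-<-head a (b + sum r) _ (ℕP.<-≤-trans pb (ℕP.m≤m+n b (sum r)))))
        (cong (a ∷_) (trans (cong (_++ [ a + (b + sum r) ]) (filter-map-shift a (b + sum r) (partialSums (b ∷ r))))
          (trans (sym (LP.map-++ (_+_ a) (setOf (b ∷ r)) [ b + sum r ]))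
            (cong (map (_+_ a)) (sym (partialSums≡setOf∷ʳsum (b ∷ r) (pb ∷ pr) (λ ()))))))))

map-+-injective : ∀ a (xs ys : List ℕ) → map (_+_ a) xs ≡ map (_+_ a) ys → xs ≡ ys
map-+-injective a [] [] e = refl
map-+-injective a (x ∷ xs) (y ∷ ys) e with LP.∷-injective e
... | e1 , e2 = cong₂ _∷_ (ℕP.+-cancelˡ-≡ a x y e1) (map-+-injective a xs ys e2)
map-+-injective a [] (y ∷ ys) ()
map-+-injective a (x ∷ xs) [] ()

partialSums-injective : ∀ γ δ → partialSums γ ≡ partialSums δ → γ ≡ δ
partialSums-injective [] [] e = refl
partialSums-injective (a ∷ γ) (b ∷ δ) e with LP.∷-injective e
... | refl , e2 = cong (a ∷_) (partialSums-injective γ δ (map-+-injective a _ _ e2))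
partialSums-injective [] (b ∷ δ) ()
partialSums-injective (a ∷ γ) [] ()

comp-of-0 : ∀ {γ} → All (0 <_) γ → sum γ ≡ 0 → γ ≡ []
comp-of-0 [] e = refl
comp-of-0 {suc a ∷ γ} (p ∷ ps) ()

setOf-injective : ∀ n γ δ → γ ∈ comps n → δ ∈ comps n → setOf γ ≡ setOf δ → γ ≡ δ
setOf-injective zero γ δ mγ mδ e = trans (comp-of-0 (proj₁ (∈-comps⁻ 0 mγ)) (proj₂ (∈-comps⁻ 0 mγ))) (sym (comp-of-0 (proj₁ (∈-comps⁻ 0 mδ)) (proj₂ (∈-comps⁻ 0 mδ))))
setOf-injective (suc n) γ δ mγ mδ e =
  partialSums-injective γ δ (trans (partialSums≡setOf∷ʳsum γ pγ neγ) (trans (cong₂ (λ a b → a ++ [ b ]) e (trans sγ (sym sδ))) (sym (partialSums≡setOf∷ʳsum δ pδ neδ))))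
  where
  pγ = proj₁ (∈-comps⁻ (suc n) mγ)
  sγ = proj₂ (∈-comps⁻ (suc n) mγ)
  pδ = proj₁ (∈-comps⁻ (suc n) mδ)
  sδ = proj₂ (∈-comps⁻ (suc n) mδ)
  z≢s : 0 ≡ suc n → ⊥
  z≢s ()
  neγ : γ ≢ []
  neγ refl = z≢s sγ
  neδ : δ ≢ []
  neδ refl = z≢s sδ

compOfSet : ℕ → List ℕ → ℕ → List ℕ
compOfSet s [] n = [ n ∸ s ]
compOfSet s (d ∷ D) n = (d ∸ s) ∷ compOfSet d D n

StrictlyIncreasingFrom : ℕ → List ℕ → ℕ → Set
StrictlyIncreasingFrom s [] n = s < n
StrictlyIncreasingFrom s (d ∷ D) n = s < d × StrictlyIncreasingFrom d D n

StrictlyIncreasingFrom-all : ∀ s D n → StrictlyIncreasingFrom s D n → ∀ x → x ∈ D ++ [ n ] → s < x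
StrictlyIncreasingFrom-all s [] n h x (here refl) = h
StrictlyIncreasingFrom-all s (d ∷ D) n (h1 , h2) x (here refl) = h1
StrictlyIncreasingFrom-all s (d ∷ D) n (h1 , h2) x (there m) = ℕP.<-trans h1 (StrictlyIncreasingFrom-all d D n h2 x m)

gaps-pos : ∀ s D n → StrictlyIncreasingFrom s D n → All (0 <_) (compOfSet s D n)
gaps-pos s [] n h = ℕP.m<n⇒0<n∸m h ∷ []
gaps-pos s (d ∷ D) n (h1 , h2) = ℕP.m<n⇒0<n∸m h1 ∷ gaps-pos d D n h2

gaps-ps : ∀ s D n → StrictlyIncreasingFrom s D n → partialSums (compOfSet s D n) ≡ map (_∸ s) (D ++ [ n ])
gaps-ps s [] n h = refl
gaps-ps s (d ∷ D) n (h1 , h2) = cong ((d ∸ s) ∷_)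
  (trans (cong (map (_+_ (d ∸ s))) (gaps-ps d D n h2))
   (trans (sym (LP.map-∘ (D ++ [ n ])))
    (map-cong-in' (D ++ [ n ]) (λ x m → ∸-split x (ℕP.<⇒≤ (StrictlyIncreasingFrom-all d D n h2 x m)))))) 
  where
  ∸-split : ∀ x → d ≤ x → (d ∸ s) + (x ∸ d) ≡ x ∸ s
  ∸-split x le = trans (sym (ℕP.+-∸-comm (x ∸ d) (ℕP.<⇒≤ h1))) (trans (cong (_∸ s) (ℕP.m+[n∸m]≡n le)) refl)
  map-cong-in' : ∀ xs → (∀ x → x ∈ xs → (d ∸ s) + (x ∸ d) ≡ x ∸ s) → map (λ x → (d ∸ s) + (x ∸ d)) xs ≡ map (_∸ s) xs
  map-cong-in' [] h = refl
  map-cong-in' (x ∷ xs) h = cong₂ _∷_ (h x (here refl)) (map-cong-in' xs (λ y m → h y (there m)))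

gaps-sum : ∀ s D n → StrictlyIncreasingFrom s D n → sum (compOfSet s D n) ≡ n ∸ s
gaps-sum s [] n h = ℕP.+-identityʳ (n ∸ s)
gaps-sum s (d ∷ D) n (h1 , h2) =
  trans (cong (_+_ (d ∸ s)) (gaps-sum d D n h2))
   (trans (sym (ℕP.+-∸-comm (n ∸ d) (ℕP.<⇒≤ h1))) (cong (_∸ s) (ℕP.m+[n∸m]≡n (ℕP.<⇒≤ (StrictlyIncreasingFrom-all d D n h2 n (MP.∈-++⁺ʳ D (here refl)))))))

StrictlyIncreasingFrom-bound : ∀ s D n → StrictlyIncreasingFrom s D n → ∀ x → x ∈ D → x < n
StrictlyIncreasingFrom-bound s (d ∷ D) n (h1 , h2) x (here refl) = StrictlyIncreasingFrom-all d D n h2 n (MP.∈-++⁺ʳ D (here refl))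
StrictlyIncreasingFrom-bound s (d ∷ D) n (h1 , h2) x (there m) = StrictlyIncreasingFrom-bound d D n h2 x m

setOf-gaps : ∀ D n → StrictlyIncreasingFrom 0 D n → setOf (compOfSet 0 D n) ≡ D
setOf-gaps D n h rewrite gaps-sum 0 D n h | gaps-ps 0 D n h | LP.map-id (D ++ [ n ]) | LP.filter-++ (λ x → T? (x <ᵇ n)) D [ n ] | <ᵇ-irrefl n
  = trans (LP.++-identityʳ _) (LP.filter-all (λ x → T? (x <ᵇ n)) (All.tabulate (λ m → ℕP.<⇒<ᵇ (StrictlyIncreasingFrom-bound 0 D n h _ m))))

comp-with-setOf : ∀ n D → StrictlyIncreasingFrom 0 D n → Σ[ γ ∈ List ℕ ] γ ∈ comps n × setOf γ ≡ D
comp-with-setOf n D h = compOfSet 0 D n , ∈-comps⁺ n (gaps-pos 0 D n h) (gaps-sum 0 D n h) , setOf-gaps D n h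

applyUpTo-cong : ∀ (f g : ℕ → ℕ) n → (∀ k → f k ≡ g k) → applyUpTo f n ≡ applyUpTo g n
applyUpTo-cong f g zero h = refl
applyUpTo-cong f g (suc n) h = cong₂ _∷_ (h 0) (applyUpTo-cong (λ k → f (suc k)) (λ k → g (suc k)) n (λ k → h (suc k)))

applyUpTo-+-suc : ∀ t m → applyUpTo (λ k → t + suc k) m ≡ applyUpTo (λ k → suc t + k) m
applyUpTo-+-suc t m = applyUpTo-cong _ _ m (λ k → ℕP.+-suc t k)

StrictlyIncreasingFrom-filter : ∀ (p : ℕ → Bool) s t m n → s < t → t + m ≤ n → StrictlyIncreasingFrom s (filterᵇ p (applyUpTo (λ k → t + k) m)) n
StrictlyIncreasingFrom-filter p s t zero n st le = ℕP.<-≤-trans st (subst (_≤ n) (ℕP.+-identityʳ t) le)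
StrictlyIncreasingFrom-filter p s t (suc m) n st le rewrite applyUpTo-+-suc t m with p (t + 0)
... | true = subst (s <_) (sym (ℕP.+-identityʳ t)) st ,
             StrictlyIncreasingFrom-filter p (t + 0) (suc t) m n (subst (_< suc t) (sym (ℕP.+-identityʳ t)) ℕP.≤-refl) (subst (_≤ n) (ℕP.+-suc t m) le)
... | false = StrictlyIncreasingFrom-filter p s (suc t) m n (ℕP.<-trans st (ℕP.n<1+n t)) (subst (_≤ n) (ℕP.+-suc t m) le)

descentSet-increasing : ∀ n' U → StrictlyIncreasingFrom 0 (descentSet (suc n') U) (suc n')
descentSet-increasing n' U = StrictlyIncreasingFrom-filter (descentAtᵇ U) 0 1 n' (suc n') (s≤s z≤n) ℕP.≤-refl

refinesᵇ-setOf : ∀ n γ f → γ ∈ comps n → sum f ≡ n → refinesᵇ f γ ≡ all (λ d → elem d (partialSums f)) (setOf γ)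
refinesᵇ-setOf zero γ f mγ sf rewrite comp-of-0 (proj₁ (∈-comps⁻ 0 mγ)) (proj₂ (∈-comps⁻ 0 mγ)) | sf = refl
refinesᵇ-setOf (suc n') γ f mγ sf =
  trans (cong₂ (λ a b → a ∧ all (λ s → elem s (partialSums f)) b) (trans (cong₂ _≡ᵇ_ sf sγ) (≡ᵇ-refl (suc n'))) (partialSums≡setOf∷ʳsum γ pγ neγ))
   (trans (all-++ _ (setOf γ) [ sum γ ])
    (trans (cong (λ b → all (λ d → elem d (partialSums f)) (setOf γ) ∧ (b ∧ true)) top)
      (∧-identityʳ _)))
  where
  pγ = proj₁ (∈-comps⁻ (suc n') mγ)
  sγ = proj₂ (∈-comps⁻ (suc n') mγ)
  z≢s : 0 ≡ suc n' → ⊥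
  z≢s ()
  neγ : γ ≢ []
  neγ refl = z≢s sγ
  nef : f ≢ []
  nef refl = z≢s sf
  top : elem (sum γ) (partialSums f) ≡ true
  top = elem-complete (sum γ) (partialSums f) (subst (_∈ partialSums f) (trans sf (sym sγ)) (sum∈partialSums f nef))

count-cons : ∀ i x xs → count i (x ∷ xs) ≡ (if i ≡ᵇ x then 1 else 0) + count i xs
count-cons i x xs with i ≡ᵇ x
... | true = refl
... | false = refl

sum-map-+ : ∀ (f g : ℕ → ℕ) xs → sum (map (λ i → f i + g i) xs) ≡ sum (map f xs) + sum (map g xs)
sum-map-+ f g [] = refl
sum-map-+ f g (x ∷ xs) rewrite sum-map-+ f g xs = +-interchange (f x) (g x) _ _

sum-indicator-∉ : ∀ x xs → x ∉ xs → sum (map (λ i → if i ≡ᵇ x then 1 else 0) xs) ≡ 0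
sum-indicator-∉ x [] h = refl
sum-indicator-∉ x (y ∷ xs) h with y ≡ᵇ x in e
... | true = ⊥-elim (h (here (sym (≡ᵇ⇒≡ e))))
... | false = sum-indicator-∉ x xs (λ m → h (there m))

sum-indicator-∈ : ∀ x xs → Unique xs → x ∈ xs → sum (map (λ i → if i ≡ᵇ x then 1 else 0) xs) ≡ 1
sum-indicator-∈ x (y ∷ xs) (ny ∷ u) (here refl) rewrite ≡ᵇ-refl x = cong suc (sum-indicator-∉ x xs (∉-head ny))
sum-indicator-∈ x (y ∷ xs) (ny ∷ u) (there m) with y ≡ᵇ x in e
... | true = ⊥-elim ((∉-head ny) (subst (_∈ xs) (sym (≡ᵇ⇒≡ e)) m))
... | false = sum-indicator-∈ x xs u m

sum-counts : ∀ N xs → All (_∈ oneTo N) xs → sum (map (λ i → count i xs) (oneTo N)) ≡ length xs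
sum-counts N [] a = sum0 (oneTo N)
  where sum0 : ∀ l → sum (map (λ i → count i []) l) ≡ 0
        sum0 [] = refl
        sum0 (x ∷ l) = sum0 l
sum-counts N (x ∷ xs) (mx ∷ a) =
  trans (cong sum (map-cong-in' (oneTo N)))
   (trans (sum-map-+ (λ i → if i ≡ᵇ x then 1 else 0) (λ i → count i xs) (oneTo N))
     (cong₂ _+_ (sum-indicator-∈ x (oneTo N) (Unique-oneTo N) mx) (sum-counts N xs a)))
  where
  map-cong-in' : ∀ l → map (λ i → count i (x ∷ xs)) l ≡ map (λ i → (if i ≡ᵇ x then 1 else 0) + count i xs) l
  map-cong-in' [] = refl
  map-cong-in' (i ∷ l) = cong₂ _∷_ (count-cons i x xs) (map-cong-in' l)

length-concat : ∀ (T : Tableau) → length (concat T) ≡ sum (map length T)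
length-concat [] = refl
length-concat (r ∷ T) = trans (LP.length-++ r) (cong (λ z → length r + z) (length-concat T))

sum-content : ∀ β N T → T ∈ fillings β N → sum (content N T) ≡ sum β
sum-content β N T m = trans (sum-counts N (concat T) (AllP.concat⁺ (proj₂ (∈-fillings⁻ β N m))))
                        (trans (length-concat T) (cong sum (fillings-shape β N m)))

sum-replicate-1 : ∀ N → sum (replicate N 1) ≡ N
sum-replicate-1 zero = refl
sum-replicate-1 (suc N) = cong suc (sum-replicate-1 N)

filter-none : ∀ {A : Set} (p : A → Bool) xs → (∀ x → x ∈ xs → p x ≡ false) → length (filterᵇ p xs) ≡ 0
filter-none p [] h = refl
filter-none p (x ∷ xs) h rewrite h x (here refl) = filter-none p xs (λ y m → h y (there m))

descentComposition : ∀ n U → Σ[ γ ∈ List ℕ ] γ ∈ comps n × setOf γ ≡ descentSet n U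
descentComposition zero U = [] , here refl , refl
descentComposition (suc n') U = comp-with-setOf (suc n') (descentSet (suc n') U) (descentSet-increasing n' U)

descentComposition-refines : ∀ n U e → sum e ≡ n → ∑ (comps n) (λ γ → ind (descentSet n U ==ₗ setOf γ) * ind (refinesᵇ (nonzeroParts e) γ))
                              ≡ ind (all (λ d → elem d (exponentSet e)) (descentSet n U))
descentComposition-refines n U e se =
  trans (∑-cong (comps n) (λ γ mγ → trans (cong (λ b → ind b * ind (refinesᵇ (nonzeroParts e) γ)) (sw γ mγ)) (ind-* (γU ==ₗ γ) _)))
   (trans (∑-select (comps n) γU (λ γ → ind (refinesᵇ (nonzeroParts e) γ)) (Unique-comps n) mU)
     (cong ind (trans (refinesᵇ-setOf n γU (nonzeroParts e) mU (trans (sum-nonzeroParts e) se)) (cong (all (λ d → elem d (exponentSet e))) eU))))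
  where
  ex = descentComposition n U
  γU = proj₁ ex
  mU = proj₁ (proj₂ ex)
  eU = proj₂ (proj₂ ex)
  sw : ∀ γ → γ ∈ comps n → (descentSet n U ==ₗ setOf γ) ≡ (γU ==ₗ γ)
  sw γ mγ with γU ==ₗ γ in e1
  ... | true rewrite sym (==ₗ⇒≡ e1) = trans (cong (_==ₗ setOf γU) (sym eU)) (==ₗ-refl (setOf γU))
  ... | false with descentSet n U ==ₗ setOf γ in e2
  ...   | false = refl
  ...   | true = ⊥-elim (false≢true (trans (sym e1) (trans (cong (γU ==ₗ_) (sym (setOf-injective n γU γ mU mγ (trans eU (==ₗ⇒≡ e2))))) (==ₗ-refl γU))))

dualImm≡#immaculate : ∀ β e → dualImm β e ≡ + immCount β e 0
dualImm≡#immaculate β e = cong (λ l → + length l) (filterᵇ-cong (fillings β (length e)) _ _ (λ T _ → sym (∧-identityʳ _)))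

ind-isStandardWithDescentsIn : ∀ n S lp U → ind (isStandardWithDescentsInᵇ n S lp 0 U) ≡ (if isImmaculateᵇ U ∧ (content n U ==ₗ replicate n 1) then ind (all (λ d → elem d S) (descentSet n U)) else + 0)
ind-isStandardWithDescentsIn n S lp U with isImmaculateᵇ U ∧ (content n U ==ₗ replicate n 1) | all (λ d → elem d S) (descentSet n U) | lp
... | true | true | true = refl
... | true | true | false = refl
... | true | false | true = refl
... | true | false | false = refl
... | false | _ | true = refl
... | false | _ | false = refl

dualImm-expansion-sum : ∀ β → let n = sum β in β ∈ comps n → ∀ e → dualImm β e ≡ ∑ (comps n) (λ γ → + L β γ * F γ e)
dualImm-expansion-sum β mβ e with sum e ≟ sum β
... | yes se = trans (dualImm≡#immaculate β e) (trans (cong +_ (immCount≡stdCount e β 0)) (trans lhs (sym rhs)))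
  where
  n = sum β
  A' : Tableau → Bool
  A' U = isImmaculateᵇ U ∧ (content n U ==ₗ replicate n 1)
  DS : Tableau → ℤ
  DS U = ind (all (λ d → elem d (exponentSet e)) (descentSet n U))
  lhs : + stdCount β e 0 ≡ ∑ (fillings β n) (λ U → if A' U then DS U else + 0)
  lhs rewrite se = trans (length-filterᵇ _ (fillings β n)) (∑-cong′ (fillings β n) (ind-isStandardWithDescentsIn n (exponentSet e) (lastIsPositive e)))
  rhs : ∑ (comps n) (λ γ → + L β γ * F γ e) ≡ ∑ (fillings β n) (λ U → if A' U then DS U else + 0)
  rhs =
    trans (∑-cong′ (comps n) (λ γ → cong₂ _*_ (length-filterᵇ _ (standard β)) (F-coefficient γ e)))
    (trans (∑-cong′ (comps n) (λ γ → sym (∑-*ʳ (standard β) (ind (refinesᵇ (nonzeroParts e) γ)) _)))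
    (trans (∑-swap (comps n) (standard β) _)
    (trans (∑-cong′ (standard β) (λ U → descentComposition-refines n U e se))
    (∑-filter A' (fillings β n) DS))))
... | no ne = trans (dualImm≡#immaculate β e) (trans (cong +_ (immCount≡stdCount e β 0)) (trans lhs0 (sym rhs0)))
  where
  n = sum β
  sβ : sum β ≡ n
  sβ = refl
  lhs0 : + stdCount β e 0 ≡ + 0
  lhs0 = cong +_ (filter-none _ (fillings β (sum e)) (λ U mU → hf U mU))
    where
    hf : ∀ U → U ∈ fillings β (sum e) → isStandardWithDescentsInᵇ (sum e) (exponentSet e) (lastIsPositive e) 0 U ≡ false
    hf U mU with isStandardWithDescentsInᵇ (sum e) (exponentSet e) (lastIsPositive e) 0 U in h
    ... | false = refl
    ... | true = ⊥-elim (ne (trans (sym (sum-replicate-1 (sum e))) (trans (cong sum (sym (==ₗ⇒≡ c3))) (trans (sum-content β (sum e) U mU) sβ))))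
      where
      c1 = proj₁ (∧-elim {(isImmaculateᵇ U ∧ (content (sum e) U ==ₗ replicate (sum e) 1)) ∧ all (λ d → elem d (exponentSet e)) (descentSet (sum e) U)} h)
      c2 = proj₁ (∧-elim {isImmaculateᵇ U ∧ (content (sum e) U ==ₗ replicate (sum e) 1)} c1)
      c3 = proj₂ (∧-elim {isImmaculateᵇ U} c2)
  rhs0 : ∑ (comps n) (λ γ → + L β γ * F γ e) ≡ + 0
  rhs0 = ∑-zero (comps n) _ (λ γ mγ → trans (cong (+ L β γ *_) (trans (F-coefficient γ e) (cong ind (rf γ mγ)))) (ℤP.*-zeroʳ (+ L β γ)))
    where
    rf : ∀ γ → γ ∈ comps n → refinesᵇ (nonzeroParts e) γ ≡ false
    rf γ mγ with sum (nonzeroParts e) ≡ᵇ sum γ in h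
    ... | false = refl
    ... | true = ⊥-elim (ne (trans (sym (sum-nonzeroParts e)) (trans (≡ᵇ⇒≡ h) (proj₂ (∈-comps⁻ n mγ)))))

dualImm-expansion : ∀ n β → β ∈ comps n → ∀ e → dualImm β e ≡ ∑ (comps n) (λ γ → + L β γ * F γ e)
dualImm-expansion n β mβ e = subst (λ m → dualImm β e ≡ ∑ (comps m) (λ γ → + L β γ * F γ e)) sβ
                (dualImm-expansion-sum β (subst (λ m → β ∈ comps m) (sym sβ) mβ) e)
  where sβ = proj₂ (∈-comps⁻ n mβ)

-- Triangularity

lexᵇ : List ℕ → List ℕ → Bool
lexᵇ [] [] = false
lexᵇ [] (_ ∷ _) = true
lexᵇ (_ ∷ _) [] = false
lexᵇ (x ∷ xs) (y ∷ ys) = (x <ᵇ y) ∨ ((x ≡ᵇ y) ∧ lexᵇ xs ys)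

lexᵇ-irrefl : ∀ xs → lexᵇ xs xs ≡ false
lexᵇ-irrefl [] = refl
lexᵇ-irrefl (x ∷ xs) rewrite <ᵇ-irrefl x | ≡ᵇ-refl x = lexᵇ-irrefl xs

lexᵇ-trans : ∀ a b c → lexᵇ a b ≡ true → lexᵇ b c ≡ true → lexᵇ a c ≡ true
lexᵇ-trans [] (y ∷ b) (z ∷ c) h1 h2 = refl
lexᵇ-trans (x ∷ a) (y ∷ b) (z ∷ c) h1 h2 with ∨-elim {x <ᵇ y} h1 | ∨-elim {y <ᵇ z} h2
... | inj₁ p | inj₁ q = ∨-introˡ ((x ≡ᵇ z) ∧ lexᵇ a c) (<⇒<ᵇ (ℕP.<-trans (<ᵇ⇒< {x} {y} p) (<ᵇ⇒< {y} {z} q)))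
... | inj₁ p | inj₂ q = ∨-introˡ ((x ≡ᵇ z) ∧ lexᵇ a c) (<⇒<ᵇ (subst (x <_) (≡ᵇ⇒≡ {y} {z} (proj₁ (∧-elim {y ≡ᵇ z} q))) (<ᵇ⇒< {x} {y} p)))
... | inj₂ p | inj₁ q = ∨-introˡ ((x ≡ᵇ z) ∧ lexᵇ a c) (<⇒<ᵇ (subst (_< z) (sym (≡ᵇ⇒≡ {x} {y} (proj₁ (∧-elim {x ≡ᵇ y} p)))) (<ᵇ⇒< {y} {z} q)))
... | inj₂ p | inj₂ q = ∨-introʳ (x <ᵇ z) (∧-intro (subst (λ w → (x ≡ᵇ w) ≡ true) (≡ᵇ⇒≡ {y} {z} (proj₁ (∧-elim {y ≡ᵇ z} q))) (proj₁ (∧-elim {x ≡ᵇ y} p)))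
                                (lexᵇ-trans a b c (proj₂ (∧-elim {x ≡ᵇ y} p)) (proj₂ (∧-elim {y ≡ᵇ z} q))))
lexᵇ-trans [] [] c () h2
lexᵇ-trans (x ∷ a) [] c () h2
lexᵇ-trans a (y ∷ b) [] h1 ()

shiftEntries : Tableau → Tableau
shiftEntries T = map (map suc) T

≤ᵇ-suc : ∀ x y → (suc x ≤ᵇ suc y) ≡ (x ≤ᵇ y)
≤ᵇ-suc zero y = refl
≤ᵇ-suc (suc x) y = refl

weakInc-shift : ∀ r → weakIncᵇ (map suc r) ≡ weakIncᵇ r
weakInc-shift [] = refl
weakInc-shift (x ∷ []) = refl
weakInc-shift (x ∷ y ∷ r) = cong₂ _∧_ (≤ᵇ-suc x y) (weakInc-shift (y ∷ r))

strictInc-shift : ∀ r → strictIncᵇ (map suc r) ≡ strictIncᵇ r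
strictInc-shift [] = refl
strictInc-shift (x ∷ []) = refl
strictInc-shift (x ∷ y ∷ r) = cong ((x <ᵇ y) ∧_) (strictInc-shift (y ∷ r))

firstCol-shift : ∀ T → firstCol (shiftEntries T) ≡ map suc (firstCol T)
firstCol-shift [] = refl
firstCol-shift ([] ∷ T) = firstCol-shift T
firstCol-shift ((x ∷ r) ∷ T) = cong (suc x ∷_) (firstCol-shift T)

rowsWeakInc-shift : ∀ T → all weakIncᵇ (shiftEntries T) ≡ all weakIncᵇ T
rowsWeakInc-shift [] = refl
rowsWeakInc-shift (r ∷ T) = cong₂ _∧_ (weakInc-shift r) (rowsWeakInc-shift T)

immaculate-shift : ∀ T → isImmaculateᵇ (shiftEntries T) ≡ isImmaculateᵇ T
immaculate-shift T = cong₂ _∧_ (rowsWeakInc-shift T) (trans (cong strictIncᵇ (firstCol-shift T)) (strictInc-shift (firstCol T)))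

concat-shift : ∀ T → concat (shiftEntries T) ≡ map suc (concat T)
concat-shift [] = refl
concat-shift (r ∷ T) = trans (cong (map suc r ++_) (concat-shift T)) (sym (LP.map-++ suc r (concat T)))

count-suc-map : ∀ i xs → count (suc i) (map suc xs) ≡ count i xs
count-suc-map i [] = refl
count-suc-map i (x ∷ xs) with i ≡ᵇ x
... | true = cong suc (count-suc-map i xs)
... | false = count-suc-map i xs

count-1-map-suc : ∀ xs → All (1 ≤_) xs → count 1 (map suc xs) ≡ 0
count-1-map-suc [] _ = refl
count-1-map-suc (suc x ∷ xs) (_ ∷ a) = count-1-map-suc xs a

count-replicate-1 : ∀ i b → 2 ≤ i → count i (replicate b 1) ≡ 0
count-replicate-1 i zero _ = refl
count-replicate-1 (suc (suc i)) (suc b) le = count-replicate-1 (suc (suc i)) b le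
count-replicate-1 (suc zero) (suc b) (s≤s ())

count-1-replicate : ∀ b → count 1 (replicate b 1) ≡ b
count-1-replicate zero = refl
count-1-replicate (suc b) = cong suc (count-1-replicate b)

oneTo-suc : ∀ N → oneTo (suc N) ≡ 1 ∷ map suc (oneTo N)
oneTo-suc N = cong (1 ∷_) (sym (LP.map-applyUpTo suc suc N))

content-top : ∀ N b T → Positive T → content (suc N) (replicate b 1 ∷ shiftEntries T) ≡ b ∷ content N T
content-top N b T pT = trans (cong (map (countIn X)) (oneTo-suc N)) (cong₂ _∷_ c1 (trans (sym (LP.map-∘ (oneTo N))) (map-cong-∈ _ _ (oneTo N) crest)))
  where
  X = replicate b 1 ∷ shiftEntries T
  c1 : countIn X 1 ≡ b
  c1 = trans (count-++ 1 (replicate b 1) (concat (shiftEntries T)))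
        (trans (cong₂ _+_ (count-1-replicate b) (trans (cong (count 1) (concat-shift T)) (count-1-map-suc (concat T) (All-c T pT)))) (ℕP.+-identityʳ b))
    where
    All-c : ∀ T → Positive T → All (1 ≤_) (concat T)
    All-c [] [] = []
    All-c (r ∷ T) (a ∷ as) = go r a
      where
      go : ∀ r → All (1 ≤_) r → All (1 ≤_) (r ++ concat T)
      go [] [] = All-c T as
      go (x ∷ r) (p ∷ ps) = p ∷ go r ps
  crest : ∀ i → i ∈ oneTo N → countIn X (suc i) ≡ countIn T i
  crest i m = trans (count-++ (suc i) (replicate b 1) (concat (shiftEntries T)))
               (trans (cong₂ _+_ (count-replicate-1 (suc i) b (s≤s (proj₁ (∈-oneTo⁻ m)))) (trans (cong (count (suc i)) (concat-shift T)) (count-suc-map i (concat T)))) refl)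

superstandard : List ℕ → Tableau
superstandard [] = []
superstandard (b ∷ β) = replicate b 1 ∷ shiftEntries (superstandard β)

shape-shift : ∀ T → map length (shiftEntries T) ≡ map length T
shape-shift [] = refl
shape-shift (r ∷ T) = cong₂ _∷_ (LP.length-map suc r) (shape-shift T)

superstandard-shape : ∀ β → map length (superstandard β) ≡ β
superstandard-shape [] = refl
superstandard-shape (b ∷ β) = cong₂ _∷_ (LP.length-replicate b {1}) (trans (shape-shift (superstandard β)) (superstandard-shape β))

AllEntries-shift : ∀ {Q Q' : ℕ → Set} T → (∀ x → Q x → Q' (suc x)) → AllEntries Q T → AllEntries Q' (shiftEntries T)
AllEntries-shift [] h [] = []
AllEntries-shift (r ∷ T) h (a ∷ as) = go r a ∷ AllEntries-shift T h as
  where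
  go : ∀ r → All _ r → All _ (map suc r)
  go [] [] = []
  go (x ∷ r) (p ∷ ps) = h x p ∷ go r ps

superstandard-positive : ∀ β → Positive (superstandard β)
superstandard-positive [] = []
superstandard-positive (b ∷ β) = AllP.replicate⁺ b (s≤s z≤n) ∷ AllEntries-shift (superstandard β) (λ x p → ℕP.m≤n⇒m≤1+n p) (superstandard-positive β)

superstandard-bounded : ∀ β → Bounded (length β) (superstandard β)
superstandard-bounded [] = []
superstandard-bounded (b ∷ β) = AllP.replicate⁺ b (s≤s z≤n) ∷ AllEntries-shift (superstandard β) (λ x p → s≤s p) (superstandard-bounded β)

weakInc-replicate : ∀ b → weakIncᵇ (replicate b 1) ≡ true
weakInc-replicate zero = refl
weakInc-replicate (suc zero) = refl
weakInc-replicate (suc (suc b)) = weakInc-replicate (suc b)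

superstandard-immaculate : ∀ β → All (0 <_) β → isImmaculateᵇ (superstandard β) ≡ true
superstandard-immaculate [] _ = refl
superstandard-immaculate (suc b ∷ β) (_ ∷ pβ) =
  ∧-intro (∧-intro (weakInc-replicate (suc b)) (trans (rowsWeakInc-shift (superstandard β)) (proj₁ (∧-elim ih))))
    (trans (cong (λ l → strictIncᵇ (1 ∷ l)) (firstCol-shift (superstandard β))) (trans (strictInc-shift (0 ∷ firstCol (superstandard β)))
       (trans (sym (strictInc-firstCol≡columnAbove0 (superstandard β) (superstandard-positive β))) (proj₂ (∧-elim {all weakIncᵇ (superstandard β)} ih)))))
  where ih = superstandard-immaculate β pβ

superstandard-content : ∀ β → content (length β) (superstandard β) ≡ β
superstandard-content [] = refl
superstandard-content (b ∷ β) = trans (content-top (length β) b (superstandard β) (superstandard-positive β)) (cong (b ∷_) (superstandard-content β))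

superstandard-∈-fillings : ∀ β → superstandard β ∈ fillings β (length β)
superstandard-∈-fillings β = ∈-fillings β (length β) (superstandard β) (superstandard-shape β) (AllEntries-oneTo⁺ (length β) (superstandard β) (superstandard-positive β) (superstandard-bounded β))

weakInc-head : ∀ h r → weakIncᵇ (h ∷ r) ≡ true → All (h ≤_) r
weakInc-head h [] w = []
weakInc-head h (y ∷ r) w = le ∷ go (weakInc-head y r (proj₂ (∧-elim {h ≤ᵇ y} w)))
  where
  le : h ≤ y
  le = ℕP.≤ᵇ⇒≤ h y (≡true⇒T (proj₁ (∧-elim w)))
  go : ∀ {r} → All (y ≤_) r → All (h ≤_) r
  go [] = []
  go (p ∷ ps) = ℕP.≤-trans le p ∷ go ps

columnAbove⇒entries> : ∀ b T → columnAbove b T ≡ true → all weakIncᵇ T ≡ true → AllEntries (b <_) T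
columnAbove⇒entries> b [] h w = []
columnAbove⇒entries> b ([] ∷ T) h w = [] ∷ columnAbove⇒entries> b T h (proj₂ (∧-elim {true} w))
columnAbove⇒entries> b ((x ∷ r) ∷ T) h w = (bx ∷ go r (weakInc-head x r (proj₁ (∧-elim w)))) ∷ lift (columnAbove⇒entries> x T (proj₂ (∧-elim {b <ᵇ x} h)) (proj₂ (∧-elim {weakIncᵇ (x ∷ r)} w)))
  where
  bx : b < x
  bx = <ᵇ⇒< (proj₁ (∧-elim h))
  go : ∀ r → All (x ≤_) r → All (b <_) r
  go [] [] = []
  go (y ∷ r) (p ∷ ps) = ℕP.<-≤-trans bx p ∷ go r ps
  lift : ∀ {T} → AllEntries (x <_) T → AllEntries (b <_) T
  lift [] = []
  lift (a ∷ as) = go' a ∷ lift as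
    where
    go' : ∀ {r} → All (x <_) r → All (b <_) r
    go' [] = []
    go' (p ∷ ps) = ℕP.<-trans bx p ∷ go' ps

count-all : ∀ i r → count i r ≡ length r → r ≡ replicate (length r) i
count-all i [] h = refl
count-all i (x ∷ r) h with i ≡ᵇ x in e
... | true = cong₂ _∷_ (sym (≡ᵇ⇒≡ e)) (count-all i r (ℕP.suc-injective h))
... | false = ⊥-elim (ℕP.<-irrefl refl (subst (_≤ length r) h (LP.length-filter (λ x → T? (i ≡ᵇ x)) r)))

shift-pred : ∀ T → AllEntries (2 ≤_) T → shiftEntries (map (map pred) T) ≡ T
shift-pred [] [] = refl
shift-pred (r ∷ T) (a ∷ as) = cong₂ _∷_ (go r a) (shift-pred T as)
  where
  go : ∀ r → All (2 ≤_) r → map suc (map pred r) ≡ r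
  go [] [] = refl
  go (suc x ∷ r) (_ ∷ ps) = cong (suc x ∷_) (go r ps)

AllEntries-pred : ∀ {Q Q' : ℕ → Set} T → (∀ x → Q x → Q' (pred x)) → AllEntries Q T → AllEntries Q' (map (map pred) T)
AllEntries-pred [] h [] = []
AllEntries-pred (r ∷ T) h (a ∷ as) = go r a ∷ AllEntries-pred T h as
  where
  go : ∀ r → All _ r → All _ (map pred r)
  go [] [] = []
  go (x ∷ r) (p ∷ ps) = h x p ∷ go r ps

strictInc-tail : ∀ x xs → strictIncᵇ (x ∷ xs) ≡ true → strictIncᵇ xs ≡ true
strictInc-tail x [] h = refl
strictInc-tail x (y ∷ xs) h = proj₂ (∧-elim {x <ᵇ y} h)

content-zeros : ∀ N → content N [] ≡ replicate N 0
content-zeros N = trans (go (oneTo N)) (cong (λ z → replicate z 0) (LP.length-applyUpTo suc N))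
  where
  go : ∀ l → map (λ i → count i []) l ≡ replicate (length l) 0
  go [] = refl
  go (x ∷ l) = cong (0 ∷_) (go l)

immaculate-content-lex : ∀ β γ T → All (0 <_) β → All (0 <_) γ → T ∈ fillings β (length γ) → isImmaculateᵇ T ≡ true →
     content (length γ) T ≡ γ → lexᵇ γ β ≡ true ⊎ (γ ≡ β × T ≡ superstandard β)
immaculate-content-lex [] [] T pβ pγ mT im ct with fillings-shape [] 0 mT
immaculate-content-lex [] [] [] pβ pγ mT im ct | refl = inj₂ (refl , refl)
immaculate-content-lex [] (g ∷ γ) T pβ (pg ∷ pγ) mT im ct with fillings-shape [] (length (g ∷ γ)) mT
immaculate-content-lex [] (g ∷ γ) [] pβ (pg ∷ pγ) mT im ct | refl =
  ⊥-elim (ℕP.<-irrefl (proj₁ (LP.∷-injective (trans (sym (content-zeros (suc (length γ)))) ct))) pg)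
immaculate-content-lex (b ∷ β) [] T pβ pγ mT im ct = inj₁ refl
immaculate-content-lex (b ∷ β) (g ∷ γ) [] (pb ∷ pβ) (pg ∷ pγ) mT im ct with fillings-shape (b ∷ β) (length (g ∷ γ)) mT
... | ()
immaculate-content-lex (b ∷ β) (g ∷ γ) ([] ∷ T'') (pb ∷ pβ) (pg ∷ pγ) mT im ct = ⊥-elim (ℕP.<-irrefl (proj₁ (LP.∷-injective (fillings-shape (b ∷ β) (length (g ∷ γ)) mT))) pb)
immaculate-content-lex (b ∷ β) (g ∷ γ) ((x ∷ r') ∷ T'') (pb ∷ pβ) (pg ∷ pγ) mT im ct = result
  where
  N' = length γ
  r = x ∷ r'
  T = r ∷ T''
  shp = fillings-shape (b ∷ β) (suc N') mT
  a = proj₂ (∈-fillings⁻ (b ∷ β) (suc N') mT)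
  pos = proj₁ (AllEntries-oneTo⁻ (suc N') T a)
  bnd = proj₂ (AllEntries-oneTo⁻ (suc N') T a)
  x1 : 1 ≤ x
  x1 with pos
  ... | (p ∷ _) ∷ _ = p
  wiT = proj₁ (∧-elim im)
  wiT'' : all weakIncᵇ T'' ≡ true
  wiT'' = proj₂ (∧-elim {weakIncᵇ r} wiT)
  Px : columnAbove x T'' ≡ true
  Px = proj₂ (∧-elim {all weakIncᵇ T} im)
  e2 : AllEntries (2 ≤_) T''
  e2 = columnAbove⇒entries> 1 T'' (columnAbove-mono 1 x T'' x1 Px) wiT''
  no1 : 1 ∉ concat T''
  no1 m = ℕP.<-irrefl refl (AllEntries-∈⁻ T'' e2 1 m)
  c1 : countIn T 1 ≡ count 1 r
  c1 = trans (count-++ 1 r (concat T'')) (trans (cong (λ z → count 1 r + z) (∉⇒count≡0 1 (concat T'') no1)) (ℕP.+-identityʳ _))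
  ctsplit : countIn T 1 ∷ map (λ i → countIn T (suc i)) (oneTo N') ≡ g ∷ γ
  ctsplit = trans (cong (countIn T 1 ∷_) (LP.map-∘ (oneTo N'))) (trans (sym (cong (map (countIn T)) (oneTo-suc N'))) ct)
  cg : count 1 r ≡ g
  cg = trans (sym c1) (proj₁ (LP.∷-injective ctsplit))
  lenr : length r ≡ b
  lenr = proj₁ (LP.∷-injective shp)
  g≤b : g ≤ b
  g≤b = subst₂ _≤_ cg lenr (LP.length-filter (λ x → T? (1 ≡ᵇ x)) r)
  result : lexᵇ (g ∷ γ) (b ∷ β) ≡ true ⊎ (g ∷ γ ≡ b ∷ β × T ≡ superstandard (b ∷ β))
  result with g <ᵇ b in elt
  ... | true = inj₁ refl
  ... | false = fin
    where
    gb : g ≡ b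
    gb = ℕP.≤-antisym g≤b (ℕP.≮⇒≥ (λ lt' → false≢true (trans (sym elt) (<⇒<ᵇ lt'))))
    rrep : r ≡ replicate b 1
    rrep = trans (count-all 1 r (trans cg (trans gb (sym lenr)))) (cong (λ z → replicate z 1) lenr)
    T' = map (map pred) T''
    uns : shiftEntries T' ≡ T''
    uns = shift-pred T'' e2
    Teq : T ≡ replicate b 1 ∷ shiftEntries T'
    Teq = cong₂ _∷_ rrep (sym uns)
    posT' : Positive T'
    posT' = AllEntries-pred T'' (λ { (suc (suc y)) _ → s≤s z≤n ; zero () ; (suc zero) (s≤s ()) }) e2
    bndT'' : Bounded (suc N') T''
    bndT'' with bnd
    ... | _ ∷ bs = bs
    bndT' : Bounded N' T'
    bndT' = AllEntries-pred T'' (λ y p → ℕP.≤-trans (ℕP.pred-mono-≤ p) ℕP.≤-refl) bndT''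
    shT' : map length T' ≡ β
    shT' = trans (sym (shape-shift T')) (trans (cong (map length) uns) (proj₂ (LP.∷-injective shp)))
    mT' : T' ∈ fillings β N'
    mT' = ∈-fillings β N' T' shT' (AllEntries-oneTo⁺ N' T' posT' bndT')
    imT'' : isImmaculateᵇ T'' ≡ true
    imT'' = ∧-intro wiT'' (strictInc-tail x (firstCol T'') Px)
    imT' : isImmaculateᵇ T' ≡ true
    imT' = trans (sym (immaculate-shift T')) (trans (cong isImmaculateᵇ uns) imT'')
    ctT' : content N' T' ≡ γ
    ctT' = proj₂ (LP.∷-injective (trans (sym (content-top N' b T' posT')) (trans (cong (content (suc N')) (sym Teq)) ct)))
    fin : (false ∨ ((g ≡ᵇ b) ∧ lexᵇ γ β)) ≡ true ⊎ (g ∷ γ ≡ b ∷ β × T ≡ superstandard (b ∷ β))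
    fin with immaculate-content-lex β γ T' pβ pγ mT' imT' ctT'
    ... | inj₁ l = inj₁ (∧-intro (subst (λ z → (g ≡ᵇ z) ≡ true) gb (≡ᵇ-refl g)) l)
    ... | inj₂ (refl , eT) = inj₂ (cong (_∷ γ) gb , trans Teq (cong (λ Z → replicate b 1 ∷ shiftEntries Z) eT))

head≤partialSums : ∀ b β s → s ∈ partialSums (b ∷ β) → b ≤ s
head≤partialSums b β s (here refl) = ℕP.≤-refl
head≤partialSums b β s (there m) with MP.∈-map⁻ (_+_ b) m
... | t , _ , refl = ℕP.m≤m+n b t

refines⇒lex : ∀ β δ → All (0 <_) β → All (0 <_) δ → sum β ≡ sum δ →
  (∀ s → s ∈ partialSums δ → s ∈ partialSums β) → β ≡ δ ⊎ lexᵇ β δ ≡ true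
refines⇒lex [] [] _ _ _ _ = inj₁ refl
refines⇒lex [] (d ∷ δ) _ _ _ _ = inj₂ refl
refines⇒lex (b ∷ β) [] (pb ∷ _) _ e _ = ⊥-elim (ℕP.<-irrefl (sym e) (ℕP.<-≤-trans pb (ℕP.m≤m+n b (sum β))))
refines⇒lex (b ∷ β) (d ∷ δ) (pb ∷ pβ) (pd ∷ pδ) e sub with b <ᵇ d in e1
... | true = inj₂ refl
... | false = fin
  where
  bd : b ≤ d
  bd = head≤partialSums b β d (sub d (here refl))
  b≡d : b ≡ d
  b≡d = ℕP.≤-antisym bd (ℕP.≮⇒≥ (λ l → false≢true (trans (sym e1) (<⇒<ᵇ l))))
  sub' : ∀ s → s ∈ partialSums δ → s ∈ partialSums β
  sub' s m with sub (d + s) (there (MP.∈-map⁺ (_+_ d) m))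
  ... | here e' = ⊥-elim (ℕP.<-irrefl (sym (trans e' b≡d')) (ℕP.m<m+n d (ps-pos δ pδ s m)))
    where
    b≡d' : b ≡ d
    b≡d' = b≡d
    ps-pos : ∀ δ → All (0 <_) δ → ∀ s → s ∈ partialSums δ → 0 < s
    ps-pos (c ∷ δ) (pc ∷ _) s (here refl) = pc
    ps-pos (c ∷ δ) (pc ∷ _) s (there m) with MP.∈-map⁻ (_+_ c) m
    ... | t , _ , refl = ℕP.<-≤-trans pc (ℕP.m≤m+n c t)
  ... | there m' with MP.∈-map⁻ (_+_ b) m'
  ...   | t , mt , eq = subst (_∈ partialSums β) (sym (ℕP.+-cancelˡ-≡ d s t (trans eq (cong (_+ t) b≡d)))) mt
  fin : (b ∷ β) ≡ (d ∷ δ) ⊎ (false ∨ ((b ≡ᵇ d) ∧ lexᵇ β δ)) ≡ true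
  fin with refines⇒lex β δ pβ pδ (ℕP.+-cancelˡ-≡ b (sum β) (sum δ) (trans e (cong (_+ sum δ) (sym b≡d)))) sub'
  ... | inj₁ eq = inj₁ (cong₂ _∷_ b≡d eq)
  ... | inj₂ l = inj₂ (∧-intro (subst (λ z → (b ≡ᵇ z) ≡ true) b≡d (≡ᵇ-refl b)) l)

nonzeroParts-comp : ∀ γ → All (0 <_) γ → nonzeroParts γ ≡ γ
nonzeroParts-comp [] [] = refl
nonzeroParts-comp (suc x ∷ γ) (_ ∷ p) = cong (suc x ∷_) (nonzeroParts-comp γ p)

all-elem⇒⊆ : ∀ X Y → all (λ s → elem s X) Y ≡ true → ∀ s → s ∈ Y → s ∈ X
all-elem⇒⊆ X (y ∷ Y) h s (here refl) = elem-sound s X (proj₁ (∧-elim h))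
all-elem⇒⊆ X (y ∷ Y) h s (there m) = all-elem⇒⊆ X Y (proj₂ (∧-elim {elem y X} h)) s m

⊆⇒all-elem : ∀ X Y → (∀ s → s ∈ Y → s ∈ X) → all (λ s → elem s X) Y ≡ true
⊆⇒all-elem X [] h = refl
⊆⇒all-elem X (y ∷ Y) h = ∧-intro (elem-complete y X (h y (here refl))) (⊆⇒all-elem X Y (λ s m → h s (there m)))

refinesᵇ-refl : ∀ γ → refinesᵇ γ γ ≡ true
refinesᵇ-refl γ = ∧-intro (≡ᵇ-refl (sum γ)) (⊆⇒all-elem (partialSums γ) (partialSums γ) (λ s m → m))

indℕ : Bool → ℕ
indℕ true = 1
indℕ false = 0

ind≡+indℕ : ∀ b → ind b ≡ + indℕ b
ind≡+indℕ true = refl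
ind≡+indℕ false = refl

sum-map-≥ : {A : Set} (xs : List A) (g : A → ℕ) {a : A} → a ∈ xs → g a ≤ sum (map g xs)
sum-map-≥ (x ∷ xs) g (here refl) = ℕP.m≤m+n (g x) _
sum-map-≥ (x ∷ xs) g (there m) = ℕP.≤-trans (sum-map-≥ xs g m) (ℕP.m≤n+m _ (g x))

sum-map-single : {A : Set} (xs : List A) (g : A → ℕ) (a : A) → Unique xs → a ∈ xs →
  (∀ x → x ∈ xs → x ≢ a → g x ≡ 0) → sum (map g xs) ≡ g a
sum-map-single (x ∷ xs) g a (x∉ ∷ u) (here refl) h =
  trans (cong (λ z → g a + z) (sum-zero xs (λ y m → h y (there m) (λ e → ∉-head x∉ (subst (_∈ xs) e m))))) (ℕP.+-identityʳ _)
  where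
  sum-zero : ∀ ys → (∀ y → y ∈ ys → g y ≡ 0) → sum (map g ys) ≡ 0
  sum-zero [] _ = refl
  sum-zero (y ∷ ys) h′ rewrite h′ y (here refl) = sum-zero ys (λ w m → h′ w (there m))
sum-map-single (x ∷ xs) g a (x∉ ∷ u) (there a∈) h =
  trans (cong (_+ sum (map g xs)) (h x (here refl) (λ e → ∉-head x∉ (subst (_∈ xs) (sym e) a∈))))
        (sum-map-single xs g a u a∈ (λ y y∈ ne → h y (there y∈) ne))

length-filterᵇ-single : {A : Set} (p : A → Bool) (xs : List A) (c : A) → Unique xs → c ∈ xs → p c ≡ true →
  (∀ x → x ∈ xs → p x ≡ true → x ≡ c) → length (filterᵇ p xs) ≡ 1
length-filterᵇ-single p (x ∷ xs) c (x∉ ∷ u) (here refl) pc only rewrite pc = cong suc (filter-none p xs rejected)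
  where
  rejected : ∀ y → y ∈ xs → p y ≡ false
  rejected y y∈ with p y in py
  ... | true = ⊥-elim (∉-head x∉ (subst (_∈ xs) (only y (there y∈) py) y∈))
  ... | false = refl
length-filterᵇ-single p (x ∷ xs) c (x∉ ∷ u) (there c∈) pc only with p x in px
... | true = ⊥-elim (∉-head x∉ (subst (_∈ xs) (sym (only x (here refl) px)) c∈))
... | false = length-filterᵇ-single p xs c u c∈ pc (λ y y∈ py → only y (there y∈) py)

length-filterᵇ-nonempty : {A : Set} (p : A → Bool) (xs : List A) → 1 ≤ length (filterᵇ p xs) → Σ[ x ∈ A ] x ∈ xs × p x ≡ true
length-filterᵇ-nonempty p xs h with filterᵇ p xs in e
... | x ∷ _ = let x∈ , px = ∈-filterᵇ⁻ p (subst (x ∈_) (sym e) (here refl)) in x , x∈ , px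

module _ {n : ℕ} where

  dualImm-at-comp : ∀ {β γ} → β ∈ comps n → γ ∈ comps n →
    dualImm β γ ≡ + sum (map (λ δ → L β δ ℕ.* indℕ (refinesᵇ γ δ)) (comps n))
  dualImm-at-comp {β} {γ} β∈ γ∈ =
    trans (dualImm-expansion n β β∈ γ) (trans (∑-cong′ (comps n) term) (∑-pos (comps n) _))
    where
    term : ∀ δ → + L β δ * F δ γ ≡ + (L β δ ℕ.* indℕ (refinesᵇ γ δ))
    term δ = begin
      + L β δ * F δ γ                           ≡⟨ cong (+ L β δ *_) (F-coefficient δ γ) ⟩
      + L β δ * ind (refinesᵇ (nonzeroParts γ) δ) ≡⟨ cong (λ z → + L β δ * ind (refinesᵇ z δ)) (nonzeroParts-comp γ (proj₁ (∈-comps⁻ n γ∈))) ⟩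
      + L β δ * ind (refinesᵇ γ δ)               ≡⟨ cong (+ L β δ *_) (ind≡+indℕ (refinesᵇ γ δ)) ⟩
      + L β δ * + indℕ (refinesᵇ γ δ)            ≡⟨ sym (ℤP.pos-* (L β δ) _) ⟩
      + (L β δ ℕ.* indℕ (refinesᵇ γ δ))          ∎
      where open ≡-Reasoning

  immaculate-of-content : ∀ {β γ} → β ∈ comps n → γ ∈ comps n → 1 ≤ L β γ →
    Σ[ T ∈ Tableau ] T ∈ fillings β (length γ) × (isImmaculateᵇ T ∧ (content (length γ) T ==ₗ γ)) ≡ true
  immaculate-of-content {β} {γ} β∈ γ∈ L≥1 = length-filterᵇ-nonempty _ (fillings β (length γ)) (begin
    1                                       ≤⟨ L≥1 ⟩
    L β γ                                   ≡⟨ sym (ℕP.*-identityʳ (L β γ)) ⟩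
    L β γ ℕ.* indℕ true                     ≡⟨ cong (λ b → L β γ ℕ.* indℕ b) (sym (refinesᵇ-refl γ)) ⟩
    L β γ ℕ.* indℕ (refinesᵇ γ γ)           ≤⟨ sum-map-≥ (comps n) (λ δ → L β δ ℕ.* indℕ (refinesᵇ γ δ)) γ∈ ⟩
    sum (map (λ δ → L β δ ℕ.* indℕ (refinesᵇ γ δ)) (comps n)) ≡⟨ ℤP.+-injective (sym (dualImm-at-comp β∈ γ∈)) ⟩
    _                                       ∎)
    where open ℕP.≤-Reasoning

  L-support-lex : ∀ {β γ} → β ∈ comps n → γ ∈ comps n → 1 ≤ L β γ → lexᵇ γ β ≡ true ⊎ γ ≡ β
  L-support-lex {β} {γ} β∈ γ∈ L≥1 with immaculate-of-content β∈ γ∈ L≥1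
  ... | T , T∈ , pT with immaculate-content-lex β γ T (proj₁ (∈-comps⁻ n β∈)) (proj₁ (∈-comps⁻ n γ∈)) T∈
                           (proj₁ (∧-elim pT)) (==ₗ⇒≡ (proj₂ (∧-elim {isImmaculateᵇ T} pT)))
  ...   | inj₁ γ<β = inj₁ γ<β
  ...   | inj₂ (γ≡β , _) = inj₂ γ≡β

  edge⇒lex : ∀ {a b} → a ∈ comps n → b ∈ comps n → edgeᵇ a b ≡ true → lexᵇ b a ≡ true
  edge⇒lex {a} {b} a∈ b∈ edge with ∧-elim {not (a ==ₗ b)} edge
  ... | a≠b , L>0 with L-support-lex a∈ b∈ (<ᵇ⇒< L>0)
  ...   | inj₁ b<a = b<a
  ...   | inj₂ refl = ⊥-elim (false≢true (trans (sym (cong not (==ₗ-refl b))) a≠b))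

  dualImm-diagonal : ∀ {β} → β ∈ comps n → dualImm β β ≡ + 1
  dualImm-diagonal {β} β∈ = cong +_ (length-filterᵇ-single _ (fillings β (length β)) (superstandard β)
      (Unique-fillings β (length β)) (superstandard-∈-fillings β)
      (∧-intro (superstandard-immaculate β pos) (≡⇒==ₗ (superstandard-content β))) only-superstandard)
    where
    pos = proj₁ (∈-comps⁻ n β∈)
    only-superstandard : ∀ T → T ∈ fillings β (length β) → (isImmaculateᵇ T ∧ (content (length β) T ==ₗ β)) ≡ true → T ≡ superstandard β
    only-superstandard T T∈ pT with immaculate-content-lex β β T pos pos T∈ (proj₁ (∧-elim pT)) (==ₗ⇒≡ (proj₂ (∧-elim {isImmaculateᵇ T} pT)))
    ... | inj₁ β<β = ⊥-elim (false≢true (trans (sym (lexᵇ-irrefl β)) β<β))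
    ... | inj₂ (_ , T≡) = T≡

  -- Of the terms of dualImm β β = Σ_δ L β δ [β refines δ], only δ = β survives:
  -- refinement pushes δ lexicographically above β, while L β δ ≠ 0 pushes it below.
  L-diagonal : ∀ {β} → β ∈ comps n → L β β ≡ 1
  L-diagonal {β} β∈ = ℤP.+-injective (begin
    + L β β                                 ≡⟨ cong +_ (sym (ℕP.*-identityʳ (L β β))) ⟩
    + (L β β ℕ.* indℕ true)                 ≡⟨ cong (λ b → + (L β β ℕ.* indℕ b)) (sym (refinesᵇ-refl β)) ⟩
    + (L β β ℕ.* indℕ (refinesᵇ β β))       ≡⟨ cong +_ (sym (sum-map-single (comps n) _ β (Unique-comps n) β∈ off-diagonal-vanishes)) ⟩
    + sum (map (λ δ → L β δ ℕ.* indℕ (refinesᵇ β δ)) (comps n)) ≡⟨ sym (dualImm-at-comp β∈ β∈) ⟩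
    dualImm β β                             ≡⟨ dualImm-diagonal β∈ ⟩
    + 1                                     ∎)
    where
    open ≡-Reasoning
    off-diagonal-vanishes : ∀ δ → δ ∈ comps n → δ ≢ β → L β δ ℕ.* indℕ (refinesᵇ β δ) ≡ 0
    off-diagonal-vanishes δ δ∈ δ≢β with refinesᵇ β δ in refines
    ... | false = ℕP.*-zeroʳ (L β δ)
    ... | true with L β δ in Lβδ
    ...   | zero = refl
    ...   | suc _ with L-support-lex β∈ δ∈ (subst (1 ≤_) (sym Lβδ) (s≤s z≤n))
    ...     | inj₂ δ≡β = ⊥-elim (δ≢β δ≡β)
    ...     | inj₁ δ<β with refines⇒lex β δ (proj₁ (∈-comps⁻ n β∈)) (proj₁ (∈-comps⁻ n δ∈))
                           (trans (proj₂ (∈-comps⁻ n β∈)) (sym (proj₂ (∈-comps⁻ n δ∈))))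
                           (all-elem⇒⊆ (partialSums β) (partialSums δ) (proj₂ (∧-elim {sum β ≡ᵇ sum δ} refines)))
    ...       | inj₁ β≡δ = ⊥-elim (δ≢β (sym β≡δ))
    ...       | inj₂ β<δ = ⊥-elim (false≢true (trans (sym (lexᵇ-irrefl β)) (lexᵇ-trans β δ β β<δ δ<β)))

-- Inverting the dual immaculate expansion

∑-reachable : ∀ n α (f : List ℕ → ℤ) →
  ∑ (reachable n α) (λ β → Linv n α β * f β) ≡ ∑ (comps n) (λ β → Linv n α β * f β)
∑-reachable n α f = trans (∑-filter _ (comps n) _) (∑-cong′ (comps n) unreachable-vanishes)
  where
  unreachable-vanishes : ∀ β → (if not (null (paths n α β)) then Linv n α β * f β else + 0) ≡ Linv n α β * f β
  unreachable-vanishes β with paths n α β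
  ... | [] = refl
  ... | _ ∷ _ = refl

F≡∑Linv*dualImm : ∀ {n α} → α ∈ comps n → ∀ e → F α e ≡ ∑ (comps n) (λ β → Linv n α β * dualImm β e)
F≡∑Linv*dualImm {n} {α} α∈ e = begin
  F α e
    ≡⟨ sym (∑-select C α (λ γ → F γ e) (Unique-comps n) α∈) ⟩
  ∑ C (λ γ → if α ==ₗ γ then F γ e else + 0)
    ≡⟨ ∑-cong C (λ γ γ∈ → trans (sym (ind-* (α ==ₗ γ) (F γ e))) (cong (_* F γ e) (sym (Linv-*-L α∈ γ∈)))) ⟩
  ∑ C (λ γ → ∑ C (λ β → Linv n α β * + L β γ) * F γ e)
    ≡⟨ ∑-cong′ C (λ γ → trans (sym (∑-*ʳ C (F γ e) _)) (∑-cong′ C (λ β → ℤP.*-assoc (Linv n α β) _ _))) ⟩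
  ∑ C (λ γ → ∑ C (λ β → Linv n α β * (+ L β γ * F γ e)))
    ≡⟨ ∑-swap C C _ ⟩
  ∑ C (λ β → ∑ C (λ γ → Linv n α β * (+ L β γ * F γ e)))
    ≡⟨ ∑-cong C (λ β β∈ → trans (∑-*ˡ C (Linv n α β) _) (cong (Linv n α β *_) (sym (dualImm-expansion n β β∈ e)))) ⟩
  ∑ C (λ β → Linv n α β * dualImm β e) ∎
  where
  open ≡-Reasoning
  C = comps n
  open UnitriangularInverse n lexᵇ (λ {a} {b} {c} → lexᵇ-trans a b c) lexᵇ-irrefl (L-diagonal {n}) (edge⇒lex {n})
    using (Linv-*-L)

corollary4p31 : (n : ℕ) (α : List ℕ) → IsComp n α →
    (e : List ℕ) → F α e ≡ sumℤ (map (λ β → Linv n α β * dualImm β e) (reachable n α))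
corollary4p31 n α (pos , size) e =
  trans (F≡∑Linv*dualImm {n} (∈-comps⁺ n pos size) e) (sym (∑-reachable n α (λ β → dualImm β e)))
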